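{- For every $k\geq2$, $$H_{12\mbox{ - }3\mbox{ - }\cdots\mbox{ - }k}(x)=\frac{x}{U_k^2\left(\frac{1}{2\sqrt{x}}\right)}\sum_{j=1}^{k-2}U_j^2\left(\frac{1}{2\sqrt{x}}\right)$$ (for $k=2$ the pattern is $12$ and the sum is empty).
   Context: A generalized pattern is a permutation of $\{1,\dots,k\}$ written as a word $\tau_1\cdots\tau_k$ in which each pair of adjacent letters may or may not be separated by a dash "-". An occurrence of $\tau$ in $\pi=\pi_1\cdots\pi_n\in S_n$ is a choice of indices $i_1<\dots<i_k$ with $(\pi_{i_1},\dots,\pi_{i_k})$ order-isomorphic to $(\tau_1,\dots,\tau_k)$ and $i_{j+1}=i_j+1$ whenever $\tau_j,\tau_{j+1}$ are not separated by a dash; $\pi$ avoids $\tau$ if there is no occurrence. $1\mbox{ - }3\mbox{ - }2$ is the classical pattern $132$. $H_\tau(x)=\sum_{n\geq0}h_\tau(n)x^n$ where $h_\tau(n)$ is the number of permutations in $S_n$ avoiding $\tau$ and containing exactly one occurrence of $1\mbox{ - }3\mbox{ - }2$. $U_p$ is the Chebyshev polynomial of the second kind, $U_p(\cos\theta)=\sin((p+1)\theta)/\sin\theta$. -}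

module Defs where

open import Data.Bool using (Bool; true; false; _∧_; _∨_; not; if_then_else_)
open import Data.Nat using (ℕ; zero; suc; _+_; _∸_; _<ᵇ_; _≡ᵇ_; _≤ᵇ_)
open import Data.List using (List; []; _∷_; map; concatMap; length; filterᵇ; applyUpTo; replicate; zip; foldr; upTo)
open import Data.Product using (_×_; _,_; proj₁; proj₂)
open import Data.Integer as ℤ using (ℤ; +_)

allᵇ : {A : Set} → (A → Bool) → List A → Bool
allᵇ p = foldr (λ a b → p a ∧ b) true

anyᵇ : {A : Set} → (A → Bool) → List A → Bool
anyᵇ p = foldr (λ a b → p a ∨ b) false

_==ᵇ_ : Bool → Bool → Bool
true  ==ᵇ b = b
false ==ᵇ b = not b

countᵇ : {A : Set} → (A → Bool) → List A → ℕ
countᵇ p xs = length (filterᵇ p xs)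

words : ℕ → List ℕ → List (List ℕ)
words zero    A = [] ∷ []
words (suc m) A = concatMap (λ a → map (a ∷_) (words m A)) A

distinct : List ℕ → Bool
distinct []       = true
distinct (x ∷ xs) = not (anyᵇ (λ y → x ≡ᵇ y) xs) ∧ distinct xs

oneTo : ℕ → List ℕ
oneTo n = applyUpTo suc n

Sym : ℕ → List (List ℕ)
Sym n = filterᵇ distinct (words n (oneTo n))

-- Generalized patterns: a word τ₁⋯τ_k together with, for each of the
-- k-1 adjacent pairs, a flag telling whether a dash separates them
-- (true = dash, false = the two letters must be adjacent in π).

record GPattern : Set where
  constructor gpat
  field
    letters : List ℕ
    dashes  : List Bool

open GPattern public

subseqs : {A : Set} → List A → List (List A)
subseqs []       = [] ∷ []
subseqs (x ∷ xs) = map (x ∷_) (subseqs xs) Data.List.++ subseqs xs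

-- π with positions attached: (i , πᵢ), positions starting at 1
indexed : List ℕ → List (ℕ × ℕ)
indexed π = zip (oneTo (length π)) π

orderIso : List ℕ → List ℕ → Bool
orderIso xs ys =
  (length xs ≡ᵇ length ys) ∧
  allᵇ (λ p → allᵇ (λ q → (proj₁ p <ᵇ proj₁ q) ==ᵇ (proj₂ p <ᵇ proj₂ q)) ps) ps
  where ps = zip xs ys

adjOK : List ℕ → List Bool → Bool
adjOK (i ∷ j ∷ is) (d ∷ ds) = (d ∨ (j ≡ᵇ suc i)) ∧ adjOK (j ∷ is) ds
adjOK _ _ = true

isOccurrence : GPattern → List (ℕ × ℕ) → Bool
isOccurrence τ s =
  (length s ≡ᵇ length (letters τ)) ∧
  orderIso (map proj₂ s) (letters τ) ∧
  adjOK (map proj₁ s) (dashes τ)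

occ : GPattern → List ℕ → ℕ
occ τ π = countᵇ (isOccurrence τ) (subseqs (indexed π))

avoids : GPattern → List ℕ → Bool
avoids τ π = occ τ π ≡ᵇ 0

p1-3-2 : GPattern
p1-3-2 = gpat (1 ∷ 3 ∷ 2 ∷ []) (true ∷ true ∷ [])

-- the pattern 12-3-⋯-k  (for k = 2 this is 12); intended for k ≥ 2
p12-3-k : ℕ → GPattern
p12-3-k k = gpat (oneTo k) (false ∷ replicate (k ∸ 2) true)

h : GPattern → ℕ → ℕ
h τ n = countᵇ (λ π → avoids τ π ∧ (occ p1-3-2 π ≡ᵇ 1)) (Sym n)

Series : Set
Series = ℕ → ℤ

sumℤ : List ℤ → ℤ
sumℤ = foldr ℤ._+_ (+ 0)

_⊛_ : Series → Series → Series
(f ⊛ g) n = sumℤ (map (λ m → f m ℤ.* g (n ∸ m)) (upTo (suc n)))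

shift : ℕ → Series → Series
shift a f n = if a ≤ᵇ n then f (n ∸ a) else + 0

-- P_j(x) = (√x)^j · U_j(1/(2√x)), a polynomial in x, via the Chebyshev
-- recurrence U_{j+1}(t) = 2t U_j(t) - U_{j-1}(t), U_0 = 1, U_1 = 2t:
-- P_0 = 1, P_1 = 1, P_{j+2} = P_{j+1} - x P_j.
one : Series
one zero    = + 1
one (suc _) = + 0

P : ℕ → Series
P zero          = one
P (suc zero)    = one
P (suc (suc j)) n = P (suc j) n ℤ.- shift 1 (P j) n

rhsNum : ℕ → Series
rhsNum k n = sumℤ (map (λ j → shift (k + 1 ∸ j) (P j ⊛ P j) n) (applyUpTo suc (k ∸ 2)))

H : GPattern → Series
H τ n = + h τ n

module Submission where

open import Defs
open import Algebra.Bundles using (CommutativeRing)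
open import Data.Nat using (ℕ; _≤_)
open import Relation.Binary.PropositionalEquality using (_≡_)

module PowerSeries where

  open import Defs using (Series; _⊛_; shift; one; sumℤ)
  open import Algebra.Bundles using (CommutativeRing)
  import Algebra.Consequences.Setoid as Consequences
  import Algebra.Construct.Pointwise as Pointwise
  open import Algebra.Structures using (IsCommutativeRing)
  open import Data.Integer using (ℤ; +_; _+_; _*_; -_)
  import Data.Integer.Properties as ℤ
  open import Data.Integer.Tactic.RingSolver using (solve-∀)
  open import Data.List.Properties using (map-applyUpTo)
  open import Data.Nat as ℕ using (ℕ; zero; suc)
  open import Function using (_∘_; id)
  open import Relation.Binary.Bundles using (Setoid)
  open import Relation.Binary.PropositionalEquality

  infix 4 _≋_
  _≋_ : Series → Series → Set
  f ≋ g = ∀ n → f n ≡ g n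

  infixl 6 _⊕_
  _⊕_ : Series → Series → Series
  (f ⊕ g) n = f n + g n

  ⊖_ : Series → Series
  (⊖ f) n = - f n

  𝟘 : Series
  𝟘 _ = + 0

  infixr 7 _·_
  _·_ : ℤ → Series → Series
  (c · f) n = c * f n

  tail : Series → Series
  tail f = f ∘ suc

  X : Series → Series
  X = shift 1

  x : Series
  x = X one

  ≋-setoid : Setoid _ _
  ≋-setoid = record
    { Carrier = Series
    ; _≈_ = _≋_
    ; isEquivalence = Pointwise.isEquivalence ℕ isEquivalence
    }

  ⊛-suc : ∀ f g n → (f ⊛ g) (suc n) ≡ f 0 * g (suc n) + (tail f ⊛ g) n
  ⊛-suc f g n = cong (λ l → f 0 * g (suc n) + sumℤ l)
    (trans (map-applyUpTo suc term (suc n)) (sym (map-applyUpTo id (term ∘ suc) (suc n))))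
    where
    term : ℕ → ℤ
    term m = f m * g (suc n ℕ.∸ m)

  ⊛-cong : ∀ {f f′ g g′} → f ≋ f′ → g ≋ g′ → f ⊛ g ≋ f′ ⊛ g′
  ⊛-cong {f} {f′} {g} {g′} f≋f′ g≋g′ zero = cong (_+ + 0) (cong₂ _*_ (f≋f′ 0) (g≋g′ 0))
  ⊛-cong {f} {f′} {g} {g′} f≋f′ g≋g′ (suc n) = begin
    (f ⊛ g) (suc n)                     ≡⟨ ⊛-suc f g n ⟩
    f 0 * g (suc n) + (tail f ⊛ g) n     ≡⟨ cong₂ _+_ (cong₂ _*_ (f≋f′ 0) (g≋g′ (suc n)))
                                                      (⊛-cong (f≋f′ ∘ suc) g≋g′ n) ⟩
    f′ 0 * g′ (suc n) + (tail f′ ⊛ g′) n ≡⟨ ⊛-suc f′ g′ n ⟨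
    (f′ ⊛ g′) (suc n)                   ∎
    where open ≡-Reasoning

  ⊛-zeroˡ : ∀ g → 𝟘 ⊛ g ≋ 𝟘
  ⊛-zeroˡ g zero = refl
  ⊛-zeroˡ g (suc n) = trans (⊛-suc 𝟘 g n) (cong (_+_ (+ 0 * g (suc n))) (⊛-zeroˡ g n))

  ⊛-identityˡ : ∀ g → one ⊛ g ≋ g
  ⊛-identityˡ g zero = trans (ℤ.+-identityʳ _) (ℤ.*-identityˡ (g 0))
  ⊛-identityˡ g (suc n) = begin
    (one ⊛ g) (suc n)                ≡⟨ ⊛-suc one g n ⟩
    + 1 * g (suc n) + (𝟘 ⊛ g) n       ≡⟨ cong (_+_ (+ 1 * g (suc n))) (⊛-zeroˡ g n) ⟩
    + 1 * g (suc n) + + 0            ≡⟨ ℤ.+-identityʳ _ ⟩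
    + 1 * g (suc n)                  ≡⟨ ℤ.*-identityˡ (g (suc n)) ⟩
    g (suc n)                        ∎
    where open ≡-Reasoning

  ⊛-distribʳ : ∀ h f g → (f ⊕ g) ⊛ h ≋ f ⊛ h ⊕ g ⊛ h
  ⊛-distribʳ h f g zero = solve-∀′ (f 0) (g 0) (h 0)
    where
    solve-∀′ : ∀ a b c → (a + b) * c + + 0 ≡ (a * c + + 0) + (b * c + + 0)
    solve-∀′ = solve-∀
  ⊛-distribʳ h f g (suc n) = begin
    ((f ⊕ g) ⊛ h) (suc n)                                       ≡⟨ ⊛-suc (f ⊕ g) h n ⟩
    (f 0 + g 0) * h (suc n) + ((tail f ⊕ tail g) ⊛ h) n          ≡⟨ cong (_+_ ((f 0 + g 0) * h (suc n)))
                                                                       (⊛-distribʳ h (tail f) (tail g) n) ⟩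
    (f 0 + g 0) * h (suc n) + ((tail f ⊛ h) n + (tail g ⊛ h) n)  ≡⟨ rearrange (f 0) (g 0) (h (suc n)) _ _ ⟩
    (f 0 * h (suc n) + (tail f ⊛ h) n) + (g 0 * h (suc n) + (tail g ⊛ h) n)
      ≡⟨ cong₂ _+_ (⊛-suc f h n) (⊛-suc g h n) ⟨
    (f ⊛ h ⊕ g ⊛ h) (suc n)                                     ∎
    where
    open ≡-Reasoning
    rearrange : ∀ a b c d e → (a + b) * c + (d + e) ≡ (a * c + d) + (b * c + e)
    rearrange = solve-∀

  ⊛-scaleˡ : ∀ c f g → (c · f) ⊛ g ≋ c · (f ⊛ g)
  ⊛-scaleˡ c f g zero = solve-∀′ c (f 0) (g 0)
    where
    solve-∀′ : ∀ a b d → (a * b) * d + + 0 ≡ a * (b * d + + 0)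
    solve-∀′ = solve-∀
  ⊛-scaleˡ c f g (suc n) = begin
    ((c · f) ⊛ g) (suc n)                            ≡⟨ ⊛-suc (c · f) g n ⟩
    (c * f 0) * g (suc n) + ((c · tail f) ⊛ g) n     ≡⟨ cong (_+_ ((c * f 0) * g (suc n))) (⊛-scaleˡ c (tail f) g n) ⟩
    (c * f 0) * g (suc n) + c * (tail f ⊛ g) n       ≡⟨ rearrange c (f 0) (g (suc n)) _ ⟩
    c * (f 0 * g (suc n) + (tail f ⊛ g) n)           ≡⟨ cong (c *_) (⊛-suc f g n) ⟨
    (c · (f ⊛ g)) (suc n)                            ∎
    where
    open ≡-Reasoning
    rearrange : ∀ a b d e → (a * b) * d + a * e ≡ a * (b * d + e)
    rearrange = solve-∀

  -- Peeling the last term off instead of the first, as needed for commutativity.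
  ⊛-sucʳ : ∀ f g n → (f ⊛ g) (suc n) ≡ (f ⊛ tail g) n + f (suc n) * g 0
  ⊛-sucʳ f g zero = solve-∀′ (f 0) (f 1) (g 0) (g 1)
    where
    solve-∀′ : ∀ a b c d → a * d + (b * c + + 0) ≡ (a * d + + 0) + b * c
    solve-∀′ = solve-∀
  ⊛-sucʳ f g (suc n) = begin
    (f ⊛ g) (suc (suc n))                                               ≡⟨ ⊛-suc f g (suc n) ⟩
    f 0 * g (2 ℕ.+ n) + (tail f ⊛ g) (suc n)                       ≡⟨ cong (_+_ (f 0 * g (2 ℕ.+ n))) (⊛-sucʳ (tail f) g n) ⟩
    f 0 * g (2 ℕ.+ n) + ((tail f ⊛ tail g) n + f (2 ℕ.+ n) * g 0) ≡⟨ ℤ.+-assoc (f 0 * g (2 ℕ.+ n)) _ _ ⟨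
    (f 0 * g (2 ℕ.+ n) + (tail f ⊛ tail g) n) + f (2 ℕ.+ n) * g 0 ≡⟨ cong (_+ f (2 ℕ.+ n) * g 0) (⊛-suc f (tail g) n) ⟨
    (f ⊛ tail g) (suc n) + f (2 ℕ.+ n) * g 0                      ∎
    where open ≡-Reasoning

  ⊛-comm : ∀ f g → f ⊛ g ≋ g ⊛ f
  ⊛-comm f g zero = cong (_+ + 0) (ℤ.*-comm (f 0) (g 0))
  ⊛-comm f g (suc n) = begin
    (f ⊛ g) (suc n)                       ≡⟨ ⊛-suc f g n ⟩
    f 0 * g (suc n) + (tail f ⊛ g) n       ≡⟨ cong (_+_ (f 0 * g (suc n))) (⊛-comm (tail f) g n) ⟩
    f 0 * g (suc n) + (g ⊛ tail f) n       ≡⟨ ℤ.+-comm (f 0 * g (suc n)) _ ⟩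
    (g ⊛ tail f) n + f 0 * g (suc n)       ≡⟨ cong (_+_ ((g ⊛ tail f) n)) (ℤ.*-comm (f 0) (g (suc n))) ⟩
    (g ⊛ tail f) n + g (suc n) * f 0       ≡⟨ ⊛-sucʳ g f n ⟨
    (g ⊛ f) (suc n)                       ∎
    where open ≡-Reasoning

  ⊛-assoc : ∀ f g h → (f ⊛ g) ⊛ h ≋ f ⊛ (g ⊛ h)
  ⊛-assoc f g h zero = solve-∀′ (f 0) (g 0) (h 0)
    where
    solve-∀′ : ∀ a b c → (a * b + + 0) * c + + 0 ≡ a * (b * c + + 0) + + 0
    solve-∀′ = solve-∀
  ⊛-assoc f g h (suc n) = begin
    ((f ⊛ g) ⊛ h) (suc n)
      ≡⟨ ⊛-suc (f ⊛ g) h n ⟩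
    (f 0 * g 0 + + 0) * h (suc n) + (tail (f ⊛ g) ⊛ h) n
      ≡⟨ cong (_+_ ((f 0 * g 0 + + 0) * h (suc n))) tail-step ⟩
    (f 0 * g 0 + + 0) * h (suc n) + (f 0 * (tail g ⊛ h) n + (tail f ⊛ (g ⊛ h)) n)
      ≡⟨ rearrange (f 0) (g 0) (h (suc n)) _ _ ⟩
    f 0 * (g 0 * h (suc n) + (tail g ⊛ h) n) + (tail f ⊛ (g ⊛ h)) n
      ≡⟨ cong (λ t → f 0 * t + (tail f ⊛ (g ⊛ h)) n) (⊛-suc g h n) ⟨
    f 0 * (g ⊛ h) (suc n) + (tail f ⊛ (g ⊛ h)) n
      ≡⟨ ⊛-suc f (g ⊛ h) n ⟨
    (f ⊛ (g ⊛ h)) (suc n)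
      ∎
    where
    open ≡-Reasoning
    rearrange : ∀ a b c d e → (a * b + + 0) * c + (a * d + e) ≡ a * (b * c + d) + e
    rearrange = solve-∀
    tail-step : (tail (f ⊛ g) ⊛ h) n ≡ f 0 * (tail g ⊛ h) n + (tail f ⊛ (g ⊛ h)) n
    tail-step = begin
      (tail (f ⊛ g) ⊛ h) n                       ≡⟨ ⊛-cong {g = h} {g′ = h} (⊛-suc f g) (λ _ → refl) n ⟩
      ((f 0 · tail g ⊕ tail f ⊛ g) ⊛ h) n         ≡⟨ ⊛-distribʳ h (f 0 · tail g) (tail f ⊛ g) n ⟩
      ((f 0 · tail g) ⊛ h) n + ((tail f ⊛ g) ⊛ h) n
        ≡⟨ cong₂ _+_ (⊛-scaleˡ (f 0) (tail g) h n) (⊛-assoc (tail f) g h n) ⟩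
      f 0 * (tail g ⊛ h) n + (tail f ⊛ (g ⊛ h)) n ∎

  ⊕-cong : ∀ {f f′ g g′} → f ≋ f′ → g ≋ g′ → f ⊕ g ≋ f′ ⊕ g′
  ⊕-cong f≋f′ g≋g′ n = cong₂ _+_ (f≋f′ n) (g≋g′ n)

  ⊛-isCommutativeRing : IsCommutativeRing _≋_ _⊕_ _⊛_ ⊖_ 𝟘 one
  ⊛-isCommutativeRing = record
    { isRing = record
      { +-isAbelianGroup = Pointwise.isAbelianGroup ℕ ℤ.+-0-isAbelianGroup
      ; *-cong = ⊛-cong
      ; *-assoc = ⊛-assoc
      ; *-identity = Consequences.comm∧idˡ⇒id ≋-setoid ⊛-comm ⊛-identityˡ
      ; distrib = Consequences.comm∧distrʳ⇒distr ≋-setoid {_⊛_} {_⊕_} ⊕-cong ⊛-comm ⊛-distribʳ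
      }
    ; *-comm = ⊛-comm
    }

  ⊛-commutativeRing : CommutativeRing _ _
  ⊛-commutativeRing = record { isCommutativeRing = ⊛-isCommutativeRing }

  X-cong : ∀ {f g} → f ≋ g → X f ≋ X g
  X-cong f≋g zero = refl
  X-cong f≋g (suc n) = f≋g n

  X≋x⊛ : ∀ f → X f ≋ x ⊛ f
  X≋x⊛ f zero = refl
  X≋x⊛ f (suc n) = sym (begin
    (x ⊛ f) (suc n)            ≡⟨ ⊛-suc x f n ⟩
    + 0 * f (suc n) + (one ⊛ f) n ≡⟨ cong (_+_ (+ 0 * f (suc n))) (⊛-identityˡ f n) ⟩
    + 0 + f n                   ≡⟨ ℤ.+-identityˡ (f n) ⟩
    f n                         ∎)
    where open ≡-Reasoning

module RecurrenceSteps {c ℓ} (R : CommutativeRing c ℓ) where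

  open CommutativeRing R
  open import Algebra.Properties.AbelianGroup +-abelianGroup using (∙-cancelˡ; ∙-cancelʳ)
  open import Data.Maybe using (nothing)
  open import Relation.Binary.Reasoning.Setoid setoid

  -- Everything is kept subtraction-free, so that the ℕ-coefficient solver applies;
  -- the ring structure is used only to cancel summands.
  open import Algebra.Solver.Ring.NaturalCoefficients commutativeSemiring (λ _ _ → nothing)

  module _ {x p₀ p₁ p₂ a : Carrier} (p-rec : p₂ + x * p₀ ≈ p₁) (p₁a≈p₀ : p₁ * a ≈ p₀) where

    ratio-step : ∀ {b} → b ≈ 1# + x * (a * b) → p₂ * b ≈ p₁
    ratio-step {b} b-eq = ∙-cancelʳ (x * (p₀ * b)) _ _ (begin
      p₂ * b + x * (p₀ * b)       ≈⟨ solve 4 (λ p₂ x p₀ b → p₂ :* b :+ x :* (p₀ :* b) := (p₂ :+ x :* p₀) :* b) refl p₂ x p₀ b ⟩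
      (p₂ + x * p₀) * b           ≈⟨ *-congʳ p-rec ⟩
      p₁ * b                      ≈⟨ *-congˡ b-eq ⟩
      p₁ * (1# + x * (a * b))     ≈⟨ solve 4 (λ p₁ x a b → p₁ :* (con 1 :+ x :* (a :* b)) := p₁ :+ x :* ((p₁ :* a) :* b))
                                           refl p₁ x a b ⟩
      p₁ + x * ((p₁ * a) * b)     ≈⟨ +-congˡ (*-congˡ (*-congʳ p₁a≈p₀)) ⟩
      p₁ + x * (p₀ * b)           ∎)

    module _ {b b⁺ g h : Carrier} (p₂b≈p₁ : p₂ * b ≈ p₁) (b⁺-eq : b⁺ + 1# ≈ b)
             (h-eq : h ≈ x * (g * b) + x * (a * h) + x * (x * (a * b⁺))) where

      private
        p₂h≈ : p₂ * h ≈ x * (p₁ * (g * b)) + x * (x * (p₀ * b⁺))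
        p₂h≈ = ∙-cancelʳ (x * (p₀ * h)) _ _ (begin
          p₂ * h + x * (p₀ * h)
            ≈⟨ solve 4 (λ p₂ x p₀ h → p₂ :* h :+ x :* (p₀ :* h) := (p₂ :+ x :* p₀) :* h) refl p₂ x p₀ h ⟩
          (p₂ + x * p₀) * h
            ≈⟨ *-congʳ p-rec ⟩
          p₁ * h
            ≈⟨ *-congˡ h-eq ⟩
          p₁ * (x * (g * b) + x * (a * h) + x * (x * (a * b⁺)))
            ≈⟨ solve 7 (λ p₁ x g b a h b⁺ → p₁ :* (x :* (g :* b) :+ x :* (a :* h) :+ x :* (x :* (a :* b⁺)))
                          := x :* (p₁ :* (g :* b)) :+ x :* (x :* ((p₁ :* a) :* b⁺)) :+ x :* ((p₁ :* a) :* h))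
                       refl p₁ x g b a h b⁺ ⟩
          x * (p₁ * (g * b)) + x * (x * ((p₁ * a) * b⁺)) + x * ((p₁ * a) * h)
            ≈⟨ +-cong (+-congˡ (*-congˡ (*-congˡ (*-congʳ p₁a≈p₀)))) (*-congˡ (*-congʳ p₁a≈p₀)) ⟩
          x * (p₁ * (g * b)) + x * (x * (p₀ * b⁺)) + x * (p₀ * h)
            ∎)

        p₂b⁺≈ : p₂ * b⁺ ≈ x * p₀
        p₂b⁺≈ = ∙-cancelˡ p₂ _ _ (begin
          p₂ + p₂ * b⁺     ≈⟨ solve 2 (λ p₂ b⁺ → p₂ :+ p₂ :* b⁺ := p₂ :* (b⁺ :+ con 1)) refl p₂ b⁺ ⟩
          p₂ * (b⁺ + 1#)   ≈⟨ *-congˡ b⁺-eq ⟩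
          p₂ * b           ≈⟨ p₂b≈p₁ ⟩
          p₁               ≈⟨ p-rec ⟨
          p₂ + x * p₀      ∎)

      weighted-step : p₂ * (p₂ * h) ≈ x * (p₁ * (p₁ * g)) + x * (x * (x * (p₀ * p₀)))
      weighted-step = begin
        p₂ * (p₂ * h)
          ≈⟨ *-congˡ p₂h≈ ⟩
        p₂ * (x * (p₁ * (g * b)) + x * (x * (p₀ * b⁺)))
          ≈⟨ solve 7 (λ p₂ x p₁ g b p₀ b⁺ → p₂ :* (x :* (p₁ :* (g :* b)) :+ x :* (x :* (p₀ :* b⁺)))
                        := x :* (p₁ :* g) :* (p₂ :* b) :+ x :* x :* p₀ :* (p₂ :* b⁺))
                     refl p₂ x p₁ g b p₀ b⁺ ⟩
        x * (p₁ * g) * (p₂ * b) + x * x * p₀ * (p₂ * b⁺)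
          ≈⟨ +-cong (*-congˡ p₂b≈p₁) (*-congˡ p₂b⁺≈) ⟩
        x * (p₁ * g) * p₁ + x * x * p₀ * (x * p₀)
          ≈⟨ solve 4 (λ p₁ x g p₀ → x :* (p₁ :* g) :* p₁ :+ x :* x :* p₀ :* (x :* p₀)
                                    := x :* (p₁ :* (p₁ :* g)) :+ x :* (x :* (x :* (p₀ :* p₀)))) refl p₁ x g p₀ ⟩
        x * (p₁ * (p₁ * g)) + x * (x * (x * (p₀ * p₀)))
          ∎

module Booleans where

  open import Data.Bool using (Bool; true; false; T; _∧_; _∨_)
  open import Data.Empty using (⊥-elim)
  open import Data.Nat using (ℕ; zero; suc; _+_; _<_; _≤_; _<ᵇ_; _≡ᵇ_)
  open import Data.Nat.Properties using (<⇒<ᵇ; <ᵇ⇒<; ≡ᵇ⇒≡; <-irrefl; ≤⇒≯; ≮⇒≥; suc-injective)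
  open import Data.Product using (_×_; _,_)
  open import Data.Sum using (_⊎_; inj₁; inj₂)
  open import Data.Unit using (tt)
  open import Function using (case_of_)
  open import Relation.Binary.PropositionalEquality
  open import Relation.Nullary using (¬_)

  T⇒≡true : ∀ {b} → T b → b ≡ true
  T⇒≡true {true} _ = refl

  ≡true⇒T : ∀ {b} → b ≡ true → T b
  ≡true⇒T refl = tt

  ¬T⇒≡false : ∀ {b} → ¬ T b → b ≡ false
  ¬T⇒≡false {true} ¬t = ⊥-elim (¬t tt)
  ¬T⇒≡false {false} _ = refl

  T-∧ˡ : ∀ a b → T (a ∧ b) → T a
  T-∧ˡ true _ _ = tt

  T-∧ʳ : ∀ a b → T (a ∧ b) → T b
  T-∧ʳ true _ t = t

  T-∧⁺ : ∀ {a b} → T a → T b → T (a ∧ b)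
  T-∧⁺ {true} _ t = t

  T-ext : ∀ a b → (T a → T b) → (T b → T a) → a ≡ b
  T-ext true true _ _ = refl
  T-ext true false to _ = ⊥-elim (to tt)
  T-ext false true _ from = ⊥-elim (from tt)
  T-ext false false _ _ = refl

  ∨-false⁻ : ∀ a b → a ∨ b ≡ false → a ≡ false × b ≡ false
  ∨-false⁻ false _ b≡false = refl , b≡false

  <ᵇ-true : ∀ {m n} → m < n → (m <ᵇ n) ≡ true
  <ᵇ-true m<n = T⇒≡true (<⇒<ᵇ m<n)

  <ᵇ-false : ∀ {m n} → ¬ m < n → (m <ᵇ n) ≡ false
  <ᵇ-false {m} {n} m≮n = ¬T⇒≡false (λ t → m≮n (<ᵇ⇒< m n t))

  <ᵇ-false-≤ : ∀ {m n} → n ≤ m → (m <ᵇ n) ≡ false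
  <ᵇ-false-≤ n≤m = <ᵇ-false (≤⇒≯ n≤m)

  <ᵇ-irrefl : ∀ n → (n <ᵇ n) ≡ false
  <ᵇ-irrefl n = <ᵇ-false {n} (<-irrefl refl)

  <ᵇ-false⇒≥ : ∀ {m n} → (m <ᵇ n) ≡ false → n ≤ m
  <ᵇ-false⇒≥ eq = ≮⇒≥ (λ m<n → case trans (sym eq) (<ᵇ-true m<n) of λ ())

  ≡ᵇ-refl : ∀ n → (n ≡ᵇ n) ≡ true
  ≡ᵇ-refl zero = refl
  ≡ᵇ-refl (suc n) = ≡ᵇ-refl n

  ≡ᵇ-false : ∀ {m n} → m ≢ n → (m ≡ᵇ n) ≡ false
  ≡ᵇ-false {m} {n} m≢n = ¬T⇒≡false (λ t → m≢n (≡ᵇ⇒≡ m n t))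

  +≡0⁻ : ∀ a b → a + b ≡ 0 → a ≡ 0 × b ≡ 0
  +≡0⁻ zero _ b≡0 = refl , b≡0

  +≡1⁻ : ∀ a b → a + b ≡ 1 → (a ≡ 0 × b ≡ 1) ⊎ (a ≡ 1 × b ≡ 0)
  +≡1⁻ zero _ b≡1 = inj₁ (refl , b≡1)
  +≡1⁻ (suc zero) _ 1+b≡1 = inj₂ (refl , suc-injective 1+b≡1)

module Counting where

  open import Defs using (countᵇ; subseqs)
  open import Data.Bool using (Bool; true; false; T; T?)
  open import Data.Empty using (⊥; ⊥-elim)
  open import Data.List using (List; []; _∷_; _++_; map; length; filterᵇ; concatMap; upTo)
  open import Data.Nat.ListAction using (sum)
  open import Data.List.Membership.Propositional using (_∈_; _∉_; lose; find)
  open import Data.List.Membership.Propositional.Properties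
    using (∈-filter⁺; ∈-filter⁻; ∈-map⁺; ∈-map⁻; ∈-++⁺ˡ; ∈-++⁺ʳ; ∈-++⁻; ∈-∃++; ∈-concatMap⁺; ∈-concatMap⁻; ∈-upTo⁺; ∈-upTo⁻)
  import Data.List.Properties as List
  open import Data.List.Relation.Unary.All as All using (All; []; _∷_)
  import Data.List.Relation.Unary.All.Properties as All
  open import Data.List.Relation.Unary.Any using (here; there)
  open import Data.List.Relation.Unary.Unique.Propositional using (Unique; []; _∷_)
  import Data.List.Relation.Unary.Unique.Propositional.Properties as Unique
  open import Data.Nat using (ℕ; zero; suc; _+_; _*_; _<_; _≤_; z≤n; s≤s; _≟_)
  open import Data.Nat.Properties using (≤-antisym; ≤-refl; ≤-trans; <-irrefl; <-trans; <⇒≱; n<1+n; +-suc; m≤m+n; ≤∧≢⇒<; +-identityʳ; module ≤-Reasoning)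
  open import Data.Product using (_×_; _,_; proj₁; proj₂; ∃-syntax)
  import Data.Product.Properties as Product
  open import Data.Sum using (inj₁; inj₂)
  open import Function using (_∘_; case_of_)
  open import Relation.Nullary using (yes; no)
  open import Relation.Binary.PropositionalEquality

  private
    variable
      A B : Set

  countᵇ-++ : ∀ (p : A → Bool) xs ys → countᵇ p (xs ++ ys) ≡ countᵇ p xs + countᵇ p ys
  countᵇ-++ p [] ys = refl
  countᵇ-++ p (x ∷ xs) ys with p x
  ... | true = cong suc (countᵇ-++ p xs ys)
  ... | false = countᵇ-++ p xs ys

  countᵇ-map : ∀ (p : B → Bool) (f : A → B) xs → countᵇ p (map f xs) ≡ countᵇ (p ∘ f) xs
  countᵇ-map p f [] = refl
  countᵇ-map p f (x ∷ xs) with p (f x)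
  ... | true = cong suc (countᵇ-map p f xs)
  ... | false = countᵇ-map p f xs

  countᵇ-cong-All : ∀ {p q : A → Bool} xs → All (λ x → p x ≡ q x) xs → countᵇ p xs ≡ countᵇ q xs
  countᵇ-cong-All [] [] = refl
  countᵇ-cong-All {p = p} {q} (x ∷ xs) (px≡qx ∷ eqs) with p x | q x
  ... | true  | true  = cong suc (countᵇ-cong-All xs eqs)
  ... | false | false = countᵇ-cong-All xs eqs
  ... | true  | false = case px≡qx of λ ()
  ... | false | true  = case px≡qx of λ ()

  countᵇ-cong : ∀ {p q : A → Bool} xs → (∀ x → p x ≡ q x) → countᵇ p xs ≡ countᵇ q xs
  countᵇ-cong xs p≗q = countᵇ-cong-All xs (All.tabulate (λ {x} _ → p≗q x))

  countᵇ-false : ∀ (xs : List A) → countᵇ (λ _ → false) xs ≡ 0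
  countᵇ-false [] = refl
  countᵇ-false (x ∷ xs) = countᵇ-false xs

  countᵇ-none : ∀ (p : A → Bool) xs → (∀ {x} → x ∈ xs → p x ≡ false) → countᵇ p xs ≡ 0
  countᵇ-none p xs none = trans (countᵇ-cong-All xs (All.tabulate none)) (countᵇ-false xs)

  countᵇ-subseqs-∷ : ∀ (p : List A → Bool) a as →
    countᵇ p (subseqs (a ∷ as)) ≡ countᵇ (p ∘ (a ∷_)) (subseqs as) + countᵇ p (subseqs as)
  countᵇ-subseqs-∷ p a as = trans (countᵇ-++ p (map (a ∷_) (subseqs as)) (subseqs as))
                                   (cong (_+ countᵇ p (subseqs as)) (countᵇ-map p (a ∷_) (subseqs as)))

  Unique-⊆⇒length≤ : ∀ (xs ys : List A) → Unique xs → (∀ {x} → x ∈ xs → x ∈ ys) → length xs ≤ length ys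
  Unique-⊆⇒length≤ [] ys _ _ = z≤n
  Unique-⊆⇒length≤ (x ∷ xs) ys (x∉xs ∷ xs!) xs⊆ys with ∈-∃++ (xs⊆ys (here refl))
  ... | ys₁ , ys₂ , refl = begin
    suc (length xs)                  ≤⟨ s≤s (Unique-⊆⇒length≤ xs (ys₁ ++ ys₂) xs! xs⊆ys₁++ys₂) ⟩
    suc (length (ys₁ ++ ys₂))        ≡⟨ cong suc (List.length-++ ys₁) ⟩
    suc (length ys₁ + length ys₂)    ≡⟨ +-suc (length ys₁) (length ys₂) ⟨
    length ys₁ + length (x ∷ ys₂)    ≡⟨ List.length-++ ys₁ ⟨
    length (ys₁ ++ x ∷ ys₂)          ∎
    where
    open ≤-Reasoning
    xs⊆ys₁++ys₂ : ∀ {z} → z ∈ xs → z ∈ ys₁ ++ ys₂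
    xs⊆ys₁++ys₂ z∈xs with ∈-++⁻ ys₁ (xs⊆ys (there z∈xs))
    ... | inj₁ z∈ys₁ = ∈-++⁺ˡ z∈ys₁
    ... | inj₂ (here refl) = ⊥-elim (All.lookup x∉xs z∈xs refl)
    ... | inj₂ (there z∈ys₂) = ∈-++⁺ʳ ys₁ z∈ys₂

  Unique-map⁺-on : ∀ (f : A → B) ys → Unique ys →
    (∀ {y y′} → y ∈ ys → y′ ∈ ys → f y ≡ f y′ → y ≡ y′) → Unique (map f ys)
  Unique-map⁺-on f [] _ _ = []
  Unique-map⁺-on f (y ∷ ys) (y∉ys ∷ ys!) inj =
    All.map⁺ (All.tabulate (λ y′∈ys fy≡fy′ → All.lookup y∉ys y′∈ys (inj (here refl) (there y′∈ys) fy≡fy′)))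
    ∷ Unique-map⁺-on f ys ys! (λ y∈ y′∈ → inj (there y∈) (there y′∈))

  countᵇ-bijection : ∀ (p : A → Bool) xs (ys : List B) (f : B → A) → Unique xs → Unique ys →
    (∀ {y} → y ∈ ys → f y ∈ xs × T (p (f y))) →
    (∀ {x} → x ∈ xs → T (p x) → ∃[ y ] (y ∈ ys × f y ≡ x)) →
    (∀ {y y′} → y ∈ ys → y′ ∈ ys → f y ≡ f y′ → y ≡ y′) →
    countᵇ p xs ≡ length ys
  countᵇ-bijection p xs ys f xs! ys! into onto inj = ≤-antisym
    (subst (length (filterᵇ p xs) ≤_) (List.length-map f ys)
      (Unique-⊆⇒length≤ (filterᵇ p xs) (map f ys) (Unique.filter⁺ (T? ∘ p) xs!) filtered⊆image))
    (subst (_≤ length (filterᵇ p xs)) (List.length-map f ys)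
      (Unique-⊆⇒length≤ (map f ys) (filterᵇ p xs) (Unique-map⁺-on f ys ys! inj) image⊆filtered))
    where
    filtered⊆image : ∀ {x} → x ∈ filterᵇ p xs → x ∈ map f ys
    filtered⊆image x∈ with ∈-filter⁻ (T? ∘ p) x∈
    ... | x∈xs , px with onto x∈xs px
    ... | y , y∈ys , refl = ∈-map⁺ f y∈ys
    image⊆filtered : ∀ {x} → x ∈ map f ys → x ∈ filterᵇ p xs
    image⊆filtered x∈ with ∈-map⁻ f x∈
    ... | y , y∈ys , refl = ∈-filter⁺ (T? ∘ p) (proj₁ (into y∈ys)) (proj₂ (into y∈ys))

  range : ℕ → ℕ → List ℕ
  range lo zero = []
  range lo (suc k) = suc lo ∷ range (suc lo) k

  length-range : ∀ lo k → length (range lo k) ≡ k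
  length-range lo zero = refl
  length-range lo (suc k) = cong suc (length-range (suc lo) k)

  ∈-range⁻ : ∀ lo k {v} → v ∈ range lo k → lo < v × v ≤ lo + k
  ∈-range⁻ lo (suc k) (here refl) = ≤-refl , subst (suc lo ≤_) (sym (+-suc lo k)) (s≤s (m≤m+n lo k))
  ∈-range⁻ lo (suc k) {v} (there v∈) with ∈-range⁻ (suc lo) k v∈
  ... | lo<v , v≤ = <-trans (n<1+n lo) lo<v , subst (v ≤_) (sym (+-suc lo k)) v≤

  ∈-range⁺ : ∀ lo k {v} → lo < v → v ≤ lo + k → v ∈ range lo k
  ∈-range⁺ lo zero {v} lo<v v≤lo+0 = ⊥-elim (<⇒≱ lo<v (subst (v ≤_) (+-identityʳ lo) v≤lo+0))
  ∈-range⁺ lo (suc k) {v} lo<v v≤ with v ≟ suc lo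
  ... | yes refl = here refl
  ... | no v≢ = there (∈-range⁺ (suc lo) k (≤∧≢⇒< lo<v (v≢ ∘ sym)) (subst (v ≤_) (+-suc lo k) v≤))

  Unique-range : ∀ lo k → Unique (range lo k)
  Unique-range lo zero = []
  Unique-range lo (suc k) =
    All.tabulate (λ v∈ eq → <-irrefl eq (proj₁ (∈-range⁻ (suc lo) k v∈))) ∷ Unique-range (suc lo) k

  pigeonhole : ∀ lo k xs → Unique xs → All (λ v → lo < v × v ≤ lo + k) xs → length xs ≤ k
  pigeonhole lo k xs xs! bounded = subst (length xs ≤_) (length-range lo k)
    (Unique-⊆⇒length≤ xs (range lo k) xs! (λ v∈ → let lo<v , v≤ = All.lookup bounded v∈ in ∈-range⁺ lo k lo<v v≤))

  Unique-++⁻ : ∀ (xs : List A) {ys} → Unique (xs ++ ys) → Unique xs × Unique ys × All (λ x → All (x ≢_) ys) xs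
  Unique-++⁻ [] ys! = [] , ys! , []
  Unique-++⁻ (x ∷ xs) (x∉ ∷ xs++ys!) with Unique-++⁻ xs xs++ys!
  ... | xs! , ys! , disjoint = All.++⁻ˡ xs x∉ ∷ xs! , ys! , All.++⁻ʳ xs x∉ ∷ disjoint

  Unique-++⁺ : ∀ (xs : List A) {ys} → Unique xs → Unique ys → All (λ x → All (x ≢_) ys) xs → Unique (xs ++ ys)
  Unique-++⁺ [] _ ys! _ = ys!
  Unique-++⁺ (x ∷ xs) (x∉xs ∷ xs!) ys! (x∉ys ∷ disjoint) = All.++⁺ x∉xs x∉ys ∷ Unique-++⁺ xs xs! ys! disjoint

  Unique-middle-∉ : ∀ (v : A) L R → Unique (L ++ v ∷ R) → v ∉ L
  Unique-middle-∉ v L R L++v∷R! v∈L = All.head (All.lookup (proj₂ (proj₂ (Unique-++⁻ L L++v∷R!))) v∈L) refl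

  ++-∷-cancel : ∀ (v : A) L R L′ R′ → L ++ v ∷ R ≡ L′ ++ v ∷ R′ → v ∉ L → v ∉ L′ → L ≡ L′ × R ≡ R′
  ++-∷-cancel v [] R [] R′ eq _ _ = refl , proj₂ (List.∷-injective eq)
  ++-∷-cancel v [] R (x ∷ L′) R′ eq _ v∉L′ = ⊥-elim (v∉L′ (here (proj₁ (List.∷-injective eq))))
  ++-∷-cancel v (x ∷ L) R [] R′ eq v∉L _ = ⊥-elim (v∉L (here (sym (proj₁ (List.∷-injective eq)))))
  ++-∷-cancel v (x ∷ L) R (x′ ∷ L′) R′ eq v∉L v∉L′ with List.∷-injective eq
  ... | refl , eq′ with ++-∷-cancel v L R L′ R′ eq′ (v∉L ∘ there) (v∉L′ ∘ there)
  ... | refl , refl = refl , refl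

  map-injective-on : ∀ (f : A → B) (Q : A → Set) xs ys → All Q xs → All Q ys →
    (∀ a b → Q a → Q b → f a ≡ f b → a ≡ b) → map f xs ≡ map f ys → xs ≡ ys
  map-injective-on f Q [] [] _ _ _ _ = refl
  map-injective-on f Q (x ∷ xs) (y ∷ ys) (qx ∷ qxs) (qy ∷ qys) inj eq with List.∷-injective eq
  ... | fx≡fy , eq′ = cong₂ _∷_ (inj x y qx qy fx≡fy) (map-injective-on f Q xs ys qxs qys inj eq′)

  Unique-concatMap⁺ : ∀ (key : B → A) (f : A → List B) xs → Unique xs → (∀ x → Unique (f x)) →
    (∀ {x y} → y ∈ f x → key y ≡ x) → Unique (concatMap f xs)
  Unique-concatMap⁺ key f [] _ _ _ = []
  Unique-concatMap⁺ key f (x ∷ xs) (x∉xs ∷ xs!) f! keyed =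
    Unique.++⁺ (f! x) (Unique-concatMap⁺ key f xs xs! f! keyed) disjoint
    where
    disjoint : ∀ {y} → y ∈ f x × y ∈ concatMap f xs → ⊥
    disjoint (y∈fx , y∈rest) with find (∈-concatMap⁻ f y∈rest)
    ... | x′ , x′∈xs , y∈fx′ = All.lookup x∉xs x′∈xs (trans (sym (keyed y∈fx)) (keyed y∈fx′))

  length-concatMap : ∀ (f : A → List B) xs → length (concatMap f xs) ≡ sum (map (length ∘ f) xs)
  length-concatMap f [] = refl
  length-concatMap f (x ∷ xs) = trans (List.length-++ (f x)) (cong (length (f x) +_) (length-concatMap f xs))

  triples : (ℕ → List A) → (ℕ → List B) → ℕ → List (ℕ × A × B)
  triples X Y K = concatMap (λ m → concatMap (λ σ → map (λ ρ → (m , σ , ρ)) (Y m)) (X m)) (upTo K)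

  ∈-triples⁺ : ∀ (X : ℕ → List A) (Y : ℕ → List B) K {m σ ρ} → m < K → σ ∈ X m → ρ ∈ Y m → (m , σ , ρ) ∈ triples X Y K
  ∈-triples⁺ X Y K {m} {σ} m<K σ∈ ρ∈ =
    ∈-concatMap⁺ _ (lose (∈-upTo⁺ m<K) (∈-concatMap⁺ (λ σ → map (λ ρ → (m , σ , ρ)) (Y m)) (lose σ∈ (∈-map⁺ (λ ρ → (m , σ , ρ)) ρ∈))))

  ∈-triples⁻ : ∀ (X : ℕ → List A) (Y : ℕ → List B) K {m σ ρ} → (m , σ , ρ) ∈ triples X Y K → m < K × σ ∈ X m × ρ ∈ Y m
  ∈-triples⁻ X Y K t∈ with find (∈-concatMap⁻ (λ m → concatMap (λ σ → map (λ ρ → (m , σ , ρ)) (Y m)) (X m)) {upTo K} t∈)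
  ... | m′ , m′∈ , t∈m′ with find (∈-concatMap⁻ (λ σ → map (λ ρ → (m′ , σ , ρ)) (Y m′)) {X m′} t∈m′)
  ... | σ′ , σ′∈ , t∈m′σ′ with ∈-map⁻ (λ ρ′ → (m′ , σ′ , ρ′)) t∈m′σ′
  ... | _ , ρ∈ , refl = ∈-upTo⁻ m′∈ , σ′∈ , ρ∈

  Unique-triples : ∀ (X : ℕ → List A) (Y : ℕ → List B) K → (∀ m → Unique (X m)) → (∀ m → Unique (Y m)) →
    Unique (triples X Y K)
  Unique-triples X Y K X! Y! = Unique-concatMap⁺ proj₁ _ (upTo K) (Unique.upTo⁺ K)
    (λ m → Unique-concatMap⁺ (proj₁ ∘ proj₂) (λ σ → map (λ ρ → (m , σ , ρ)) (Y m)) (X m) (X! m)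
             (λ σ → Unique.map⁺ (λ eq → proj₂ (Product.,-injective (proj₂ (Product.,-injective eq)))) (Y! m))
             (λ {σ} t∈ → case ∈-map⁻ (λ ρ → (m , σ , ρ)) t∈ of λ { (_ , _ , refl) → refl }))
    (λ {m} t∈ → case find (∈-concatMap⁻ (λ σ → map (λ ρ → (m , σ , ρ)) (Y m)) {X m} t∈) of λ
       { (σ , _ , t∈′) → case ∈-map⁻ (λ ρ → (m , σ , ρ)) t∈′ of λ { (_ , _ , refl) → refl } })

  length-triples : ∀ (X : ℕ → List A) (Y : ℕ → List B) K →
    length (triples X Y K) ≡ sum (map (λ m → length (X m) * length (Y m)) (upTo K))
  length-triples X Y K = trans (length-concatMap _ (upTo K)) (cong sum (List.map-cong (λ m → length-fibre m (X m)) (upTo K)))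
    where
    length-fibre : ∀ m σs → length (concatMap (λ σ → map (λ ρ → (m , σ , ρ)) (Y m)) σs) ≡ length σs * length (Y m)
    length-fibre m [] = refl
    length-fibre m (σ ∷ σs) = trans (List.length-++ (map _ (Y m))) (cong₂ _+_ (List.length-map _ (Y m)) (length-fibre m σs))

module Permutations where

  open import Defs using (words; distinct; anyᵇ; oneTo; Sym)
  open Counting
  open import Data.Bool using (Bool; true; false; T; T?; not; _∧_)
  open import Data.Bool.Properties using (T-≡; T-∧)
  open import Data.Empty using (⊥-elim)
  open import Data.List using (List; []; _∷_; _++_; map; length; applyUpTo)
  open import Data.List.Membership.Propositional using (_∈_; _∉_; lose; find)
  open import Data.List.Membership.Propositional.Properties
    using (∈-filter⁺; ∈-filter⁻; ∈-map⁺; ∈-map⁻; ∈-concatMap⁺; ∈-concatMap⁻; ∈-∃++)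
  import Data.List.Properties as List
  import Data.List.Relation.Unary.All.Properties as All
  open import Data.List.Relation.Unary.All as All using (All; []; _∷_)
  open import Data.List.Relation.Unary.All.Properties.Core using (¬Any⇒All¬)
  open import Data.List.Relation.Unary.Any using (here; there)
  open import Data.List.Relation.Unary.Unique.Propositional using (Unique; []; _∷_)
  import Data.List.Relation.Unary.Unique.Propositional.Properties as Unique
  open import Data.Nat using (ℕ; zero; suc; _+_; _∸_; _<_; _≤_; _≡ᵇ_; z≤n; s≤s; _≟_)
  open import Data.List.Membership.DecPropositional _≟_ using (_∈?_)
  open import Data.Nat.Properties
    using (suc-injective; ≡ᵇ⇒≡; ≡⇒≡ᵇ; +-identityʳ; +-suc; ≤-refl; <-irrefl; ≤-trans; ≤-pred; ≤∧≢⇒<; n≤1+n; <⇒≤;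
           +-cancelˡ-≤; m≤o∸n⇒m+n≤o; m+[n∸m]≡n; +-cancelˡ-≡; m≤n+m; m<m+n; +-comm; +-monoʳ-≤; ≤⇒≯;
           ∸-cancelʳ-≡; m<n⇒0<n∸m; m+n∸m≡n; ∸-monoˡ-≤)
  open import Data.Product using (_×_; _,_; proj₁; proj₂; ∃-syntax)
  open import Function using (_∘_; case_of_; Equivalence)
  open import Relation.Nullary using (yes; no)
  open import Relation.Binary.PropositionalEquality

  IsPerm : ℕ → List ℕ → Set
  IsPerm n π = length π ≡ n × Unique π × All (λ v → 0 < v × v ≤ n) π

  ∈-words⁻ : ∀ m A {w} → w ∈ words m A → length w ≡ m × All (_∈ A) w
  ∈-words⁻ zero A (here refl) = refl , []
  ∈-words⁻ (suc m) A w∈ with find (∈-concatMap⁻ (λ a → map (a ∷_) (words m A)) {A} w∈)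
  ... | a , a∈A , w∈′ with ∈-map⁻ (a ∷_) w∈′
  ... | w′ , w′∈ , refl with ∈-words⁻ m A w′∈
  ... | length≡ , letters∈ = cong suc length≡ , a∈A ∷ letters∈

  ∈-words⁺ : ∀ m A {w} → length w ≡ m → All (_∈ A) w → w ∈ words m A
  ∈-words⁺ zero A {[]} refl [] = here refl
  ∈-words⁺ (suc m) A {a ∷ w} length≡ (a∈A ∷ letters∈) =
    ∈-concatMap⁺ (λ a → map (a ∷_) (words m A)) (lose a∈A (∈-map⁺ (a ∷_) (∈-words⁺ m A (suc-injective length≡) letters∈)))

  Unique-words : ∀ m A → Unique A → Unique (words m A)
  Unique-words zero A _ = [] ∷ []
  Unique-words (suc m) A A! = Unique-concatMap⁺ head (λ a → map (a ∷_) (words m A)) A A!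
    (λ a → Unique.map⁺ (proj₂ ∘ List.∷-injective) (Unique-words m A A!))
    (λ {a} w∈ → case ∈-map⁻ (a ∷_) w∈ of λ { (_ , _ , refl) → refl })
    where
    head : List ℕ → ℕ
    head [] = 0
    head (x ∷ _) = x

  distinct⇒Unique : ∀ xs → T (distinct xs) → Unique xs
  distinct⇒Unique [] _ = []
  distinct⇒Unique (x ∷ xs) d with Equivalence.to T-∧ d
  ... | x∉xs , xs-distinct = new x xs x∉xs ∷ distinct⇒Unique xs xs-distinct
    where
    new : ∀ x xs → T (not (anyᵇ (x ≡ᵇ_) xs)) → All (x ≢_) xs
    new x [] _ = []
    new x (y ∷ ys) t with x ≡ᵇ y in x≡ᵇy
    ... | false = (λ x≡y → case trans (sym x≡ᵇy) (Equivalence.to T-≡ (≡⇒≡ᵇ x y x≡y)) of λ ()) ∷ new x ys t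

  Unique⇒distinct : ∀ xs → Unique xs → T (distinct xs)
  Unique⇒distinct [] _ = _
  Unique⇒distinct (x ∷ xs) (x∉xs ∷ xs!) = Equivalence.from T-∧ (new x xs x∉xs , Unique⇒distinct xs xs!)
    where
    new : ∀ x xs → All (x ≢_) xs → T (not (anyᵇ (x ≡ᵇ_) xs))
    new x [] [] = _
    new x (y ∷ ys) (x≢y ∷ x∉ys) with x ≡ᵇ y in x≡ᵇy
    ... | true = x≢y (≡ᵇ⇒≡ x y (Equivalence.from T-≡ x≡ᵇy))
    ... | false = new x ys x∉ys

  oneTo≡range : ∀ n → oneTo n ≡ range 0 n
  oneTo≡range n = go 0 n
    where
    applyUpTo-cong : ∀ {f g : ℕ → ℕ} → (∀ i → f i ≡ g i) → ∀ n → applyUpTo f n ≡ applyUpTo g n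
    applyUpTo-cong f≗g zero = refl
    applyUpTo-cong f≗g (suc n) = cong₂ _∷_ (f≗g 0) (applyUpTo-cong (f≗g ∘ suc) n)
    go : ∀ c n → applyUpTo (λ i → suc (c + i)) n ≡ range c n
    go c zero = refl
    go c (suc n) = cong₂ _∷_ (cong suc (+-identityʳ c))
      (trans (applyUpTo-cong (λ i → cong suc (+-suc c i)) n) (go (suc c) n))

  Unique-Sym : ∀ n → Unique (Sym n)
  Unique-Sym n = Unique.filter⁺ (T? ∘ distinct) (Unique-words n (oneTo n) (subst Unique (sym (oneTo≡range n)) (Unique-range 0 n)))

  ∈Sym⁻ : ∀ n {π} → π ∈ Sym n → IsPerm n π
  ∈Sym⁻ n π∈ with ∈-filter⁻ (T? ∘ distinct) π∈
  ... | π∈words , π-distinct with ∈-words⁻ n (oneTo n) π∈words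
  ... | length≡ , letters∈ =
    length≡ , distinct⇒Unique _ π-distinct , All.map (∈-range⁻ 0 n ∘ subst (_ ∈_) (oneTo≡range n)) letters∈

  ∈Sym⁺ : ∀ n {π} → IsPerm n π → π ∈ Sym n
  ∈Sym⁺ n {π} (length≡ , π! , bounded) = ∈-filter⁺ (T? ∘ distinct)
    (∈-words⁺ n (oneTo n) length≡ (All.map (λ (0<v , v≤n) → subst (_ ∈_) (sym (oneTo≡range n)) (∈-range⁺ 0 n 0<v v≤n)) bounded))
    (Unique⇒distinct π π!)

  IsPerm-∋ : ∀ n {π v} → IsPerm n π → 0 < v → v ≤ n → v ∈ π
  IsPerm-∋ n {π} {v} (length≡ , π! , bounded) 0<v v≤n with v ∈? π
  ... | yes v∈π = v∈π
  ... | no v∉π = ⊥-elim (<-irrefl refl (subst (λ l → suc l ≤ n) length≡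
                          (pigeonhole 0 n (v ∷ π) (¬Any⇒All¬ π v∉π ∷ π!) ((0<v , v≤n) ∷ bounded))))

  IsPerm-split-max : ∀ n {π} → IsPerm (suc n) π → ∃[ L ] ∃[ R ] (π ≡ L ++ suc n ∷ R)
  IsPerm-split-max n π-perm with ∈-∃++ (IsPerm-∋ (suc n) π-perm (s≤s z≤n) ≤-refl)
  ... | L , R , eq = L , R , eq

  below-max : ∀ {n v} → v ≤ suc n → v ≢ suc n → v ≤ n
  below-max v≤ v≢ = ≤-pred (≤∧≢⇒< v≤ v≢)

  IsPerm-remove-max : ∀ n L R → IsPerm (suc n) (L ++ suc n ∷ R) → IsPerm n (L ++ R)
  IsPerm-remove-max n L R (length≡ , π! , bounded) with Unique-++⁻ L π!
  ... | L! , N∉R ∷ R! , L#N∷R = length≡′ , Unique-++⁺ L L! R! (All.map All.tail L#N∷R) , bounded′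
    where
    length≡′ : length (L ++ R) ≡ n
    length≡′ = suc-injective (begin
      suc (length (L ++ R))          ≡⟨ cong suc (List.length-++ L) ⟩
      suc (length L + length R)      ≡⟨ +-suc (length L) (length R) ⟨
      length L + length (suc n ∷ R)  ≡⟨ List.length-++ L ⟨
      length (L ++ suc n ∷ R)        ≡⟨ length≡ ⟩
      suc n                          ∎)
      where open ≡-Reasoning
    bounded′ : All (λ v → 0 < v × v ≤ n) (L ++ R)
    bounded′ = All.++⁺
      (All.zipWith (λ ((0<v , v≤) , v∉N∷R) → 0<v , below-max v≤ (All.head v∉N∷R)) (All.++⁻ˡ L bounded , L#N∷R))
      (All.zipWith (λ ((0<v , v≤) , N≢v) → 0<v , below-max v≤ (N≢v ∘ sym)) (All.tail (All.++⁻ʳ L bounded) , N∉R))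

  IsPerm-insert-max : ∀ n L R → IsPerm n (L ++ R) → IsPerm (suc n) (L ++ suc n ∷ R)
  IsPerm-insert-max n L R (length≡ , L++R! , bounded) with Unique-++⁻ L L++R!
  ... | L! , R! , L#R = length≡′ , Unique-++⁺ L L! (All.map (λ (_ , v≤n) N≡v → <-irrefl (sym N≡v) (s≤s v≤n)) boundsR ∷ R!)
                          (All.zipWith (λ ((_ , v≤n) , v∉R) → (λ v≡N → <-irrefl v≡N (s≤s v≤n)) ∷ v∉R) (boundsL , L#R)) ,
                        All.++⁺ (All.map weaken boundsL) ((s≤s z≤n , ≤-refl) ∷ All.map weaken boundsR)
    where
    boundsL = All.++⁻ˡ L bounded
    boundsR = All.++⁻ʳ L bounded
    weaken : ∀ {v} → 0 < v × v ≤ n → 0 < v × v ≤ suc n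
    weaken (0<v , v≤n) = 0<v , ≤-trans v≤n (n≤1+n n)
    length≡′ : length (L ++ suc n ∷ R) ≡ suc n
    length≡′ = begin
      length (L ++ suc n ∷ R)        ≡⟨ List.length-++ L ⟩
      length L + suc (length R)      ≡⟨ +-suc (length L) (length R) ⟩
      suc (length L + length R)      ≡⟨ cong suc (List.length-++ L) ⟨
      suc (length (L ++ R))          ≡⟨ cong suc length≡ ⟩
      suc n                          ∎
      where open ≡-Reasoning

  IsPerm-blocks⁻ : ∀ n L R → IsPerm n (L ++ R) → All (λ x → All (_< x) R) L →
    IsPerm (length R) R × All (λ x → length R < x × x ≤ n) L
  IsPerm-blocks⁻ n L R (length≡ , L++R! , bounded) L>R with Unique-++⁻ L L++R!
  ... | L! , R! , L#R = (refl , R! , All.tabulate (λ z∈R → proj₁ (All.lookup boundsR z∈R) , R-low z∈R)) ,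
                        All.tabulate (λ x∈L → L-high x∈L , proj₂ (All.lookup boundsL x∈L))
    where
    boundsL = All.++⁻ˡ L bounded
    boundsR = All.++⁻ʳ L bounded
    |L|+|R|≡n : length L + length R ≡ n
    |L|+|R|≡n = trans (sym (List.length-++ L)) length≡
    R-low : ∀ {z} → z ∈ R → z ≤ length R
    R-low {z} z∈R = +-cancelˡ-≤ (length L) z (length R)
      (subst (length L + z ≤_) (sym |L|+|R|≡n) (m≤o∸n⇒m+n≤o (length L) z≤n′ |L|≤n∸z))
      where
      z≤n′ = proj₂ (All.lookup boundsR z∈R)
      |L|≤n∸z : length L ≤ n ∸ z
      |L|≤n∸z = pigeonhole z (n ∸ z) L L!
        (All.zipWith (λ ((_ , x≤n) , R<x) → All.lookup R<x z∈R , subst (_ ≤_) (sym (m+[n∸m]≡n z≤n′)) x≤n) (boundsL , L>R))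
    L-high : ∀ {x} → x ∈ L → length R < x
    L-high {x} x∈L = pigeonhole 0 x (x ∷ R) (All.lookup L#R x∈L ∷ R!)
      ((proj₁ (All.lookup boundsL x∈L) , ≤-refl) ∷ All.zipWith (λ ((0<z , _) , z<x) → 0<z , <⇒≤ z<x) (boundsR , All.lookup L>R x∈L))

  IsPerm-blocks⁺ : ∀ r s σ ρ → IsPerm s σ → IsPerm r ρ → IsPerm (s + r) (map (r +_) σ ++ ρ)
  IsPerm-blocks⁺ r s σ ρ (|σ|≡s , σ! , σ-bounded) (|ρ|≡r , ρ! , ρ-bounded) =
    length≡ , Unique-++⁺ (map (r +_) σ) (Unique.map⁺ (+-cancelˡ-≡ r _ _) σ!) ρ! disjoint ,
    All.++⁺ (All.map (λ (r<x , x≤) → ≤-trans (s≤s z≤n) r<x , x≤) high) (All.map (λ (0<z , z≤r) → 0<z , ≤-trans z≤r (m≤n+m r s)) ρ-bounded)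
    where
    high : All (λ x → r < x × x ≤ s + r) (map (r +_) σ)
    high = All.map⁺ (All.map (λ {v} (0<v , v≤s) → m<m+n r 0<v , subst (r + v ≤_) (+-comm r s) (+-monoʳ-≤ r v≤s)) σ-bounded)
    disjoint : All (λ x → All (x ≢_) ρ) (map (r +_) σ)
    disjoint = All.map (λ (r<x , _) → All.map (λ (_ , z≤r) x≡z → ≤⇒≯ z≤r (subst (r <_) x≡z r<x)) ρ-bounded) high
    length≡ : length (map (r +_) σ ++ ρ) ≡ s + r
    length≡ = trans (List.length-++ (map (r +_) σ)) (cong₂ _+_ (trans (List.length-map _ σ) |σ|≡s) |ρ|≡r)

  IsPerm-unshift : ∀ r k L → Unique L → All (λ x → r < x × x ≤ r + k) L → length L ≡ k → IsPerm k (map (_∸ r) L)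
  IsPerm-unshift r k L L! bounds |L|≡k =
    trans (List.length-map _ L) |L|≡k ,
    Unique-map⁺-on (_∸ r) L L! (λ x∈ y∈ → ∸-cancelʳ-≡ (<⇒≤ (proj₁ (All.lookup bounds x∈))) (<⇒≤ (proj₁ (All.lookup bounds y∈)))) ,
    All.map⁺ (All.map (λ (r<x , x≤) → m<n⇒0<n∸m r<x , subst (_ ∸ r ≤_) (m+n∸m≡n r k) (∸-monoˡ-≤ r x≤)) bounds)

  map-+-∸ : ∀ r L → All (r ≤_) L → map (r +_) (map (_∸ r) L) ≡ L
  map-+-∸ r [] [] = refl
  map-+-∸ r (x ∷ L) (r≤x ∷ r≤L) = cong₂ _∷_ (m+[n∸m]≡n r≤x) (map-+-∸ r L r≤L)

module Occurrences where

  open import Defs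
  open Booleans
  open Counting
  open import Data.Bool using (Bool; true; false; _∧_; _∨_; not; if_then_else_; T)
  import Data.Bool.Properties as BP
  open import Data.Nat as ℕ using (ℕ; zero; suc; _+_; _<_; _≤_; _<ᵇ_; _≡ᵇ_; s≤s; z≤n)
  import Data.Nat.Properties as NP
  open import Data.List using (List; []; _∷_; map; length; filterᵇ; applyUpTo; replicate; zip; foldr; _++_)
  import Data.List.Properties as LP
  open import Data.List.Relation.Unary.All as All using (All; []; _∷_)
  import Data.List.Relation.Unary.All.Properties as AllP
  open import Data.Product using (_×_; _,_; proj₁; proj₂)
  open import Data.Unit using (tt)
  open import Data.Empty using (⊥; ⊥-elim)
  open import Relation.Binary.PropositionalEquality
  open import Relation.Nullary using (¬_)
  open import Function using (_∘_)

  indexedFrom : ℕ → List ℕ → List (ℕ × ℕ)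
  indexedFrom c [] = []
  indexedFrom c (x ∷ xs) = (c , x) ∷ indexedFrom (suc c) xs

  idx-lemma : ∀ (g : ℕ → ℕ) c xs → (∀ i → g i ≡ c + i) → zip (applyUpTo g (length xs)) xs ≡ indexedFrom c xs
  idx-lemma g c [] e = refl
  idx-lemma g c (x ∷ xs) e = cong₂ _∷_ (cong (_, x) (trans (e 0) (NP.+-identityʳ c)))
    (idx-lemma (g ∘ suc) (suc c) xs (λ i → trans (e (suc i)) (NP.+-suc c i)))

  indexed≡indexedFrom : ∀ π → indexed π ≡ indexedFrom 1 π
  indexed≡indexedFrom π = idx-lemma suc 1 π (λ i → refl)

  countᵇ-subseqs-values : ∀ (G : List ℕ → Bool) c xs → countᵇ (λ (s : List (ℕ × ℕ)) → G (map proj₂ s)) (subseqs (indexedFrom c xs)) ≡ countᵇ G (subseqs xs)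
  countᵇ-subseqs-values G c [] with G []
  ... | true = refl
  ... | false = refl
  countᵇ-subseqs-values G c (x ∷ xs) = trans (countᵇ-subseqs-∷ (λ (s : List (ℕ × ℕ)) → G (map proj₂ s)) (c , x) (indexedFrom (suc c) xs))
    (trans (cong₂ _+_ (countᵇ-subseqs-values (λ v → G (x ∷ v)) (suc c) xs) (countᵇ-subseqs-values G (suc c) xs))
           (sym (countᵇ-subseqs-∷ G x xs)))

  𝟙 : Bool → ℕ
  𝟙 true = 1
  𝟙 false = 0

  countBetween : ℕ → ℕ → List ℕ → ℕ
  countBetween x y [] = 0
  countBetween x y (z ∷ zs) = 𝟙 ((x <ᵇ z) ∧ (z <ᵇ y)) + countBetween x y zs

  count132From : ℕ → List ℕ → ℕ
  count132From x [] = 0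
  count132From x (y ∷ ys) = countBetween x y ys + count132From x ys

  count132 : List ℕ → ℕ
  count132 [] = 0
  count132 (x ∷ xs) = count132From x xs + count132 xs

  is132 : List ℕ → Bool
  is132 v = (length v ≡ᵇ 3) ∧ orderIso v (1 ∷ 3 ∷ 2 ∷ [])

  adjOK-dashed : ∀ is → adjOK is (true ∷ true ∷ []) ≡ true
  adjOK-dashed [] = refl
  adjOK-dashed (i ∷ []) = refl
  adjOK-dashed (i ∷ j ∷ []) = refl
  adjOK-dashed (i ∷ j ∷ k ∷ []) = refl
  adjOK-dashed (i ∷ j ∷ k ∷ l ∷ is) = refl

  isOccurrence-1-3-2 : ∀ s → isOccurrence p1-3-2 s ≡ is132 (map proj₂ s)
  isOccurrence-1-3-2 s rewrite adjOK-dashed (map proj₁ s) | BP.∧-identityʳ (orderIso (map proj₂ s) (1 ∷ 3 ∷ 2 ∷ [])) | LP.length-map proj₂ s = refl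

  ==true : ∀ b → T (b ==ᵇ true) → T b
  ==true true t = t

  orderIso-132 : ∀ x y z → orderIso (x ∷ y ∷ z ∷ []) (1 ∷ 3 ∷ 2 ∷ []) ≡ ((x <ᵇ z) ∧ (z <ᵇ y))
  orderIso-132 x y z = T-ext _ _ to from
    where
    c1 = (x <ᵇ x) ==ᵇ false
    c2 = (x <ᵇ y) ==ᵇ true
    c3 = (x <ᵇ z) ==ᵇ true
    d1 = (y <ᵇ x) ==ᵇ false
    d2 = (y <ᵇ y) ==ᵇ false
    d3 = (y <ᵇ z) ==ᵇ false
    e1 = (z <ᵇ x) ==ᵇ false
    e2 = (z <ᵇ y) ==ᵇ true
    e3 = (z <ᵇ z) ==ᵇ false
    A1 = c1 ∧ (c2 ∧ (c3 ∧ true))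
    A2 = d1 ∧ (d2 ∧ (d3 ∧ true))
    A3 = e1 ∧ (e2 ∧ (e3 ∧ true))
    to : T (orderIso (x ∷ y ∷ z ∷ []) (1 ∷ 3 ∷ 2 ∷ [])) → T ((x <ᵇ z) ∧ (z <ᵇ y))
    to t = T-∧⁺ {x <ᵇ z} {z <ᵇ y} (==true _ tc3) (==true _ te2)
      where
      nf : T (A1 ∧ (A2 ∧ (A3 ∧ true)))
      nf = t
      tc3 : T c3
      tc3 = T-∧ˡ c3 true (T-∧ʳ c2 (c3 ∧ true) (T-∧ʳ c1 (c2 ∧ (c3 ∧ true)) (T-∧ˡ A1 (A2 ∧ (A3 ∧ true)) nf)))
      te2 : T e2
      te2 = T-∧ˡ e2 (e3 ∧ true) (T-∧ʳ e1 (e2 ∧ (e3 ∧ true)) (T-∧ˡ A3 true (T-∧ʳ A2 (A3 ∧ true) (T-∧ʳ A1 (A2 ∧ (A3 ∧ true)) nf))))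
    from : T ((x <ᵇ z) ∧ (z <ᵇ y)) → T (orderIso (x ∷ y ∷ z ∷ []) (1 ∷ 3 ∷ 2 ∷ []))
    from t = goal
      where
      x<z = NP.<ᵇ⇒< x z (T-∧ˡ (x <ᵇ z) (z <ᵇ y) t)
      z<y = NP.<ᵇ⇒< z y (T-∧ʳ (x <ᵇ z) (z <ᵇ y) t)
      x<y = NP.<-trans x<z z<y
      goal : T (orderIso (x ∷ y ∷ z ∷ []) (1 ∷ 3 ∷ 2 ∷ []))
      goal rewrite <ᵇ-irrefl x | <ᵇ-irrefl y | <ᵇ-irrefl z | <ᵇ-true x<z | <ᵇ-true z<y | <ᵇ-true x<y
            | <ᵇ-false (NP.<⇒≯ x<y) | <ᵇ-false (NP.<⇒≯ x<z) | <ᵇ-false (NP.<⇒≯ z<y) = tt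

  countᵇ-subseqs-length0 : ∀ b (zs : List ℕ) → countᵇ (λ v → (length v ≡ᵇ 0) ∧ b) (subseqs zs) ≡ 𝟙 b
  countᵇ-subseqs-length0 true [] = refl
  countᵇ-subseqs-length0 false [] = refl
  countᵇ-subseqs-length0 b (z ∷ zs) = trans (countᵇ-subseqs-∷ (λ v → (length v ≡ᵇ 0) ∧ b) z zs)
    (cong₂ _+_ (countᵇ-false (subseqs zs)) (countᵇ-subseqs-length0 b zs))

  count-is132-from₃ : ∀ x y z zs → countᵇ (λ v → is132 (x ∷ y ∷ z ∷ v)) (subseqs zs) ≡ 𝟙 ((x <ᵇ z) ∧ (z <ᵇ y))
  count-is132-from₃ x y z zs = trans (countᵇ-cong (subseqs zs) pw) (countᵇ-subseqs-length0 _ zs)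
    where pw : ∀ v → is132 (x ∷ y ∷ z ∷ v) ≡ ((length v ≡ᵇ 0) ∧ ((x <ᵇ z) ∧ (z <ᵇ y)))
          pw [] = orderIso-132 x y z
          pw (w ∷ v) = refl

  count-is132-from₂ : ∀ x y zs → countᵇ (λ v → is132 (x ∷ y ∷ v)) (subseqs zs) ≡ countBetween x y zs
  count-is132-from₂ x y [] = refl
  count-is132-from₂ x y (z ∷ zs) = trans (countᵇ-subseqs-∷ (λ v → is132 (x ∷ y ∷ v)) z zs) (cong₂ _+_ (count-is132-from₃ x y z zs) (count-is132-from₂ x y zs))

  count-is132-from₁ : ∀ x ys → countᵇ (λ v → is132 (x ∷ v)) (subseqs ys) ≡ count132From x ys
  count-is132-from₁ x [] = refl
  count-is132-from₁ x (y ∷ ys) = trans (countᵇ-subseqs-∷ (λ v → is132 (x ∷ v)) y ys) (cong₂ _+_ (count-is132-from₂ x y ys) (count-is132-from₁ x ys))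

  count-is132 : ∀ xs → countᵇ is132 (subseqs xs) ≡ count132 xs
  count-is132 [] = refl
  count-is132 (x ∷ xs) = trans (countᵇ-subseqs-∷ is132 x xs) (cong₂ _+_ (count-is132-from₁ x xs) (count-is132 xs))

  occ-1-3-2≡count132 : ∀ π → occ p1-3-2 π ≡ count132 π
  occ-1-3-2≡count132 π = begin
      countᵇ (isOccurrence p1-3-2) (subseqs (indexed π))
    ≡⟨ cong (λ l → countᵇ (isOccurrence p1-3-2) (subseqs l)) (indexed≡indexedFrom π) ⟩
      countᵇ (isOccurrence p1-3-2) (subseqs (indexedFrom 1 π))
    ≡⟨ countᵇ-cong (subseqs (indexedFrom 1 π)) isOccurrence-1-3-2 ⟩
      countᵇ (λ (s : List (ℕ × ℕ)) → is132 (map proj₂ s)) (subseqs (indexedFrom 1 π))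
    ≡⟨ countᵇ-subseqs-values is132 1 π ⟩
      countᵇ is132 (subseqs π)
    ≡⟨ count-is132 π ⟩
      count132 π ∎
    where open ≡-Reasoning

  increasing : List ℕ → Bool
  increasing [] = true
  increasing (x ∷ v) = allᵇ (x <ᵇ_) v ∧ increasing v

  sameOrder : ℕ × ℕ → ℕ × ℕ → Bool
  sameOrder p q = (proj₁ p <ᵇ proj₁ q) ==ᵇ (proj₂ p <ᵇ proj₂ q)

  orderIsoPairs : List (ℕ × ℕ) → Bool
  orderIsoPairs ps = allᵇ (λ p → allᵇ (λ q → sameOrder p q) ps) ps

  ∧-shuffle : ∀ a b c d → ((a ∧ b) ∧ (c ∧ d)) ≡ ((a ∧ c) ∧ (b ∧ d))
  ∧-shuffle true b true d = refl
  ∧-shuffle true b false d = BP.∧-zeroʳ b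
  ∧-shuffle false b c d = refl

  allᵇ-∧ : ∀ {A : Set} (f g : A → Bool) xs → allᵇ (λ p → f p ∧ g p) xs ≡ allᵇ f xs ∧ allᵇ g xs
  allᵇ-∧ f g [] = refl
  allᵇ-∧ f g (x ∷ xs) = trans (cong ((f x ∧ g x) ∧_) (allᵇ-∧ f g xs)) (∧-shuffle (f x) (g x) _ _)

  RelCons : ∀ a ps → orderIsoPairs (a ∷ ps) ≡ (sameOrder a a ∧ allᵇ (sameOrder a) ps) ∧ (allᵇ (λ p → sameOrder p a) ps ∧ orderIsoPairs ps)
  RelCons a ps = cong ((sameOrder a a ∧ allᵇ (sameOrder a) ps) ∧_) (allᵇ-∧ (λ p → sameOrder p a) (λ p → allᵇ (sameOrder p) ps) ps)

  ==t : ∀ b → (b ==ᵇ true) ≡ b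
  ==t true = refl
  ==t false = refl

  ==f : ∀ b → (b ==ᵇ false) ≡ not b
  ==f true = refl
  ==f false = refl

  all-sameOrder-first : ∀ x y xs ys → length xs ≡ length ys → T (allᵇ (y <ᵇ_) ys) → allᵇ (sameOrder (x , y)) (zip xs ys) ≡ allᵇ (x <ᵇ_) xs
  all-sameOrder-first x y [] [] e t = refl
  all-sameOrder-first x y (w ∷ xs) (v ∷ ys) e t =
    cong₂ _∧_ (trans (cong ((x <ᵇ w) ==ᵇ_) (T⇒≡true (T-∧ˡ (y <ᵇ v) _ t))) (==t (x <ᵇ w)))
              (all-sameOrder-first x y xs ys (NP.suc-injective e) (T-∧ʳ (y <ᵇ v) _ t))

  all-sameOrder-second : ∀ x y xs ys → length xs ≡ length ys → T (allᵇ (y <ᵇ_) ys) → allᵇ (λ p → sameOrder p (x , y)) (zip xs ys) ≡ allᵇ (λ w → not (w <ᵇ x)) xs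
  all-sameOrder-second x y [] [] e t = refl
  all-sameOrder-second x y (w ∷ xs) (v ∷ ys) e t =
    cong₂ _∧_ (trans (cong ((w <ᵇ x) ==ᵇ_) (<ᵇ-false (NP.<⇒≯ (NP.<ᵇ⇒< y v (T-∧ˡ (y <ᵇ v) _ t))))) (==f (w <ᵇ x)))
              (all-sameOrder-second x y xs ys (NP.suc-injective e) (T-∧ʳ (y <ᵇ v) _ t))

  all-above⇒none-below : ∀ x xs → T (allᵇ (x <ᵇ_) xs) → allᵇ (λ w → not (w <ᵇ x)) xs ≡ true
  all-above⇒none-below x [] t = refl
  all-above⇒none-below x (w ∷ xs) t rewrite <ᵇ-false (NP.<⇒≯ (NP.<ᵇ⇒< x w (T-∧ˡ (x <ᵇ w) _ t))) = all-above⇒none-below x xs (T-∧ʳ (x <ᵇ w) _ t)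

  orderIso-increasing : ∀ xs ys → length xs ≡ length ys → T (increasing ys) → orderIso xs ys ≡ increasing xs
  orderIso-increasing [] [] e t = refl
  orderIso-increasing (x ∷ xs) (y ∷ ys) e t = begin
      (length (x ∷ xs) ≡ᵇ length (y ∷ ys)) ∧ orderIsoPairs ((x , y) ∷ zip xs ys)
    ≡⟨ cong (_∧ orderIsoPairs ((x , y) ∷ zip xs ys)) (trans (cong (λ l → suc l ≡ᵇ length (y ∷ ys)) e′) (≡ᵇ-refl (length ys))) ⟩
      orderIsoPairs ((x , y) ∷ zip xs ys)
    ≡⟨ RelCons (x , y) (zip xs ys) ⟩
      (sameOrder (x , y) (x , y) ∧ allᵇ (sameOrder (x , y)) (zip xs ys)) ∧ (allᵇ (λ p → sameOrder p (x , y)) (zip xs ys) ∧ orderIsoPairs (zip xs ys))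
    ≡⟨ cong₂ (λ u v → (u ∧ allᵇ (sameOrder (x , y)) (zip xs ys)) ∧ (allᵇ (λ p → sameOrder p (x , y)) (zip xs ys) ∧ v)) sameOrder-refl rest ⟩
      (true ∧ allᵇ (sameOrder (x , y)) (zip xs ys)) ∧ (allᵇ (λ p → sameOrder p (x , y)) (zip xs ys) ∧ increasing xs)
    ≡⟨ cong₂ (λ u v → u ∧ (v ∧ increasing xs)) (all-sameOrder-first x y xs ys e′ ty) (all-sameOrder-second x y xs ys e′ ty) ⟩
      allᵇ (x <ᵇ_) xs ∧ (allᵇ (λ w → not (w <ᵇ x)) xs ∧ increasing xs)
    ≡⟨ drop-redundant (allᵇ (x <ᵇ_) xs) refl ⟩
      allᵇ (x <ᵇ_) xs ∧ increasing xs ∎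
    where
    open ≡-Reasoning
    e′ = NP.suc-injective e
    ty = T-∧ˡ (allᵇ (y <ᵇ_) ys) _ t
    sameOrder-refl : sameOrder (x , y) (x , y) ≡ true
    sameOrder-refl rewrite <ᵇ-irrefl x | <ᵇ-irrefl y = refl
    rest : orderIsoPairs (zip xs ys) ≡ increasing xs
    rest = trans (sym (cong (_∧ orderIsoPairs (zip xs ys)) (trans (cong (_≡ᵇ length ys) e′) (≡ᵇ-refl (length ys)))))
                  (orderIso-increasing xs ys e′ (T-∧ʳ (allᵇ (y <ᵇ_) ys) _ t))
    drop-redundant : ∀ b → allᵇ (x <ᵇ_) xs ≡ b → b ∧ (allᵇ (λ w → not (w <ᵇ x)) xs ∧ increasing xs) ≡ b ∧ increasing xs
    drop-redundant true e rewrite all-above⇒none-below x xs (≡true⇒T e) = refl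
    drop-redundant false e = refl

  allᵇ-applyUpTo : ∀ (P : ℕ → Bool) (g : ℕ → ℕ) k → (∀ i → T (P (g i))) → T (allᵇ P (applyUpTo g k))
  allᵇ-applyUpTo P g zero h = tt
  allᵇ-applyUpTo P g (suc k) h = T-∧⁺ {P (g 0)} (h 0) (allᵇ-applyUpTo P (g ∘ suc) k (λ i → h (suc i)))

  increasing-applyUpTo : ∀ (g : ℕ → ℕ) k → (∀ i j → i < j → g i < g j) → T (increasing (applyUpTo g k))
  increasing-applyUpTo g zero mono = tt
  increasing-applyUpTo g (suc k) mono = T-∧⁺ {allᵇ (g 0 <ᵇ_) (applyUpTo (g ∘ suc) k)}
    (allᵇ-applyUpTo (g 0 <ᵇ_) (g ∘ suc) k (λ i → NP.<⇒<ᵇ (mono 0 (suc i) (s≤s z≤n))))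
    (increasing-applyUpTo (g ∘ suc) k (λ i j p → mono (suc i) (suc j) (s≤s p)))

  increasing-oneTo : ∀ k → T (increasing (oneTo k))
  increasing-oneTo k = increasing-applyUpTo suc k (λ i j p → s≤s p)

  -- ascends m y zs: zs has an increasing subsequence of length m whose entries exceed y.
  -- containsRise m π: π contains 12-3-⋯-(m+2), i.e. an adjacent rise x < y followed by such an ascent from y.
  ascends : ℕ → ℕ → List ℕ → Bool
  ascends zero y zs = true
  ascends (suc m) y [] = false
  ascends (suc m) y (z ∷ zs) = ((y <ᵇ z) ∧ ascends m z zs) ∨ ascends (suc m) y zs

  containsRise : ℕ → List ℕ → Bool
  containsRise m (x ∷ y ∷ zs) = ((x <ᵇ y) ∧ ascends m y zs) ∨ containsRise m (y ∷ zs)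
  containsRise m _ = false

  contains : ℕ → List ℕ → Bool
  contains zero _ = true
  contains (suc zero) [] = false
  contains (suc zero) (_ ∷ _) = true
  contains (suc (suc m)) π = containsRise m π

  allᵇ-<-trans : ∀ x y v → x < y → T (allᵇ (y <ᵇ_) v) → T (allᵇ (x <ᵇ_) v)
  allᵇ-<-trans x y [] p t = tt
  allᵇ-<-trans x y (w ∷ v) p t = T-∧⁺ {x <ᵇ w} (NP.<⇒<ᵇ (NP.<-trans p (NP.<ᵇ⇒< y w (T-∧ˡ (y <ᵇ w) _ t)))) (allᵇ-<-trans x y v p (T-∧ʳ (y <ᵇ w) _ t))

  increasing-∷∷ : ∀ x y v → increasing (x ∷ y ∷ v) ≡ (x <ᵇ y) ∧ increasing (y ∷ v)
  increasing-∷∷ x y v = T-ext _ _ to from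
    where
    to : T (increasing (x ∷ y ∷ v)) → T ((x <ᵇ y) ∧ increasing (y ∷ v))
    to t = T-∧⁺ {x <ᵇ y} (T-∧ˡ (x <ᵇ y) _ (T-∧ˡ (allᵇ (x <ᵇ_) (y ∷ v)) _ t)) (T-∧ʳ (allᵇ (x <ᵇ_) (y ∷ v)) _ t)
    from : T ((x <ᵇ y) ∧ increasing (y ∷ v)) → T (increasing (x ∷ y ∷ v))
    from t = T-∧⁺ {allᵇ (x <ᵇ_) (y ∷ v)} (T-∧⁺ {x <ᵇ y} t1 (allᵇ-<-trans x y v (NP.<ᵇ⇒< x y t1) (T-∧ˡ (allᵇ (y <ᵇ_) v) _ t2))) t2
      where t1 = T-∧ˡ (x <ᵇ y) _ t
            t2 = T-∧ʳ (x <ᵇ y) _ t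

  not-∨ : ∀ a b → not (a ∨ b) ≡ not a ∧ not b
  not-∨ true b = refl
  not-∨ false b = refl

  countAscents : ℕ → ℕ → List ℕ → ℕ
  countAscents m y zs = countᵇ (λ v → (length v ≡ᵇ m) ∧ increasing (y ∷ v)) (subseqs zs)

  +≡ᵇ0 : ∀ a b → (a + b ≡ᵇ 0) ≡ (a ≡ᵇ 0) ∧ (b ≡ᵇ 0)
  +≡ᵇ0 zero b = refl
  +≡ᵇ0 (suc a) b = refl

  count-if : ∀ (b : Bool) (P : List ℕ → Bool) xs → countᵇ (λ v → b ∧ P v) xs ≡ (if b then countᵇ P xs else 0)
  count-if true P xs = refl
  count-if false P xs = countᵇ-false xs

  mutual
    countAscents≡0 : ∀ m y zs → (countAscents m y zs ≡ᵇ 0) ≡ not (ascends m y zs)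
    countAscents≡0 zero y zs = cong (_≡ᵇ 0) (trans (countᵇ-cong (subseqs zs) pw) (countᵇ-subseqs-length0 true zs))
      where pw : ∀ v → ((length v ≡ᵇ 0) ∧ increasing (y ∷ v)) ≡ ((length v ≡ᵇ 0) ∧ true)
            pw [] = refl
            pw (w ∷ v) = refl
    countAscents≡0 (suc m) y [] = refl
    countAscents≡0 (suc m) y (z ∷ zs) = begin
        (countAscents (suc m) y (z ∷ zs) ≡ᵇ 0)
      ≡⟨ cong (_≡ᵇ 0) (countᵇ-subseqs-∷ (λ v → (length v ≡ᵇ suc m) ∧ increasing (y ∷ v)) z zs) ⟩
        (countᵇ (λ v → (length v ≡ᵇ m) ∧ increasing (y ∷ z ∷ v)) (subseqs zs) + countAscents (suc m) y zs ≡ᵇ 0)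
      ≡⟨ +≡ᵇ0 (countᵇ (λ v → (length v ≡ᵇ m) ∧ increasing (y ∷ z ∷ v)) (subseqs zs)) (countAscents (suc m) y zs) ⟩
        (countᵇ (λ v → (length v ≡ᵇ m) ∧ increasing (y ∷ z ∷ v)) (subseqs zs) ≡ᵇ 0) ∧ (countAscents (suc m) y zs ≡ᵇ 0)
      ≡⟨ cong₂ _∧_ (countAscents-∷≡0 m y z zs) (countAscents≡0 (suc m) y zs) ⟩
        not ((y <ᵇ z) ∧ ascends m z zs) ∧ not (ascends (suc m) y zs)
      ≡⟨ sym (not-∨ ((y <ᵇ z) ∧ ascends m z zs) _) ⟩
        not (ascends (suc m) y (z ∷ zs)) ∎
      where
      open ≡-Reasoning

    countAscents-∷≡0 : ∀ m y z zs → (countᵇ (λ v → (length v ≡ᵇ m) ∧ increasing (y ∷ z ∷ v)) (subseqs zs) ≡ᵇ 0) ≡ not ((y <ᵇ z) ∧ ascends m z zs)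
    countAscents-∷≡0 m y z zs = begin
        (countᵇ (λ v → (length v ≡ᵇ m) ∧ increasing (y ∷ z ∷ v)) (subseqs zs) ≡ᵇ 0)
      ≡⟨ cong (_≡ᵇ 0) (countᵇ-cong (subseqs zs) (λ v → trans (cong ((length v ≡ᵇ m) ∧_) (increasing-∷∷ y z v))
            (trans (sym (BP.∧-assoc (length v ≡ᵇ m) _ _)) (trans (cong (_∧ increasing (z ∷ v)) (BP.∧-comm (length v ≡ᵇ m) (y <ᵇ z))) (BP.∧-assoc (y <ᵇ z) _ _))))) ⟩
        (countᵇ (λ v → (y <ᵇ z) ∧ ((length v ≡ᵇ m) ∧ increasing (z ∷ v))) (subseqs zs) ≡ᵇ 0)
      ≡⟨ cong (_≡ᵇ 0) (count-if (y <ᵇ z) _ (subseqs zs)) ⟩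
        ((if y <ᵇ z then countAscents m z zs else 0) ≡ᵇ 0)
      ≡⟨ by-cases (y <ᵇ z) ⟩
        not ((y <ᵇ z) ∧ ascends m z zs) ∎
      where
      open ≡-Reasoning
      by-cases : ∀ b → ((if b then countAscents m z zs else 0) ≡ᵇ 0) ≡ not (b ∧ ascends m z zs)
      by-cases true = countAscents≡0 m z zs
      by-cases false = refl

  countRises : ℕ → List ℕ → ℕ
  countRises m (x ∷ y ∷ zs) = countᵇ (λ v → (length v ≡ᵇ m) ∧ increasing (x ∷ y ∷ v)) (subseqs zs) + countRises m (y ∷ zs)
  countRises m _ = 0

  countRises≡0 : ∀ m π → (countRises m π ≡ᵇ 0) ≡ not (containsRise m π)
  countRises≡0 m [] = refl
  countRises≡0 m (x ∷ []) = refl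
  countRises≡0 m (x ∷ y ∷ zs) = trans (+≡ᵇ0 (countᵇ (λ v → (length v ≡ᵇ m) ∧ increasing (x ∷ y ∷ v)) (subseqs zs)) (countRises m (y ∷ zs)))
    (trans (cong₂ _∧_ (countAscents-∷≡0 m x y zs) (countRises≡0 m (y ∷ zs))) (sym (not-∨ ((x <ᵇ y) ∧ ascends m y zs) _)))

  adjOK-all-dashes : ∀ is m → adjOK is (replicate m true) ≡ true
  adjOK-all-dashes [] m = refl
  adjOK-all-dashes (i ∷ []) m = refl
  adjOK-all-dashes (i ∷ j ∷ is) zero = refl
  adjOK-all-dashes (i ∷ j ∷ is) (suc m) = adjOK-all-dashes (j ∷ is) m

  All-subseqs : ∀ {A : Set} {P : A → Set} l → All P l → All (All P) (subseqs l)
  All-subseqs [] [] = [] ∷ []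
  All-subseqs (a ∷ l) (pa ∷ pl) = AllP.++⁺ (AllP.map⁺ (All.map (pa ∷_) (All-subseqs l pl))) (All-subseqs l pl)

  indexedFrom-≥ : ∀ c zs → All (λ p → c ≤ proj₁ p) (indexedFrom c zs)
  indexedFrom-≥ c [] = []
  indexedFrom-≥ c (z ∷ zs) = NP.≤-refl ∷ All.map (λ p → NP.≤-trans (NP.n≤1+n c) p) (indexedFrom-≥ (suc c) zs)

  pattern12-3 : ℕ → GPattern
  pattern12-3 m = p12-3-k (2 + m)

  ∧-cong-guarded : ∀ a a′ b c → a ≡ a′ → (a′ ≡ true → b ≡ c) → (a ∧ (b ∧ true)) ≡ (a′ ∧ c)
  ∧-cong-guarded a .a b c refl f with a
  ... | true = trans (BP.∧-identityʳ b) (f refl)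
  ... | false = refl

  isOccurrence-adjacent : ∀ m c x y s → isOccurrence (pattern12-3 m) ((c , x) ∷ (suc c , y) ∷ s) ≡ ((length (map proj₂ s) ≡ᵇ m) ∧ increasing (x ∷ y ∷ map proj₂ s))
  isOccurrence-adjacent m c x y s = begin
      isOccurrence (pattern12-3 m) ((c , x) ∷ (suc c , y) ∷ s)
    ≡⟨ refl ⟩
      (length s ≡ᵇ length (applyUpTo (λ i → suc (suc (suc i))) m)) ∧ (orderIso (x ∷ y ∷ map proj₂ s) (oneTo (2 + m)) ∧ ((c ≡ᵇ c) ∧ adjOK (suc c ∷ map proj₁ s) (replicate m true)))
    ≡⟨ cong₂ (λ u v → (length s ≡ᵇ u) ∧ (orderIso (x ∷ y ∷ map proj₂ s) (oneTo (2 + m)) ∧ v)) (LP.length-applyUpTo _ m)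
         (cong₂ _∧_ (≡ᵇ-refl c) (adjOK-all-dashes (suc c ∷ map proj₁ s) m)) ⟩
      (length s ≡ᵇ m) ∧ (orderIso (x ∷ y ∷ map proj₂ s) (oneTo (2 + m)) ∧ true)
    ≡⟨ ∧-cong-guarded (length s ≡ᵇ m) (length (map proj₂ s) ≡ᵇ m) _ _ (cong (_≡ᵇ m) (sym (LP.length-map proj₂ s)))
      (λ e → orderIso-increasing (x ∷ y ∷ map proj₂ s) (oneTo (2 + m))
               (trans (cong (λ l → suc (suc l)) (NP.≡ᵇ⇒≡ _ _ (≡true⇒T e))) (sym (LP.length-applyUpTo suc (2 + m))))
               (increasing-oneTo (2 + m))) ⟩
      (length (map proj₂ s) ≡ᵇ m) ∧ increasing (x ∷ y ∷ map proj₂ s) ∎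
    where open ≡-Reasoning

  isOccurrence-apart : ∀ m c x s → All (λ p → suc (suc c) ≤ proj₁ p) s → isOccurrence (pattern12-3 m) ((c , x) ∷ s) ≡ false
  isOccurrence-apart m c x [] _ = refl
  isOccurrence-apart m c x ((p , w) ∷ s) (le ∷ _) rewrite ≡ᵇ-false {p} {suc c} (λ e → NP.<-irrefl (sym e) le) = 
    trans (cong (L ∧_) (BP.∧-zeroʳ O)) (BP.∧-zeroʳ L)
    where L = length ((c , x) ∷ (p , w) ∷ s) ≡ᵇ length (oneTo (2 + m))
          O = orderIso (x ∷ w ∷ map proj₂ s) (oneTo (2 + m))

  occ≡countRises : ∀ m c π → countᵇ (isOccurrence (pattern12-3 m)) (subseqs (indexedFrom c π)) ≡ countRises m π
  occ≡countRises m c [] = refl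
  occ≡countRises m c (x ∷ []) = refl
  occ≡countRises m c (x ∷ y ∷ zs) = begin
      countᵇ F (subseqs (indexedFrom c (x ∷ y ∷ zs)))
    ≡⟨ countᵇ-subseqs-∷ F (c , x) (indexedFrom (suc c) (y ∷ zs)) ⟩
      countᵇ (λ s → F ((c , x) ∷ s)) (subseqs (indexedFrom (suc c) (y ∷ zs))) + countᵇ F (subseqs (indexedFrom (suc c) (y ∷ zs)))
    ≡⟨ cong₂ _+_ (countᵇ-subseqs-∷ (λ s → F ((c , x) ∷ s)) (suc c , y) (indexedFrom (suc (suc c)) zs)) (occ≡countRises m (suc c) (y ∷ zs)) ⟩
      (countᵇ (λ s → F ((c , x) ∷ (suc c , y) ∷ s)) (subseqs L) + countᵇ (λ s → F ((c , x) ∷ s)) (subseqs L)) + countRises m (y ∷ zs)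
    ≡⟨ cong (_+ countRises m (y ∷ zs)) (cong₂ _+_ starting-adjacent starting-apart) ⟩
      (countᵇ (λ v → (length v ≡ᵇ m) ∧ increasing (x ∷ y ∷ v)) (subseqs zs) + 0) + countRises m (y ∷ zs)
    ≡⟨ cong (_+ countRises m (y ∷ zs)) (NP.+-identityʳ _) ⟩
      countRises m (x ∷ y ∷ zs) ∎
    where
    open ≡-Reasoning
    F = isOccurrence (pattern12-3 m)
    L = indexedFrom (suc (suc c)) zs
    starting-adjacent : countᵇ (λ s → F ((c , x) ∷ (suc c , y) ∷ s)) (subseqs L) ≡ countᵇ (λ v → (length v ≡ᵇ m) ∧ increasing (x ∷ y ∷ v)) (subseqs zs)
    starting-adjacent = trans (countᵇ-cong (subseqs L) (isOccurrence-adjacent m c x y)) (countᵇ-subseqs-values (λ v → (length v ≡ᵇ m) ∧ increasing (x ∷ y ∷ v)) (suc (suc c)) zs)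
    starting-apart : countᵇ (λ s → F ((c , x) ∷ s)) (subseqs L) ≡ 0
    starting-apart = trans (countᵇ-cong-All {q = λ _ → false} (subseqs L) (All.map (isOccurrence-apart m c x _) (All-subseqs L (indexedFrom-≥ (suc (suc c)) zs))))
               (countᵇ-false (subseqs L))

  avoids≡not-containsRise : ∀ m π → avoids (p12-3-k (2 + m)) π ≡ not (containsRise m π)
  avoids≡not-containsRise m π = trans (cong (λ l → countᵇ (isOccurrence (pattern12-3 m)) (subseqs l) ≡ᵇ 0) (indexed≡indexedFrom π))
                      (trans (cong (_≡ᵇ 0) (occ≡countRises m 1 π)) (countRises≡0 m π))

  countᵇ-subseqs-[]-≥1 : ∀ {A : Set} (p : List A → Bool) l → p [] ≡ true → 1 ≤ countᵇ p (subseqs l)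
  countᵇ-subseqs-[]-≥1 p [] e rewrite e = s≤s z≤n
  countᵇ-subseqs-[]-≥1 p (a ∷ l) e = NP.≤-trans (countᵇ-subseqs-[]-≥1 p l e)
    (subst (countᵇ p (subseqs l) ≤_) (sym (countᵇ-++ p (map (a ∷_) (subseqs l)) (subseqs l))) (NP.m≤n+m _ _))

  avoids-1-∷ : ∀ x xs → avoids (p12-3-k 1) (x ∷ xs) ≡ false
  avoids-1-∷ x xs = ≡ᵇ-false {occ (p12-3-k 1) (x ∷ xs)} {0} (λ e → NP.<-irrefl (sym e) occurs)
    where
    F = isOccurrence (p12-3-k 1)
    singleton-occurs : F ((1 , x) ∷ []) ≡ true
    singleton-occurs rewrite <ᵇ-irrefl x = refl
    occurs : 1 ≤ occ (p12-3-k 1) (x ∷ xs)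
    occurs = subst (1 ≤_) (sym (trans (cong (λ l → countᵇ F (subseqs l)) (indexed≡indexedFrom (x ∷ xs))) (countᵇ-subseqs-∷ F (1 , x) (indexedFrom 2 xs))))
      (NP.≤-trans (countᵇ-subseqs-[]-≥1 (λ s → F ((1 , x) ∷ s)) (indexedFrom 2 xs) singleton-occurs) (NP.m≤m+n _ _))

  avoids≡not-contains : ∀ k π → 1 ≤ k → avoids (p12-3-k k) π ≡ not (contains k π)
  avoids≡not-contains (suc zero) [] _ = refl
  avoids≡not-contains (suc zero) (x ∷ xs) _ = avoids-1-∷ x xs
  avoids≡not-contains (suc (suc m)) π _ = avoids≡not-containsRise m π

module Decomposition where

  open import Defs using (countᵇ; allᵇ)
  open Booleans
  open Counting
  open Occurrences
  open import Data.Bool using (Bool; true; false; _∧_; _∨_; not; if_then_else_; T)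
  import Data.Bool.Properties as BP
  open import Data.Nat as ℕ using (ℕ; zero; suc; _+_; _*_; _∸_; _<_; _≤_; _<ᵇ_; _≡ᵇ_; s≤s; z≤n)
  import Data.Nat.Properties as NP
  open import Data.Nat.Tactic.RingSolver using (solve-∀)
  open import Data.List using (List; []; _∷_; map; length; _++_)
  import Data.List.Properties as LP
  open import Data.List.Relation.Unary.All as All using (All; []; _∷_)
  open import Data.Product using (_×_; _,_; proj₁; proj₂; ∃; ∃-syntax)
  open import Data.Sum using (_⊎_; inj₁; inj₂)
  open import Data.Unit using (⊤; tt)
  open import Data.Empty using (⊥; ⊥-elim)
  open import Relation.Binary.PropositionalEquality
  open import Relation.Nullary using (¬_; yes; no)
  open import Function using (_∘_; case_of_)
  open import Data.List.Membership.Propositional using (_∈_; _∉_)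
  open import Data.List.Relation.Unary.Any using (here; there)

  module OrderPreserving (f : ℕ → ℕ) (Q : ℕ → Set) (pres : ∀ a b → Q a → Q b → (f a <ᵇ f b) ≡ (a <ᵇ b)) where

    countBetween-map : ∀ x y zs → Q x → Q y → All Q zs → countBetween (f x) (f y) (map f zs) ≡ countBetween x y zs
    countBetween-map x y [] qx qy [] = refl
    countBetween-map x y (z ∷ zs) qx qy (qz ∷ qs) = cong₂ _+_ (cong 𝟙 (cong₂ _∧_ (pres x z qx qz) (pres z y qz qy))) (countBetween-map x y zs qx qy qs)

    count132From-map : ∀ x ys → Q x → All Q ys → count132From (f x) (map f ys) ≡ count132From x ys
    count132From-map x [] qx [] = refl
    count132From-map x (y ∷ ys) qx (qy ∷ qs) = cong₂ _+_ (countBetween-map x y ys qx qy qs) (count132From-map x ys qx qs)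

    count132-map : ∀ xs → All Q xs → count132 (map f xs) ≡ count132 xs
    count132-map [] [] = refl
    count132-map (x ∷ xs) (qx ∷ qs) = cong₂ _+_ (count132From-map x xs qx qs) (count132-map xs qs)

    ascends-map : ∀ m y zs → Q y → All Q zs → ascends m (f y) (map f zs) ≡ ascends m y zs
    ascends-map zero y zs qy qs = refl
    ascends-map (suc m) y [] qy [] = refl
    ascends-map (suc m) y (z ∷ zs) qy (qz ∷ qs) =
      cong₂ _∨_ (cong₂ _∧_ (pres y z qy qz) (ascends-map m z zs qz qs)) (ascends-map (suc m) y zs qy qs)

    containsRise-map : ∀ m xs → All Q xs → containsRise m (map f xs) ≡ containsRise m xs
    containsRise-map m [] [] = refl
    containsRise-map m (x ∷ []) _ = refl
    containsRise-map m (x ∷ y ∷ zs) (qx ∷ qy ∷ qs) =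
      cong₂ _∨_ (cong₂ _∧_ (pres x y qx qy) (ascends-map m y zs qy qs)) (containsRise-map m (y ∷ zs) (qy ∷ qs))

    contains-map : ∀ k xs → All Q xs → contains k (map f xs) ≡ contains k xs
    contains-map zero xs _ = refl
    contains-map (suc zero) [] _ = refl
    contains-map (suc zero) (x ∷ xs) _ = refl
    contains-map (suc (suc m)) xs qs = containsRise-map m xs qs

  countBetweenAll : ℕ → List ℕ → List ℕ → ℕ
  countBetweenAll x [] ys = 0
  countBetweenAll x (y ∷ xs) ys = countBetween x y ys + countBetweenAll x xs ys

  -- Occurrences of 1-3-2 whose 1 lies in the first list and whose 2 lies in the second.
  count132Across : List ℕ → List ℕ → ℕ
  count132Across [] ys = 0
  count132Across (x ∷ xs) ys = (count132From x ys + countBetweenAll x xs ys) + count132Across xs ys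

  countBetween-++ : ∀ x y as bs → countBetween x y (as ++ bs) ≡ countBetween x y as + countBetween x y bs
  countBetween-++ x y [] bs = refl
  countBetween-++ x y (a ∷ as) bs = trans (cong (𝟙 ((x <ᵇ a) ∧ (a <ᵇ y)) +_) (countBetween-++ x y as bs)) (sym (NP.+-assoc (𝟙 ((x <ᵇ a) ∧ (a <ᵇ y))) _ _))

  count132From-++ : ∀ x as bs → count132From x (as ++ bs) ≡ (count132From x as + count132From x bs) + countBetweenAll x as bs
  count132From-++ x [] bs = sym (NP.+-identityʳ (count132From x bs))
  count132From-++ x (a ∷ as) bs = trans (cong₂ _+_ (countBetween-++ x a as bs) (count132From-++ x as bs)) (rearrange (countBetween x a as) (countBetween x a bs) (count132From x as) (count132From x bs) (countBetweenAll x as bs))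
    where rearrange : ∀ a b c d e → (a + b) + ((c + d) + e) ≡ ((a + c) + d) + (b + e)
          rearrange = solve-∀

  count132-++ : ∀ xs ys → count132 (xs ++ ys) ≡ (count132 xs + count132 ys) + count132Across xs ys
  count132-++ [] ys = sym (NP.+-identityʳ (count132 ys))
  count132-++ (x ∷ xs) ys = trans (cong₂ _+_ (count132From-++ x xs ys) (count132-++ xs ys)) (rearrange (count132From x xs) (count132From x ys) (countBetweenAll x xs ys) (count132 xs) (count132 ys) (count132Across xs ys))
    where rearrange : ∀ a b c d e g → ((a + b) + c) + ((d + e) + g) ≡ ((a + d) + e) + ((b + c) + g)
          rearrange = solve-∀

  countBetween-≤ : ∀ x y zs → All (_≤ x) zs → countBetween x y zs ≡ 0
  countBetween-≤ x y [] [] = refl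
  countBetween-≤ x y (z ∷ zs) (p ∷ ps) rewrite <ᵇ-false-≤ {x} {z} p = countBetween-≤ x y zs ps

  count132From-≤ : ∀ x ys → All (_≤ x) ys → count132From x ys ≡ 0
  count132From-≤ x [] [] = refl
  count132From-≤ x (y ∷ ys) (p ∷ ps) = cong₂ _+_ (countBetween-≤ x y ys ps) (count132From-≤ x ys ps)

  countBetweenAll-≤ : ∀ x L ys → All (_≤ x) ys → countBetweenAll x L ys ≡ 0
  countBetweenAll-≤ x [] ys ps = refl
  countBetweenAll-≤ x (y ∷ L) ys ps = cong₂ _+_ (countBetween-≤ x y ys ps) (countBetweenAll-≤ x L ys ps)

  countBetween-∷-above : ∀ x y N R → y ≤ N → countBetween x y (N ∷ R) ≡ countBetween x y R
  countBetween-∷-above x y N R p rewrite <ᵇ-false-≤ {N} {y} p | BP.∧-zeroʳ (x <ᵇ N) = refl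

  countBetweenAll-∷-above : ∀ x L N R → All (_≤ N) L → countBetweenAll x L (N ∷ R) ≡ countBetweenAll x L R
  countBetweenAll-∷-above x [] N R [] = refl
  countBetweenAll-∷-above x (y ∷ L) N R (p ∷ ps) = cong₂ _+_ (countBetween-∷-above x y N R p) (countBetweenAll-∷-above x L N R ps)

  count132-∷-max : ∀ N R → All (_≤ N) R → count132 (N ∷ R) ≡ count132 R
  count132-∷-max N R ps = cong (_+ count132 R) (count132From-≤ N R ps)

  countAbove : ℕ → List ℕ → ℕ
  countAbove x R = countᵇ (x <ᵇ_) R

  countBetween-max : ∀ x N R → All (_< N) R → countBetween x N R ≡ countAbove x R
  countBetween-max x N [] [] = refl
  countBetween-max x N (z ∷ R) (p ∷ ps) rewrite <ᵇ-true p | BP.∧-identityʳ (x <ᵇ z) with x <ᵇ z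
  ... | true = cong suc (countBetween-max x N R ps)
  ... | false = countBetween-max x N R ps

  ≤⇒countAbove≡0 : ∀ x R → All (_≤ x) R → countAbove x R ≡ 0
  ≤⇒countAbove≡0 x [] [] = refl
  ≤⇒countAbove≡0 x (z ∷ R) (p ∷ ps) rewrite <ᵇ-false-≤ {x} {z} p = ≤⇒countAbove≡0 x R ps

  countAbove-++ : ∀ x A B → countAbove x (A ++ B) ≡ countAbove x A + countAbove x B
  countAbove-++ x A B = countᵇ-++ (x <ᵇ_) A B

  countAbove-∷-above : ∀ x z B → x < z → countAbove x (z ∷ B) ≡ suc (countAbove x B)
  countAbove-∷-above x z B p rewrite <ᵇ-true p = refl

  countAbove≡0⇒≤ : ∀ x R → countAbove x R ≡ 0 → All (_≤ x) R
  countAbove≡0⇒≤ x [] e = []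
  countAbove≡0⇒≤ x (z ∷ R) e with x <ᵇ z in q
  ... | true = case e of λ ()
  ... | false = <ᵇ-false⇒≥ q ∷ countAbove≡0⇒≤ x R e

  countAbove≢0⇒∃ : ∀ x R → countAbove x R ≢ 0 → ∃[ c ] (c ∈ R × x < c)
  countAbove≢0⇒∃ x [] ne = ⊥-elim (ne refl)
  countAbove≢0⇒∃ x (z ∷ R) ne with x <ᵇ z in q
  ... | true = z , here refl , NP.<ᵇ⇒< x z (≡true⇒T q)
  ... | false = let (c , m , p) = countAbove≢0⇒∃ x R ne in c , there m , p

  countBetween-∈ : ∀ x y c R → c ∈ R → x < c → c < y → 1 ≤ countBetween x y R
  countBetween-∈ x y c (z ∷ R) (here refl) p q rewrite <ᵇ-true p | <ᵇ-true q = s≤s z≤n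
  countBetween-∈ x y c (z ∷ R) (there m) p q = NP.≤-trans (countBetween-∈ x y c R m p q) (NP.m≤n+m _ _)

  countBetween≤countBetweenAll : ∀ x y L R → y ∈ L → countBetween x y R ≤ countBetweenAll x L R
  countBetween≤countBetweenAll x y (y′ ∷ L) R (here refl) = NP.m≤m+n _ _
  countBetween≤countBetweenAll x y (y′ ∷ L) R (there m) = NP.≤-trans (countBetween≤countBetweenAll x y L R m) (NP.m≤n+m _ _)

  count132Across-∷ : ∀ x L N R → All (_≤ N) L → All (_< N) R →
    count132Across (x ∷ L) (N ∷ R) ≡ ((countAbove x R + count132From x R) + countBetweenAll x L R) + count132Across L (N ∷ R)
  count132Across-∷ x L N R pL pR rewrite countBetween-max x N R pR | countBetweenAll-∷-above x L N R pL = refl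

  count132Across≡0⇒≤ : ∀ L N R → All (_≤ N) L → All (_< N) R → count132Across L (N ∷ R) ≡ 0 → All (λ x → All (_≤ x) R) L
  count132Across≡0⇒≤ [] N R pL pR e = []
  count132Across≡0⇒≤ (x ∷ L) N R (_ ∷ pL) pR e with +≡0⁻ _ _ (trans (sym (count132Across-∷ x L N R pL pR)) e)
  ... | e1 , e2 = countAbove≡0⇒≤ x R (proj₁ (+≡0⁻ _ _ (proj₁ (+≡0⁻ _ _ e1)))) ∷ count132Across≡0⇒≤ L N R pL pR e2

  ≤⇒count132Across≡0 : ∀ L N R → All (λ x → All (_≤ x) R) L → All (_≤ N) L → count132Across L (N ∷ R) ≡ 0
  ≤⇒count132Across≡0 [] N R _ _ = refl
  ≤⇒count132Across≡0 (x ∷ L) N R (q ∷ qs) (_ ∷ pL) rewrite countBetween-≤ x N R q | count132From-≤ x R q | countBetweenAll-∷-above x L N R pL | countBetweenAll-≤ x L R q = ≤⇒count132Across≡0 L N R qs pL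

  -- The crossing occurrence x, N, c forces x to be the last letter of L: a later letter y ≥ c would give a second one, x y c.
  count132Across≡1⇒ : ∀ L N R → All (_≤ N) L → All (_< N) R → All (λ y → All (y ≢_) R) L → count132Across L (N ∷ R) ≡ 1 →
    ∃[ L′ ] ∃[ a ] (L ≡ L′ ++ (a ∷ []) × All (λ x → All (_≤ x) R) L′ × countAbove a R ≡ 1)
  count132Across≡1⇒ [] N R L≤N R<N L#R ()
  count132Across≡1⇒ (x ∷ L) N R (_ ∷ L≤N) R<N (x#R ∷ L#R) across≡1
    with +≡1⁻ _ _ (trans (sym (count132Across-∷ x L N R L≤N R<N)) across≡1)
  ... | inj₁ (from-x≡0 , rest≡1) with count132Across≡1⇒ L N R L≤N R<N L#R rest≡1
  ...   | L′ , a , refl , L′≥R , one-above =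
    x ∷ L′ , a , refl , countAbove≡0⇒≤ x R (proj₁ (+≡0⁻ (countAbove x R) (count132From x R)
                                    (proj₁ (+≡0⁻ (countAbove x R + count132From x R) (countBetweenAll x L R) from-x≡0)))) ∷ L′≥R , one-above
  count132Across≡1⇒ (x ∷ L) N R (_ ∷ L≤N) R<N (x#R ∷ L#R) across≡1 | inj₂ (from-x≡1 , rest≡0) with countAbove x R in above-x
  ... | zero = case trans (sym from-x≡1) nothing-from-x of λ ()
    where
    R≤x = countAbove≡0⇒≤ x R above-x
    nothing-from-x : 0 + count132From x R + countBetweenAll x L R ≡ 0
    nothing-from-x = cong₂ (λ u v → 0 + u + v) (count132From-≤ x R R≤x) (countBetweenAll-≤ x L R R≤x)
  ... | suc g = x-is-last L refl
    where
    no-3-in-L : countBetweenAll x L R ≡ 0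
    no-3-in-L = proj₂ (+≡0⁻ _ _ (NP.suc-injective from-x≡1))
    one-above : suc g ≡ 1
    one-above = cong suc (proj₁ (+≡0⁻ _ _ (proj₁ (+≡0⁻ _ _ (NP.suc-injective from-x≡1)))))
    x-is-last : ∀ L₀ → L₀ ≡ L → ∃[ L′ ] ∃[ a ] (x ∷ L ≡ L′ ++ (a ∷ []) × All (λ x → All (_≤ x) R) L′ × countAbove a R ≡ 1)
    x-is-last [] refl = [] , x , refl , [] , trans above-x one-above
    x-is-last (y ∷ L₀) refl with countAbove≢0⇒∃ x R (λ eq → case trans (sym above-x) eq of λ ())
    ... | c , c∈R , x<c = ⊥-elim (NP.<-irrefl refl (NP.<-≤-trans
            (NP.≤-trans (countBetween-∈ x y c R c∈R x<c c<y) (countBetween≤countBetweenAll x y L R (here refl)))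
            (NP.≤-reflexive no-3-in-L)))
      where
      c≤y : c ≤ y
      c≤y = All.lookup (All.head (count132Across≡0⇒≤ (y ∷ L₀) N R L≤N R<N rest≡0)) c∈R
      c<y : c < y
      c<y = NP.≤∧≢⇒< c≤y (λ c≡y → All.lookup (All.head L#R) c∈R (sym c≡y))

  countAbove≡1⇒split : ∀ a R → countAbove a R ≡ 1 → ∃[ R1 ] ∃[ c ] ∃[ R2 ] (R ≡ R1 ++ c ∷ R2 × a < c × All (_≤ a) R1 × All (_≤ a) R2)
  countAbove≡1⇒split a [] ()
  countAbove≡1⇒split a (z ∷ R) e with a <ᵇ z in q
  ... | true = [] , z , R , refl , NP.<ᵇ⇒< a z (≡true⇒T q) , [] , countAbove≡0⇒≤ a R (NP.suc-injective e)
  ... | false with countAbove≡1⇒split a R e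
  ...   | R1 , c , R2 , refl , ac , p1 , p2′ = z ∷ R1 , c , R2 , refl , ac , <ᵇ-false⇒≥ q ∷ p1 , p2′

  ascends-≤ : ∀ m y R → All (_≤ y) R → ascends (suc m) y R ≡ false
  ascends-≤ m y [] [] = refl
  ascends-≤ m y (z ∷ R) (p ∷ ps) rewrite <ᵇ-false-≤ {y} {z} p = ascends-≤ m y R ps

  ascendsWith : ℕ → ℕ → List ℕ → Bool
  ascendsWith zero y zs = true
  ascendsWith (suc m) y zs = ascends m y zs

  ascends-max : ∀ m y zs N R → y < N → All (_< N) zs → All (_≤ y) R → ascends m y (zs ++ N ∷ R) ≡ ascendsWith m y zs
  ascends-max zero y zs N R yN pz pR = refl
  ascends-max (suc zero) y [] N R yN [] pR rewrite <ᵇ-true yN = refl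
  ascends-max (suc (suc m)) y [] N R yN [] pR rewrite <ᵇ-true yN | ascends-≤ (suc m) y R pR
    | ascends-≤ m N R (All.map (λ p → NP.≤-trans p (NP.<⇒≤ yN)) pR) = refl
  ascends-max (suc m) y (z ∷ zs) N R yN (zN ∷ pz) pR with y <ᵇ z in q
  ... | true rewrite ascends-max m z zs N R zN pz (All.map (λ p → NP.≤-trans p (NP.<⇒≤ (NP.<ᵇ⇒< y z (≡true⇒T q)))) pR)
                   | ascends-max (suc m) y zs N R yN pz pR = fold m
    where fold : ∀ m → ascendsWith m z zs ∨ ascends m y zs ≡ ascends m y (z ∷ zs)
          fold zero = refl
          fold (suc m) rewrite q = refl
  ... | false rewrite ascends-max (suc m) y zs N R yN pz pR = fold m
    where fold : ∀ m → ascends m y zs ≡ ascends m y (z ∷ zs)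
          fold zero = refl
          fold (suc m) rewrite q = refl

  -- Whenever L rises to y, all of R lies below y, so no ascent started in L can continue into R.
  RisesDominate : List ℕ → List ℕ → Set
  RisesDominate (x ∷ y ∷ L) R = (T (x <ᵇ y) → All (_≤ y) R) × RisesDominate (y ∷ L) R
  RisesDominate _ R = ⊤

  containsRise-∷-max : ∀ m N R → All (_< N) R → containsRise m (N ∷ R) ≡ containsRise m R
  containsRise-∷-max m N [] [] = refl
  containsRise-∷-max m N (z ∷ R) (p ∷ ps) rewrite <ᵇ-false-≤ {N} {z} (NP.<⇒≤ p) = refl

  containsRise-split-max : ∀ m L N R → All (_< N) L → All (_< N) R → RisesDominate L R → containsRise m (L ++ N ∷ R) ≡ contains (suc m) L ∨ containsRise m R
  containsRise-split-max zero [] N R pL pR ro = containsRise-∷-max zero N R pR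
  containsRise-split-max (suc m) [] N R pL pR ro = containsRise-∷-max (suc m) N R pR
  containsRise-split-max zero (x ∷ []) N R (xN ∷ []) pR ro rewrite <ᵇ-true xN = refl
  containsRise-split-max (suc m) (x ∷ []) N R (xN ∷ []) pR ro rewrite <ᵇ-true xN | ascends-≤ m N R (All.map NP.<⇒≤ pR) = containsRise-∷-max (suc m) N R pR
  containsRise-split-max m (x ∷ y ∷ L) N R (xN ∷ yN ∷ pL) pR (f , ro) =
    trans (cong (λ v → ((x <ᵇ y) ∧ ascends m y (L ++ N ∷ R)) ∨ v) (containsRise-split-max m (y ∷ L) N R (yN ∷ pL) pR ro)) first-rise
    where
    first-rise : ((x <ᵇ y) ∧ ascends m y (L ++ N ∷ R)) ∨ (contains (suc m) (y ∷ L) ∨ containsRise m R) ≡ contains (suc m) (x ∷ y ∷ L) ∨ containsRise m R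
    first-rise with x <ᵇ y in q
    ... | true rewrite ascends-max m y L N R yN pL (f tt) = fold m
      where fold : ∀ m → ascendsWith m y L ∨ (contains (suc m) (y ∷ L) ∨ containsRise m R) ≡ contains (suc m) (x ∷ y ∷ L) ∨ containsRise m R
            fold zero = refl
            fold (suc m) rewrite q = sym (BP.∨-assoc (ascends m y L) _ _)
    ... | false = fold m
      where fold : ∀ m → contains (suc m) (y ∷ L) ∨ containsRise m R ≡ contains (suc m) (x ∷ y ∷ L) ∨ containsRise m R
            fold zero = refl
            fold (suc m) rewrite q = refl

  RisesDominate-all : ∀ L R → All (λ x → All (_≤ x) R) L → RisesDominate L R
  RisesDominate-all [] R _ = tt
  RisesDominate-all (x ∷ []) R _ = tt
  RisesDominate-all (x ∷ y ∷ L) R (px ∷ py ∷ ps) = (λ _ → py) , RisesDominate-all (y ∷ L) R (py ∷ ps)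

  RisesDominate-∷ʳ : ∀ L a R → All (λ x → All (_≤ x) R) L → All (a <_) L → RisesDominate (L ++ (a ∷ [])) R
  RisesDominate-∷ʳ [] a R _ _ = tt
  RisesDominate-∷ʳ (x ∷ []) a R _ (ax ∷ []) = (λ t → ⊥-elim (NP.<-asym ax (NP.<ᵇ⇒< x a t))) , tt
  RisesDominate-∷ʳ (x ∷ y ∷ L) a R (px ∷ py ∷ ps) (ax ∷ ay ∷ as) = (λ _ → py) , RisesDominate-∷ʳ (y ∷ L) a R (py ∷ ps) (ay ∷ as)

  ascends-∷ʳ-min : ∀ m y zs a → a < y → All (a <_) zs → ascends m y (zs ++ (a ∷ [])) ≡ ascends m y zs
  ascends-∷ʳ-min zero y zs a ay az = refl
  ascends-∷ʳ-min (suc m) y [] a ay [] rewrite <ᵇ-false-≤ {y} {a} (NP.<⇒≤ ay) = refl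
  ascends-∷ʳ-min (suc m) y (z ∷ zs) a ay (az ∷ as) rewrite ascends-∷ʳ-min m z zs a az as | ascends-∷ʳ-min (suc m) y zs a ay as = refl

  containsRise-∷ʳ-min : ∀ m L a → All (a <_) L → containsRise m (L ++ (a ∷ [])) ≡ containsRise m L
  containsRise-∷ʳ-min m [] a _ = refl
  containsRise-∷ʳ-min m (x ∷ []) a (ax ∷ []) rewrite <ᵇ-false-≤ {x} {a} (NP.<⇒≤ ax) = refl
  containsRise-∷ʳ-min m (x ∷ y ∷ L) a (ax ∷ ay ∷ as) = cong₂ (λ u v → ((x <ᵇ y) ∧ u) ∨ v) (ascends-∷ʳ-min m y L a ay as) (containsRise-∷ʳ-min m (y ∷ L) a (ay ∷ as))

  countBetweenAll-[min] : ∀ x L a → a < x → countBetweenAll x L (a ∷ []) ≡ 0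
  countBetweenAll-[min] x [] a ax = refl
  countBetweenAll-[min] x (y ∷ L) a ax rewrite <ᵇ-false-≤ {x} {a} (NP.<⇒≤ ax) = countBetweenAll-[min] x L a ax

  count132Across-[min] : ∀ L a → All (a <_) L → count132Across L (a ∷ []) ≡ 0
  count132Across-[min] [] a _ = refl
  count132Across-[min] (x ∷ L) a (ax ∷ as) rewrite countBetweenAll-[min] x L a ax = count132Across-[min] L a as

  count132-∷ʳ-min : ∀ L a → All (a <_) L → count132 (L ++ (a ∷ [])) ≡ count132 L
  count132-∷ʳ-min L a as rewrite count132-++ L (a ∷ []) | count132Across-[min] L a as = trans (NP.+-identityʳ _) (NP.+-identityʳ _)

  count132Across-prefix : ∀ L′ ys N R → All (λ x → All (_≤ x) R) L′ → All (_≤ N) (L′ ++ ys) → count132Across (L′ ++ ys) (N ∷ R) ≡ count132Across ys (N ∷ R)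
  count132Across-prefix [] ys N R _ _ = refl
  count132Across-prefix (x ∷ L′) ys N R (q ∷ qs) (_ ∷ pN)
    rewrite countBetween-≤ x N R q | count132From-≤ x R q | countBetweenAll-∷-above x (L′ ++ ys) N R pN | countBetweenAll-≤ x (L′ ++ ys) R q = count132Across-prefix L′ ys N R qs pN

  countBetween-gap : ∀ x y zs → y ≤ suc x → countBetween x y zs ≡ 0
  countBetween-gap x y [] p = refl
  countBetween-gap x y (z ∷ zs) p with x <ᵇ z in q
  ... | true rewrite <ᵇ-false-≤ {z} {y} (NP.≤-trans p (NP.<ᵇ⇒< x z (≡true⇒T q))) = countBetween-gap x y zs p
  ... | false = countBetween-gap x y zs p

  count132From-gap : ∀ x R → All (_≤ suc x) R → count132From x R ≡ 0
  count132From-gap x [] [] = refl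
  count132From-gap x (y ∷ R) (p ∷ ps) = cong₂ _+_ (countBetween-gap x y R p) (count132From-gap x R ps)

module MaxSplit where

  open Booleans
  open Counting
  open Permutations
  open Occurrences
  open Decomposition
  open import Data.Bool using (Bool; true; false; _∨_; if_then_else_)
  open import Data.Empty using (⊥-elim)
  open import Data.List using (List; []; _∷_; map; length; _++_)
  open import Data.List.Membership.Propositional using (_∈_)
  import Data.List.Membership.Propositional.Properties as MP
  import Data.List.Properties as LP
  open import Data.List.Relation.Unary.All as All using (All; []; _∷_)
  import Data.List.Relation.Unary.All.Properties as AllP
  open import Data.List.Relation.Unary.Any using (here; there)
  open import Data.List.Relation.Unary.Unique.Propositional using (Unique; []; _∷_)
  open import Data.Nat as ℕ using (ℕ; zero; suc; _+_; _∸_; _<_; _≤_; _<ᵇ_; _≡ᵇ_; z≤n; s≤s)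
  import Data.Nat.Properties as NP
  open import Data.Product using (_×_; _,_; proj₁; proj₂; ∃-syntax)
  open import Data.Sum using (_⊎_; inj₁; inj₂)
  open import Data.Unit using (⊤; tt)
  open import Function using (_∘_; case_of_)
  open import Relation.Binary.PropositionalEquality
  open import Relation.Nullary using (yes; no)

  ≤∧≢⇒<-AllAll : ∀ L R → All (λ x → All (_≤ x) R) L → All (λ x → All (x ≢_) R) L → All (λ x → All (_< x) R) L
  ≤∧≢⇒<-AllAll L R L≥R L#R =
    All.zipWith (λ (x≥R , x∉R) → All.zipWith (λ (z≤x , x≢z) → NP.≤∧≢⇒< z≤x (x≢z ∘ sym)) (x≥R , x∉R)) (L≥R , L#R)

  +-<ᵇ : ∀ r a b → (r + a <ᵇ r + b) ≡ (a <ᵇ b)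
  +-<ᵇ zero a b = refl
  +-<ᵇ (suc r) a b = +-<ᵇ r a b

  Everywhere : ℕ → Set
  Everywhere _ = ⊤

  +-<ᵇ′ : ∀ r a b → Everywhere a → Everywhere b → (r + a <ᵇ r + b) ≡ (a <ᵇ b)
  +-<ᵇ′ r a b _ _ = +-<ᵇ r a b

  module Shift (r : ℕ) = OrderPreserving (r +_) Everywhere (+-<ᵇ′ r)

  All-⊤ : ∀ (xs : List ℕ) → All Everywhere xs
  All-⊤ xs = All.tabulate (λ _ → tt)

  bump : ℕ → ℕ → ℕ
  bump r v = if v ≡ᵇ r then suc r else v

  bump-self : ∀ r → bump r r ≡ suc r
  bump-self r rewrite ≡ᵇ-refl r = refl

  bump-below : ∀ r v → v < r → bump r v ≡ v
  bump-below r v p rewrite ≡ᵇ-false {v} {r} (λ e → NP.<-irrefl e p) = refl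

  bump-cases : ∀ r v → v ≤ r → (v ≡ r × bump r v ≡ suc r) ⊎ (v < r × bump r v ≡ v)
  bump-cases r v p with v ℕ.≟ r
  ... | yes refl = inj₁ (refl , bump-self r)
  ... | no ne = inj₂ (NP.≤∧≢⇒< p ne , bump-below r v (NP.≤∧≢⇒< p ne))

  bump-<ᵇ : ∀ r a b → a ≤ r → b ≤ r → (bump r a <ᵇ bump r b) ≡ (a <ᵇ b)
  bump-<ᵇ r a b p q with bump-cases r a p | bump-cases r b q
  ... | inj₁ (refl , e1) | inj₁ (refl , e2) rewrite e1 = refl
  ... | inj₁ (refl , e1) | inj₂ (bl , e2) rewrite e1 | e2 = trans (<ᵇ-false-≤ {suc a} {b} (NP.≤-trans (NP.<⇒≤ bl) (NP.n≤1+n a))) (sym (<ᵇ-false-≤ (NP.<⇒≤ bl)))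
  ... | inj₂ (al , e1) | inj₁ (refl , e2) rewrite e1 | e2 = trans (<ᵇ-true (NP.≤-trans al (NP.n≤1+n b))) (sym (<ᵇ-true al))
  ... | inj₂ (al , e1) | inj₂ (bl , e2) rewrite e1 | e2 = refl

  module Bump (r : ℕ) = OrderPreserving (bump r) (_≤ r) (bump-<ᵇ r)

  bump-injective : ∀ r a b → a ≤ r → b ≤ r → bump r a ≡ bump r b → a ≡ b
  bump-injective r a b p q e with bump-cases r a p | bump-cases r b q
  ... | inj₁ (refl , e1) | inj₁ (refl , e2) = refl
  ... | inj₁ (refl , e1) | inj₂ (bl , e2) = ⊥-elim (NP.<-irrefl refl (NP.<-trans (subst (_< a) (trans (sym e2) (trans (sym e) e1)) bl) (NP.n<1+n a)))
  ... | inj₂ (al , e1) | inj₁ (refl , e2) = ⊥-elim (NP.<-irrefl refl (NP.<-trans (subst (_< b) (trans (sym e1) (trans e e2)) al) (NP.n<1+n b)))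
  ... | inj₂ (al , e1) | inj₂ (bl , e2) = trans (sym e1) (trans e e2)

  map-bump-below : ∀ r xs → All (_< r) xs → map (bump r) xs ≡ xs
  map-bump-below r [] [] = refl
  map-bump-below r (x ∷ xs) (p ∷ ps) = cong₂ _∷_ (bump-below r x p) (map-bump-below r xs ps)

  bump-bounds : ∀ r {v} → 0 < v → v ≤ r → 0 < bump r v × bump r v ≤ suc r × bump r v ≢ r
  bump-bounds r {v} 0<v v≤r with bump-cases r v v≤r
  ... | inj₁ (refl , bump≡) rewrite bump≡ = s≤s z≤n , NP.≤-refl , λ eq → NP.<-irrefl (sym eq) (NP.n<1+n v)
  ... | inj₂ (v<r , bump≡) rewrite bump≡ = 0<v , NP.≤-trans (NP.<⇒≤ v<r) (NP.n≤1+n r) , λ eq → NP.<-irrefl eq v<r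

  IsPerm-bump : ∀ r ρ → 1 ≤ r → IsPerm r ρ → IsPerm (suc r) (r ∷ map (bump r) ρ)
  IsPerm-bump r ρ 1≤r (|ρ|≡r , ρ! , ρ-bounded) =
    cong suc (trans (LP.length-map (bump r) ρ) |ρ|≡r) ,
    AllP.map⁺ (All.map (λ (0<v , v≤r) r≡ → proj₂ (proj₂ (bump-bounds r 0<v v≤r)) (sym r≡)) ρ-bounded) ∷
      Unique-map⁺-on (bump r) ρ ρ! (λ a∈ b∈ → bump-injective r _ _ (proj₂ (All.lookup ρ-bounded a∈)) (proj₂ (All.lookup ρ-bounded b∈))) ,
    (1≤r , NP.n≤1+n r) ∷ AllP.map⁺ (All.map (λ (0<v , v≤r) → let 0<b , b≤ , _ = bump-bounds r 0<v v≤r in 0<b , b≤) ρ-bounded)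

  countAbove-bump : ∀ r ρ → IsPerm r ρ → 1 ≤ r → countAbove r (map (bump r) ρ) ≡ 1
  countAbove-bump r ρ (l , u , al) p with MP.∈-∃++ (IsPerm-∋ r (l , u , al) p NP.≤-refl)
  ... | A , B , refl = begin
      countAbove r (map (bump r) (A ++ r ∷ B))
    ≡⟨ cong (countAbove r) (LP.map-++ (bump r) A (r ∷ B)) ⟩
      countAbove r (map (bump r) A ++ bump r r ∷ map (bump r) B)
    ≡⟨ countAbove-++ r (map (bump r) A) _ ⟩
      countAbove r (map (bump r) A) + countAbove r (bump r r ∷ map (bump r) B)
    ≡⟨ cong₂ _+_ (trans (cong (countAbove r) (map-bump-below r A ltA)) (≤⇒countAbove≡0 r A (All.map NP.<⇒≤ ltA)))
         (cong₂ (λ u v → countAbove r (u ∷ v)) (bump-self r) (map-bump-below r B ltB)) ⟩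
      countAbove r (suc r ∷ B)
    ≡⟨ countAbove-∷-above r (suc r) B (NP.n<1+n r) ⟩
      1 + countAbove r B
    ≡⟨ cong suc (≤⇒countAbove≡0 r B (All.map NP.<⇒≤ ltB)) ⟩
      1 ∎
    where
    open ≡-Reasoning
    U = Unique-++⁻ A u
    aA = AllP.++⁻ˡ A al
    aB = All.tail (AllP.++⁻ʳ A al)
    ltA : All (_< r) A
    ltA = All.zipWith (λ ((_ , q) , d) → NP.≤∧≢⇒< q (λ e → All.head d e)) (aA , proj₂ (proj₂ U))
    ltB : All (_< r) B
    ltB with proj₁ (proj₂ U)
    ... | nr ∷ _ = All.zipWith (λ ((_ , q) , d) → NP.≤∧≢⇒< q (λ e → d (sym e))) (aB , nr)

  -- m is the length of σ, which is shifted onto the values above those of ρ.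
  joinAtMax : ℕ → ℕ → List ℕ → List ℕ → List ℕ
  joinAtMax n m σ ρ = map ((n ∸ m) +_) σ ++ suc n ∷ ρ

  record JoinAtMax (n m : ℕ) (σ ρ : List ℕ) : Set where
    field
      perm : IsPerm (suc n) (joinAtMax n m σ ρ)
      c132eq : count132 (joinAtMax n m σ ρ) ≡ count132 σ + count132 ρ
      conteq : ∀ j → contains (2 + j) (joinAtMax n m σ ρ) ≡ (contains (1 + j) σ ∨ contains (2 + j) ρ)
      sep : All (λ x → All (_≤ x) ρ) (map ((n ∸ m) +_) σ)

  joinAtMax-ok : ∀ n m σ ρ → m ≤ n → IsPerm m σ → IsPerm (n ∸ m) ρ → JoinAtMax n m σ ρ
  joinAtMax-ok n m σ ρ m≤n σ-perm@(_ , _ , σ-bounded) ρ-perm@(_ , _ , ρ-bounded) = record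
    { perm = IsPerm-insert-max n L ρ (subst (λ k → IsPerm k (L ++ ρ)) (NP.m+[n∸m]≡n m≤n) (IsPerm-blocks⁺ r m σ ρ σ-perm ρ-perm))
    ; c132eq = c132eq
    ; conteq = λ j → trans (containsRise-split-max j L N ρ L<N ρ<N (RisesDominate-all L ρ L≥ρ))
                           (cong (_∨ containsRise j ρ) (Shift.contains-map r (suc j) σ (All-⊤ σ)))
    ; sep = L≥ρ }
    where
    r = n ∸ m
    N = suc n
    L = map (r +_) σ
    L-bounds : All (λ x → r < x × x ≤ n) L
    L-bounds = AllP.map⁺ (All.map (λ (0<v , v≤m) → NP.m<m+n r 0<v ,
                                     NP.≤-trans (NP.+-monoʳ-≤ r v≤m) (NP.≤-reflexive (NP.m∸n+n≡m m≤n))) σ-bounded)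
    L≥ρ : All (λ x → All (_≤ x) ρ) L
    L≥ρ = All.map (λ (r<x , _) → All.map (λ (_ , z≤r) → NP.≤-trans z≤r (NP.<⇒≤ r<x)) ρ-bounded) L-bounds
    L<N : All (_< N) L
    L<N = All.map (λ (_ , x≤n) → s≤s x≤n) L-bounds
    ρ<N : All (_< N) ρ
    ρ<N = All.map (λ (_ , z≤r) → s≤s (NP.≤-trans z≤r (NP.m∸n≤m n m))) ρ-bounded
    c132eq : count132 (L ++ N ∷ ρ) ≡ count132 σ + count132 ρ
    c132eq = begin
      count132 (L ++ N ∷ ρ)                                        ≡⟨ count132-++ L (N ∷ ρ) ⟩
      count132 L + count132 (N ∷ ρ) + count132Across L (N ∷ ρ)     ≡⟨ cong₂ (λ u v → u + v + count132Across L (N ∷ ρ))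
                                                                          (Shift.count132-map r σ (All-⊤ σ))
                                                                          (count132-∷-max N ρ (All.map NP.<⇒≤ ρ<N)) ⟩
      count132 σ + count132 ρ + count132Across L (N ∷ ρ)           ≡⟨ cong (count132 σ + count132 ρ +_)
                                                                          (≤⇒count132Across≡0 L N ρ L≥ρ (All.map NP.<⇒≤ L<N)) ⟩
      count132 σ + count132 ρ + 0                                  ≡⟨ NP.+-identityʳ _ ⟩
      count132 σ + count132 ρ                                      ∎
      where open ≡-Reasoning

  splitAtMax : ∀ n L R → IsPerm (suc n) (L ++ suc n ∷ R) → All (λ x → All (_≤ x) R) L →
    ∃[ σ ] (length L ≤ n × IsPerm (length L) σ × IsPerm (n ∸ length L) R × L ++ suc n ∷ R ≡ joinAtMax n (length L) σ R)
  splitAtMax n L R π-perm L≥R =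
    σ , m≤n , σ-perm , subst (λ k → IsPerm k R) (sym n∸m≡r) R-perm , cong (_++ suc n ∷ R) (sym L≡)
    where
    m = length L
    r = length R
    L++R-perm = IsPerm-remove-max n L R π-perm
    L! = proj₁ (Unique-++⁻ L (proj₁ (proj₂ L++R-perm)))
    L>R = ≤∧≢⇒<-AllAll L R L≥R (proj₂ (proj₂ (Unique-++⁻ L (proj₁ (proj₂ L++R-perm)))))
    R-perm = proj₁ (IsPerm-blocks⁻ n L R L++R-perm L>R)
    L-bounds = proj₂ (IsPerm-blocks⁻ n L R L++R-perm L>R)
    m+r≡n : m + r ≡ n
    m+r≡n = trans (sym (LP.length-++ L)) (proj₁ L++R-perm)
    n∸m≡r : n ∸ m ≡ r
    n∸m≡r = trans (cong (_∸ m) (sym m+r≡n)) (NP.m+n∸m≡n m r)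
    m≤n : m ≤ n
    m≤n = subst (m ≤_) m+r≡n (NP.m≤m+n m r)
    σ = map (_∸ r) L
    σ-perm : IsPerm m σ
    σ-perm = IsPerm-unshift r m L L! (All.map (λ (r<x , x≤n) → r<x , subst (_ ≤_) (trans (sym m+r≡n) (NP.+-comm m r)) x≤n) L-bounds) refl
    L≡ : map ((n ∸ m) +_) σ ≡ L
    L≡ = trans (cong (λ t → map (t +_) σ) n∸m≡r) (map-+-∸ r L (All.map (NP.<⇒≤ ∘ proj₁) L-bounds))

  -- σ shifted above r, then r, the maximum N, and ρ with its entry r replaced by r + 1:
  -- the entries r, N, r + 1 form the unique occurrence of 1-3-2 through the maximum.
  joinThroughMax : ℕ → List ℕ → List ℕ → ℕ → List ℕ
  joinThroughMax r σ ρ N = (map (suc r +_) σ ++ r ∷ []) ++ N ∷ map (bump r) ρ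

  record JoinThroughMax (r s : ℕ) (σ ρ : List ℕ) : Set where
    field
      perm : IsPerm (suc (suc (s + r))) (joinThroughMax r σ ρ (suc (suc (s + r))))
      c132eq : count132 (joinThroughMax r σ ρ (suc (suc (s + r)))) ≡ (count132 σ + count132 ρ) + 1
      conteq : ∀ j → contains (3 + j) (joinThroughMax r σ ρ (suc (suc (s + r)))) ≡ (contains (2 + j) σ ∨ contains (3 + j) ρ)
      sucr∈ : suc r ∈ map (bump r) ρ

  joinThroughMax-ok : ∀ r s σ ρ → 1 ≤ r → IsPerm s σ → IsPerm r ρ → JoinThroughMax r s σ ρ
  joinThroughMax-ok r s σ ρ 1≤r σ-perm@(_ , _ , σ-bounded) ρ-perm@(_ , _ , ρ-bounded) = record
    { perm = IsPerm-insert-max (suc (s + r)) L R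
               (subst₂ IsPerm (NP.+-suc s r) (sym (LP.++-assoc L′ (r ∷ []) R)) (IsPerm-blocks⁺ (suc r) s σ (r ∷ R) σ-perm (IsPerm-bump r ρ 1≤r ρ-perm)))
    ; c132eq = c132eq
    ; conteq = λ j → trans (containsRise-split-max (suc j) L N R L<N R<N (RisesDominate-∷ʳ L′ r R L′≥R L′>r))
                      (cong₂ _∨_ (trans (containsRise-∷ʳ-min j L′ r L′>r) (Shift.containsRise-map (suc r) j σ (All-⊤ σ)))
                                 (Bump.containsRise-map r (suc j) ρ (All.map proj₂ ρ-bounded)))
    ; sucr∈ = subst (_∈ R) (bump-self r) (MP.∈-map⁺ (bump r) (IsPerm-∋ r ρ-perm 1≤r NP.≤-refl)) }
    where
    N = suc (suc (s + r))
    L′ = map (suc r +_) σ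
    L = L′ ++ r ∷ []
    R = map (bump r) ρ
    L′-bounds : All (λ x → suc r < x × x ≤ suc (s + r)) L′
    L′-bounds = AllP.map⁺ (All.map (λ (0<v , v≤s) → NP.m<m+n (suc r) 0<v ,
                                       NP.≤-trans (NP.+-monoʳ-≤ (suc r) v≤s) (NP.≤-reflexive (cong suc (NP.+-comm r s)))) σ-bounded)
    L′>r : All (r <_) L′
    L′>r = All.map (λ (r+1<x , _) → NP.<-trans (NP.n<1+n r) r+1<x) L′-bounds
    R-bounds : All (λ w → 0 < w × w ≤ suc r × w ≢ r) R
    R-bounds = AllP.map⁺ (All.map (λ (0<v , v≤r) → bump-bounds r 0<v v≤r) ρ-bounded)
    r+1<N : suc r < N
    r+1<N = s≤s (s≤s (NP.m≤n+m r s))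
    L′≥R : All (λ x → All (_≤ x) R) L′
    L′≥R = All.map (λ (r+1<x , _) → All.map (λ (_ , w≤ , _) → NP.≤-trans w≤ (NP.<⇒≤ r+1<x)) R-bounds) L′-bounds
    L<N : All (_< N) L
    L<N = AllP.++⁺ (All.map (λ (_ , x≤) → s≤s x≤) L′-bounds) (NP.<-trans (NP.n<1+n r) r+1<N ∷ [])
    R<N : All (_< N) R
    R<N = All.map (λ (_ , w≤ , _) → NP.≤-<-trans w≤ r+1<N) R-bounds
    across≡1 : count132Across L (N ∷ R) ≡ 1
    across≡1 = begin
      count132Across (L′ ++ r ∷ []) (N ∷ R)
        ≡⟨ count132Across-prefix L′ (r ∷ []) N R L′≥R (All.map NP.<⇒≤ L<N) ⟩
      countBetween r N R + count132From r R + 0 + 0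
        ≡⟨ cong₂ (λ u v → u + v + 0 + 0) (trans (countBetween-max r N R R<N) (countAbove-bump r ρ ρ-perm 1≤r))
                                        (count132From-gap r R (All.map (λ (_ , w≤ , _) → w≤) R-bounds)) ⟩
      1 ∎
      where open ≡-Reasoning
    c132eq : count132 (L ++ N ∷ R) ≡ count132 σ + count132 ρ + 1
    c132eq = trans (count132-++ L (N ∷ R)) (cong₂ _+_ (cong₂ _+_
       (trans (count132-∷ʳ-min L′ r L′>r) (Shift.count132-map (suc r) σ (All-⊤ σ)))
       (trans (count132-∷-max N R (All.map NP.<⇒≤ R<N)) (Bump.count132-map r ρ (All.map proj₂ ρ-bounded))))
       across≡1)

  IsPerm-second-largest : ∀ r a R₁ c R₂ → IsPerm (suc r) (a ∷ R₁ ++ c ∷ R₂) → a < c → All (_≤ a) R₁ → All (_≤ a) R₂ →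
    a ≡ r × c ≡ suc r
  IsPerm-second-largest r a R₁ c R₂ (|R|≡ , a∉R ∷ R! , bounded) a<c R₁≤a R₂≤a with Unique-++⁻ R₁ R!
  ... | R₁! , c∉R₂ ∷ R₂! , R₁#c∷R₂ = a≡r , c≡r+1
    where
    R-bounds = All.tail bounded
    r≤a : r ≤ a
    r≤a = subst (_≤ a) |R₁++R₂|+1≡r (pigeonhole 0 a (a ∷ R₁ ++ R₂) (a∉R₁++R₂ ∷ Unique-++⁺ R₁ R₁! R₂! (All.map All.tail R₁#c∷R₂))
            ((proj₁ (All.head bounded) , NP.≤-refl) ∷ AllP.++⁺ (positive-≤ R₁ (AllP.++⁻ˡ R₁ R-bounds) R₁≤a)
                                                                (positive-≤ R₂ (All.tail (AllP.++⁻ʳ R₁ R-bounds)) R₂≤a)))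
      where
      a∉R₁++R₂ = AllP.++⁺ (AllP.++⁻ˡ R₁ a∉R) (All.tail (AllP.++⁻ʳ R₁ a∉R))
      positive-≤ : ∀ xs → All (λ v → 0 < v × v ≤ suc r) xs → All (_≤ a) xs → All (λ v → 0 < v × v ≤ a) xs
      positive-≤ xs b ≤a = All.zipWith (λ ((0<v , _) , v≤a) → 0<v , v≤a) (b , ≤a)
      |R₁++R₂|+1≡r : length (a ∷ R₁ ++ R₂) ≡ r
      |R₁++R₂|+1≡r = NP.suc-injective (begin
        suc (suc (length (R₁ ++ R₂)))             ≡⟨ cong (suc ∘ suc) (LP.length-++ R₁) ⟩
        suc (suc (length R₁ + length R₂))         ≡⟨ cong suc (NP.+-suc (length R₁) (length R₂)) ⟨
        suc (length R₁ + length (c ∷ R₂))         ≡⟨ cong suc (LP.length-++ R₁) ⟨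
        length (a ∷ R₁ ++ c ∷ R₂)                 ≡⟨ |R|≡ ⟩
        suc r                                     ∎)
        where open ≡-Reasoning
    c≤r+1 : c ≤ suc r
    c≤r+1 = proj₂ (All.head (AllP.++⁻ʳ R₁ R-bounds))
    a≡r : a ≡ r
    a≡r = NP.≤-antisym (NP.≤-pred (NP.≤-trans a<c c≤r+1)) r≤a
    c≡r+1 : c ≡ suc r
    c≡r+1 = NP.≤-antisym c≤r+1 (subst (λ t → suc t ≤ c) a≡r a<c)

  IsPerm-unbump : ∀ r R₁ R₂ → IsPerm (suc r) (r ∷ R₁ ++ suc r ∷ R₂) →
    IsPerm r (R₁ ++ r ∷ R₂) × map (bump r) (R₁ ++ r ∷ R₂) ≡ R₁ ++ suc r ∷ R₂
  IsPerm-unbump r R₁ R₂ (|R|≡ , r∉R ∷ R! , bounded) with Unique-++⁻ R₁ R!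
  ... | R₁! , r+1∉R₂ ∷ R₂! , R₁#r+1∷R₂ = (|ρ|≡ , ρ! , ρ-bounds) , map-bump
    where
    R-bounds = All.tail bounded
    below-r : ∀ {v} → v ≢ r → v ≢ suc r → 0 < v × v ≤ suc r → v < r
    below-r v≢r v≢r+1 (_ , v≤r+1) = NP.≤∧≢⇒< (below-max v≤r+1 v≢r+1) v≢r
    R₁<r : All (_< r) R₁
    R₁<r = All.zipWith (λ ((v≢r , v∉) , b) → below-r v≢r (All.head v∉) b)
             (All.zip (All.map (_∘ sym) (AllP.++⁻ˡ R₁ r∉R) , R₁#r+1∷R₂) , AllP.++⁻ˡ R₁ R-bounds)
    R₂<r : All (_< r) R₂
    R₂<r = All.zipWith (λ ((v≢r , r+1≢v) , b) → below-r v≢r (r+1≢v ∘ sym) b)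
             (All.zip (All.map (_∘ sym) (All.tail (AllP.++⁻ʳ R₁ r∉R)) , r+1∉R₂) , All.tail (AllP.++⁻ʳ R₁ R-bounds))
    |ρ|≡ : length (R₁ ++ r ∷ R₂) ≡ r
    |ρ|≡ = NP.suc-injective (trans (cong suc (LP.length-++ R₁)) (trans (sym (cong suc (LP.length-++ R₁))) |R|≡))
    ρ! : Unique (R₁ ++ r ∷ R₂)
    ρ! = Unique-++⁺ R₁ R₁! (All.map (λ v<r r≡v → NP.<-irrefl (sym r≡v) v<r) R₂<r ∷ R₂!)
           (All.zipWith (λ (v<r , v∉) → (λ v≡r → NP.<-irrefl v≡r v<r) ∷ All.tail v∉) (R₁<r , R₁#r+1∷R₂))
    ρ-bounds : All (λ v → 0 < v × v ≤ r) (R₁ ++ r ∷ R₂)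
    ρ-bounds = AllP.++⁺ (All.zipWith (λ ((0<v , _) , v<r) → 0<v , NP.<⇒≤ v<r) (AllP.++⁻ˡ R₁ R-bounds , R₁<r))
                 ((proj₁ (All.head bounded) , NP.≤-refl) ∷
                  All.zipWith (λ ((0<v , _) , v<r) → 0<v , NP.<⇒≤ v<r) (All.tail (AllP.++⁻ʳ R₁ R-bounds) , R₂<r))
    map-bump : map (bump r) (R₁ ++ r ∷ R₂) ≡ R₁ ++ suc r ∷ R₂
    map-bump = trans (LP.map-++ (bump r) R₁ (r ∷ R₂))
      (cong₂ _++_ (map-bump-below r R₁ R₁<r) (cong₂ _∷_ (bump-self r) (map-bump-below r R₂ R₂<r)))

  splitThroughMax : ∀ n L′ a R → IsPerm (suc n) ((L′ ++ a ∷ []) ++ suc n ∷ R) → All (λ x → All (_≤ x) R) L′ → countAbove a R ≡ 1 →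
    ∃[ r ] ∃[ σ ] ∃[ ρ ] (1 ≤ r × suc (length L′ + r) ≡ n × IsPerm (length L′) σ × IsPerm r ρ ×
       (L′ ++ a ∷ []) ++ suc n ∷ R ≡ joinThroughMax r σ ρ (suc n))
  splitThroughMax n L′ a R π-perm L′≥R one-above with countAbove≡1⇒split a R one-above
  ... | R₁ , c , R₂ , refl , a<c , R₁≤a , R₂≤a =
    r , σ , ρ , 1≤r , sizes , σ-perm , ρ-perm ,
    trans (cong₂ (λ L t → (L ++ t ∷ []) ++ suc n ∷ R) (sym L′≡) a≡r)
          (cong (λ t → (map (suc r +_) σ ++ r ∷ []) ++ suc n ∷ t) (sym map-bump))
    where
    r = length (R₁ ++ c ∷ R₂)
    s = length L′
    rest-perm : IsPerm n (L′ ++ a ∷ R)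
    rest-perm = subst (IsPerm n) (LP.++-assoc L′ (a ∷ []) R) (IsPerm-remove-max n (L′ ++ a ∷ []) R π-perm)
    L′#a∷R = proj₂ (proj₂ (Unique-++⁻ L′ (proj₁ (proj₂ rest-perm))))
    c∈R : c ∈ R
    c∈R = MP.∈-++⁺ʳ R₁ (here refl)
    L′>a∷R : All (λ x → All (_< x) (a ∷ R)) L′
    L′>a∷R = All.zipWith (λ (x≥R , x∉) → let x>R = All.zipWith (λ (z≤x , x≢z) → NP.≤∧≢⇒< z≤x (x≢z ∘ sym)) (x≥R , All.tail x∉)
                                          in NP.<-≤-trans a<c (NP.<⇒≤ (All.lookup x>R c∈R)) ∷ x>R) (L′≥R , L′#a∷R)
    blocks = IsPerm-blocks⁻ n L′ (a ∷ R) rest-perm L′>a∷R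
    a≡r×c≡r+1 = IsPerm-second-largest r a R₁ c R₂ (proj₁ blocks) a<c R₁≤a R₂≤a
    a≡r = proj₁ a≡r×c≡r+1
    unbumped = IsPerm-unbump r R₁ R₂ (subst₂ (λ a c → IsPerm (suc r) (a ∷ R₁ ++ c ∷ R₂)) a≡r (proj₂ a≡r×c≡r+1) (proj₁ blocks))
    ρ = R₁ ++ r ∷ R₂
    ρ-perm = proj₁ unbumped
    map-bump : map (bump r) ρ ≡ R
    map-bump = trans (proj₂ unbumped) (cong (λ t → R₁ ++ t ∷ R₂) (sym (proj₂ a≡r×c≡r+1)))
    1≤r : 1 ≤ r
    1≤r = subst (1 ≤_) (sym (LP.length-++ R₁)) (NP.≤-trans (s≤s z≤n) (NP.≤-reflexive (sym (NP.+-suc (length R₁) (length R₂)))))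
    s+r+1≡n : s + suc r ≡ n
    s+r+1≡n = trans (sym (LP.length-++ L′)) (proj₁ rest-perm)
    sizes : suc (s + r) ≡ n
    sizes = trans (sym (NP.+-suc s r)) s+r+1≡n
    L′! = proj₁ (Unique-++⁻ L′ (proj₁ (proj₂ rest-perm)))
    σ = map (_∸ suc r) L′
    σ-perm : IsPerm s σ
    σ-perm = IsPerm-unshift (suc r) s L′ L′! (All.map (λ (r+1<x , x≤n) → r+1<x , subst (_ ≤_) (trans (sym s+r+1≡n) (NP.+-comm s (suc r))) x≤n) (proj₂ blocks)) refl
    L′≡ : map (suc r +_) σ ≡ L′
    L′≡ = map-+-∸ (suc r) L′ (All.map (NP.<⇒≤ ∘ proj₁) (proj₂ blocks))

  record AroundMax (n : ℕ) (L R : List ℕ) : Set where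
    field
      LN : All (_< suc n) L
      RN : All (_< suc n) R
      dj : All (λ x → All (x ≢_) R) L
      c132eq : count132 (L ++ suc n ∷ R) ≡ (count132 L + count132 R) + count132Across L (suc n ∷ R)

  aroundMax : ∀ n L R → IsPerm (suc n) (L ++ suc n ∷ R) → AroundMax n L R
  aroundMax n L R (l , u , al) = record { LN = LN ; RN = RN ; dj = All.map All.tail dL ; c132eq = ceq }
    where
    U = Unique-++⁻ L u
    dL = proj₂ (proj₂ U)
    nN : All (suc n ≢_) R
    nN with proj₁ (proj₂ U)
    ... | x ∷ _ = x
    LN = All.zipWith (λ ((_ , q) , d) → NP.≤∧≢⇒< q (All.head d)) (AllP.++⁻ˡ L al , dL)
    RN = All.zipWith (λ ((_ , q) , d) → NP.≤∧≢⇒< q (λ e → d (sym e))) (All.tail (AllP.++⁻ʳ L al) , nN)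
    ceq = trans (count132-++ L (suc n ∷ R)) (cong (λ t → (count132 L + t) + count132Across L (suc n ∷ R)) (count132-∷-max (suc n) R (All.map NP.<⇒≤ RN)))

  joinAtMax-injective : ∀ n m m′ σ σ′ ρ ρ′ → IsPerm m σ → IsPerm m′ σ′ → JoinAtMax n m σ ρ → JoinAtMax n m′ σ′ ρ′ →
    joinAtMax n m σ ρ ≡ joinAtMax n m′ σ′ ρ′ → m ≡ m′ × σ ≡ σ′ × ρ ≡ ρ′
  joinAtMax-injective n m m′ σ σ′ ρ ρ′ (lσ , _) (lσ′ , _) ok ok′ e
    with ++-∷-cancel (suc n) _ ρ _ ρ′ e (Unique-middle-∉ (suc n) _ ρ (proj₁ (proj₂ (JoinAtMax.perm ok)))) (Unique-middle-∉ (suc n) _ ρ′ (proj₁ (proj₂ (JoinAtMax.perm ok′))))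
  ... | eL , refl = m≡m′ , σ≡σ′ , refl
    where
    m≡m′ : m ≡ m′
    m≡m′ = trans (sym lσ) (trans (sym (LP.length-map ((n ∸ m) +_) σ)) (trans (cong length eL) (trans (LP.length-map ((n ∸ m′) +_) σ′) lσ′)))
    σ≡σ′ : σ ≡ σ′
    σ≡σ′ = map-injective-on ((n ∸ m) +_) (λ _ → ⊤) σ σ′ (All-⊤ σ) (All-⊤ σ′) (λ a b _ _ → NP.+-cancelˡ-≡ (n ∸ m) a b) (trans eL (cong (λ t → map ((n ∸ t) +_) σ′) (sym m≡m′)))

  joinThroughMax-injective : ∀ N r r′ s s′ σ σ′ ρ ρ′ → IsPerm s σ → IsPerm s′ σ′ → IsPerm r ρ → IsPerm r′ ρ′ →
    IsPerm N (joinThroughMax r σ ρ N) → IsPerm N (joinThroughMax r′ σ′ ρ′ N) → joinThroughMax r σ ρ N ≡ joinThroughMax r′ σ′ ρ′ N →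
    s ≡ s′ × σ ≡ σ′ × ρ ≡ ρ′
  joinThroughMax-injective N r r′ s s′ σ σ′ ρ ρ′ (lσ , _) (lσ′ , _) (lρ , _ , aρ) (lρ′ , _ , aρ′) ip ip′ e
    with ++-∷-cancel N _ (map (bump r) ρ) _ (map (bump r′) ρ′) e (Unique-middle-∉ N _ _ (proj₁ (proj₂ ip))) (Unique-middle-∉ N _ _ (proj₁ (proj₂ ip′)))
  ... | eL , eR = s≡s′ , σ≡σ′ , ρ≡ρ′
    where
    r≡r′ : r ≡ r′
    r≡r′ = trans (sym lρ) (trans (sym (LP.length-map (bump r) ρ)) (trans (cong length eR) (trans (LP.length-map (bump r′) ρ′) lρ′)))
    shifted≡ : map (suc r +_) σ ≡ map (suc r +_) σ′
    shifted≡ = proj₁ (LP.∷ʳ-injective _ _ (trans eL (cong (λ t → map (suc t +_) σ′ ++ t ∷ []) (sym r≡r′))))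
    σ≡σ′ : σ ≡ σ′
    σ≡σ′ = map-injective-on (suc r +_) (λ _ → ⊤) σ σ′ (All-⊤ σ) (All-⊤ σ′) (λ a b _ _ → NP.+-cancelˡ-≡ (suc r) a b) shifted≡
    s≡s′ : s ≡ s′
    s≡s′ = trans (sym lσ) (trans (cong length σ≡σ′) lσ′)
    ρ≡ρ′ : ρ ≡ ρ′
    ρ≡ρ′ = map-injective-on (bump r) (_≤ r) ρ ρ′ (All.map proj₂ aρ) (subst (λ t → All (_≤ t) ρ′) (sym r≡r′) (All.map proj₂ aρ′))
           (λ a b p q → bump-injective r a b p q) (trans eR (cong (λ t → map (bump t) ρ′) (sym r≡r′)))

  joinAtMax≢joinThroughMax : ∀ n m r σ ρ σ′ ρ′ → JoinAtMax n m σ ρ → IsPerm (suc n) (joinThroughMax r σ′ ρ′ (suc n)) → suc r ∈ map (bump r) ρ′ →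
    joinAtMax n m σ ρ ≢ joinThroughMax r σ′ ρ′ (suc n)
  joinAtMax≢joinThroughMax n m r σ ρ σ′ ρ′ ok ip sr e
    with ++-∷-cancel (suc n) _ ρ _ (map (bump r) ρ′) e (Unique-middle-∉ (suc n) _ ρ (proj₁ (proj₂ (JoinAtMax.perm ok)))) (Unique-middle-∉ (suc n) _ _ (proj₁ (proj₂ ip)))
  ... | eL , refl = NP.<-irrefl refl (All.lookup (All.lookup (JoinAtMax.sep ok) r∈) sr)
    where r∈ : r ∈ map ((n ∸ m) +_) σ
          r∈ = subst (r ∈_) (sym eL) (MP.∈-++⁺ʳ (map (suc r +_) σ′) (here refl))

module Recurrences where

  open import Defs using (countᵇ; allᵇ; Sym)
  open Booleans
  open Counting
  open Permutations
  open Occurrences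
  open Decomposition
  open MaxSplit
  open import Data.Bool using (Bool; true; false; _∧_; _∨_; not; if_then_else_; T; T?)
  import Data.Bool.Properties as BP
  open import Data.Nat as ℕ using (ℕ; zero; suc; _+_; _*_; _∸_; _<_; _≤_; _<ᵇ_; _≡ᵇ_; s≤s; z≤n)
  import Data.Nat.Properties as NP
  open import Data.List using (List; []; _∷_; map; length; _++_; filterᵇ; upTo)
  open import Data.Nat.ListAction using (sum)
  import Data.List.Properties as LP
  open import Data.List.Relation.Unary.All as All using (All; []; _∷_)
  import Data.List.Relation.Unary.All.Properties as AllP
  open import Data.List.Relation.Unary.Any using (here; there)
  open import Data.List.Membership.Propositional using (_∈_; _∉_)
  import Data.List.Membership.Propositional.Properties as MP
  open import Data.List.Relation.Unary.Unique.Propositional using (Unique; []; _∷_)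
  import Data.List.Relation.Unary.Unique.Propositional.Properties as UP
  open import Data.Product using (_×_; _,_; proj₁; proj₂; ∃; ∃-syntax)
  open import Data.Sum using (_⊎_; inj₁; inj₂)
  open import Data.Unit using (⊤; tt)
  open import Data.Empty using (⊥; ⊥-elim)
  open import Relation.Binary.PropositionalEquality
  open import Relation.Nullary using (¬_; yes; no)
  open import Function using (_∘_; case_of_)

  AvWith : ℕ → ℕ → List ℕ → Bool
  AvWith c k π = not (contains k π) ∧ (count132 π ≡ᵇ c)

  Av Av₁ : ℕ → List ℕ → Bool
  Av = AvWith 0
  Av₁ = AvWith 1

  nonempty : List ℕ → Bool
  nonempty [] = false
  nonempty (_ ∷ _) = true

  Av⁺ : ℕ → List ℕ → Bool
  Av⁺ k π = nonempty π ∧ Av k π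

  AvList Av₁List Av⁺List : ℕ → ℕ → List (List ℕ)
  AvList k m = filterᵇ (Av k) (Sym m)
  Av₁List k m = filterᵇ (Av₁ k) (Sym m)
  Av⁺List k m = filterᵇ (Av⁺ k) (Sym m)

  AvWith⇒ : ∀ c k π → T (AvWith c k π) → contains k π ≡ false × count132 π ≡ c
  AvWith⇒ c k π t = BP.not-injective (T⇒≡true (T-∧ˡ (not (contains k π)) _ t)) , NP.≡ᵇ⇒≡ _ _ (T-∧ʳ (not (contains k π)) _ t)

  ⇒AvWith : ∀ c k π → contains k π ≡ false → count132 π ≡ c → T (AvWith c k π)
  ⇒AvWith c k π e1 e2 rewrite e1 | e2 = NP.≡⇒≡ᵇ c c refl

  Unique-filter-Sym : ∀ (p : List ℕ → Bool) m → Unique (filterᵇ p (Sym m))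
  Unique-filter-Sym p m = UP.filter⁺ (T? ∘ p) (Unique-Sym m)

  ∈-filter-Sym⁻ : ∀ (p : List ℕ → Bool) m {σ} → σ ∈ filterᵇ p (Sym m) → IsPerm m σ × T (p σ)
  ∈-filter-Sym⁻ p m k = let (a , b) = MP.∈-filter⁻ (T? ∘ p) k in ∈Sym⁻ m a , b

  ∈-filter-Sym⁺ : ∀ (p : List ℕ → Bool) m {σ} → IsPerm m σ → T (p σ) → σ ∈ filterᵇ p (Sym m)
  ∈-filter-Sym⁺ p m ip t = MP.∈-filter⁺ (T? ∘ p) (∈Sym⁺ m ip) t

  #Av #Av₁ #Av⁺ : ℕ → ℕ → ℕ
  #Av k m = length (AvList k m)
  #Av₁ k m = length (Av₁List k m)
  #Av⁺ k m = length (Av⁺List k m)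

  Split : Set
  Split = ℕ × List ℕ × List ℕ

  splitsA : ℕ → ℕ → List Split
  splitsA j n = triples (AvList (1 + j)) (λ m → AvList (2 + j) (n ∸ m)) (suc n)

  joinAtMax′ : ℕ → Split → List ℕ
  joinAtMax′ n (m , σ , ρ) = joinAtMax n m σ ρ

  #Av-suc : ∀ j n → #Av (2 + j) (suc n) ≡ sum (map (λ m → #Av (1 + j) m * #Av (2 + j) (n ∸ m)) (upTo (suc n)))
  #Av-suc j n = trans (countᵇ-bijection (Av (2 + j)) (Sym (suc n)) (splitsA j n) (joinAtMax′ n) (Unique-Sym (suc n))
                      (Unique-triples XA YA (suc n) (λ m → Unique-filter-Sym (Av (1 + j)) m) (λ m → Unique-filter-Sym (Av (2 + j)) (n ∸ m))) to from inj)
                   (length-triples XA YA (suc n))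
    where
    XA = AvList (1 + j)
    YA = λ m → AvList (2 + j) (n ∸ m)
    to : ∀ {y} → y ∈ splitsA j n → joinAtMax′ n y ∈ Sym (suc n) × T (Av (2 + j) (joinAtMax′ n y))
    to {m , σ , ρ} k with ∈-triples⁻ XA YA (suc n) k
    ... | m<sn , σ∈ , ρ∈ with ∈-filter-Sym⁻ (Av (1 + j)) m σ∈ | ∈-filter-Sym⁻ (Av (2 + j)) (n ∸ m) ρ∈
    ... | ipσ , tσ | ipρ , tρ = ∈Sym⁺ (suc n) (JoinAtMax.perm ok) ,
          ⇒AvWith 0 (2 + j) (joinAtMax n m σ ρ) (trans (JoinAtMax.conteq ok j) (cong₂ _∨_ (proj₁ (AvWith⇒ 0 (1 + j) σ tσ)) (proj₁ (AvWith⇒ 0 (2 + j) ρ tρ))))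
                          (trans (JoinAtMax.c132eq ok) (cong₂ _+_ (proj₂ (AvWith⇒ 0 (1 + j) σ tσ)) (proj₂ (AvWith⇒ 0 (2 + j) ρ tρ))))
      where ok = joinAtMax-ok n m σ ρ (NP.≤-pred m<sn) ipσ ipρ
    from : ∀ {x} → x ∈ Sym (suc n) → T (Av (2 + j) x) → ∃[ y ] (y ∈ splitsA j n × joinAtMax′ n y ≡ x)
    from {x} xm t with IsPerm-split-max n (∈Sym⁻ (suc n) xm)
    ... | L , R , refl with ∈Sym⁻ (suc n) xm
    ... | ip with aroundMax n L R ip | AvWith⇒ 0 (2 + j) (L ++ suc n ∷ R) t
    ... | around | avoids , no-132′ with +≡0⁻ (count132 L + count132 R) (count132Across L (suc n ∷ R)) (trans (sym (AroundMax.c132eq around)) no-132′)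
    ... | _ , across≡0 with splitAtMax n L R ip (count132Across≡0⇒≤ L (suc n) R (All.map NP.<⇒≤ (AroundMax.LN around)) (AroundMax.RN around) across≡0)
    ... | σ , m≤n , ipσ , ipR , eq = (length L , σ , R) , ∈-triples⁺ XA YA (suc n) (s≤s m≤n) (∈-filter-Sym⁺ (Av (1 + j)) _ ipσ tσ) (∈-filter-Sym⁺ (Av (2 + j)) _ ipR tR) , sym eq
      where
      ok = joinAtMax-ok n (length L) σ R m≤n ipσ ipR
      avoiding = ∨-false⁻ (contains (1 + j) σ) (contains (2 + j) R) (trans (sym (JoinAtMax.conteq ok j)) (trans (cong (contains (2 + j)) (sym eq)) avoids))
      no-132 = +≡0⁻ (count132 σ) (count132 R) (trans (sym (JoinAtMax.c132eq ok)) (trans (cong count132 (sym eq)) no-132′))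
      tσ = ⇒AvWith 0 (1 + j) σ (proj₁ avoiding) (proj₁ no-132)
      tR = ⇒AvWith 0 (2 + j) R (proj₂ avoiding) (proj₂ no-132)
    inj : ∀ {y y′} → y ∈ splitsA j n → y′ ∈ splitsA j n → joinAtMax′ n y ≡ joinAtMax′ n y′ → y ≡ y′
    inj {m , σ , ρ} {m′ , σ′ , ρ′} k k′ e with ∈-triples⁻ XA YA (suc n) k | ∈-triples⁻ XA YA (suc n) k′
    ... | m< , σ∈ , ρ∈ | m<′ , σ∈′ , ρ∈′ with ∈-filter-Sym⁻ (Av (1 + j)) m σ∈ | ∈-filter-Sym⁻ (Av (2 + j)) (n ∸ m) ρ∈ | ∈-filter-Sym⁻ (Av (1 + j)) m′ σ∈′ | ∈-filter-Sym⁻ (Av (2 + j)) (n ∸ m′) ρ∈′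
    ... | ipσ , _ | ipρ , _ | ipσ′ , _ | ipρ′ , _ with joinAtMax-injective n m m′ σ σ′ ρ ρ′ ipσ ipσ′ (joinAtMax-ok n m σ ρ (NP.≤-pred m<) ipσ ipρ) (joinAtMax-ok n m′ σ′ ρ′ (NP.≤-pred m<′) ipσ′ ipρ′) e
    ... | refl , refl , refl = refl

  splitsH-left splitsH-right splitsH-through : ℕ → ℕ → List Split
  splitsH-left j n = triples (Av₁List (2 + j)) (λ m → AvList (3 + j) (n ∸ m)) (suc n)
  splitsH-right j n = triples (AvList (2 + j)) (λ m → Av₁List (3 + j) (n ∸ m)) (suc n)
  splitsH-through j zero = []
  splitsH-through j (suc n′) = triples (AvList (2 + j)) (λ s → Av⁺List (3 + j) (n′ ∸ s)) (suc n′)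

  Tagged : Set
  Tagged = ℕ × Split

  tagged : ℕ → Split → Tagged
  tagged c t = (c , t)

  splitsH : ℕ → ℕ → List Tagged
  splitsH j n = map (tagged 0) (splitsH-left j n) ++ (map (tagged 1) (splitsH-right j n) ++ map (tagged 2) (splitsH-through j n))

  joinH : ℕ → Tagged → List ℕ
  joinH n (zero , y) = joinAtMax′ n y
  joinH n (suc zero , y) = joinAtMax′ n y
  joinH n (suc (suc _) , (s , σ , ρ)) = joinThroughMax (length ρ) σ ρ (suc n)

  data SplitsHView (j n : ℕ) : Tagged → Set where
    v0 : ∀ {t} → t ∈ splitsH-left j n → SplitsHView j n (0 , t)
    v1 : ∀ {t} → t ∈ splitsH-right j n → SplitsHView j n (1 , t)
    v2 : ∀ {t} → t ∈ splitsH-through j n → SplitsHView j n (2 , t)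

  viewSplitsH : ∀ j n {y} → y ∈ splitsH j n → SplitsHView j n y
  viewSplitsH j n k with MP.∈-++⁻ (map (tagged 0) (splitsH-left j n)) k
  ... | inj₁ k1 with MP.∈-map⁻ (tagged 0) k1
  ...   | t , tm , refl = v0 tm
  viewSplitsH j n k | inj₂ k2 with MP.∈-++⁻ (map (tagged 1) (splitsH-right j n)) k2
  ... | inj₁ k1 with MP.∈-map⁻ (tagged 1) k1
  ...   | t , tm , refl = v1 tm
  viewSplitsH j n k | inj₂ k2 | inj₂ k3 with MP.∈-map⁻ (tagged 2) k3
  ...   | t , tm , refl = v2 tm

  Unique-splitsH-through : ∀ j n → Unique (splitsH-through j n)
  Unique-splitsH-through j zero = []
  Unique-splitsH-through j (suc n′) = Unique-triples (AvList (2 + j)) (λ s → Av⁺List (3 + j) (n′ ∸ s)) (suc n′) (λ m → Unique-filter-Sym (Av (2 + j)) m) (λ m → Unique-filter-Sym (Av⁺ (3 + j)) (n′ ∸ m))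

  Unique-splitsH : ∀ j n → Unique (splitsH j n)
  Unique-splitsH j n = UP.++⁺ (UP.map⁺ tagged-injective left!) (UP.++⁺ (UP.map⁺ tagged-injective right!) (UP.map⁺ tagged-injective through!) tag₁₂-disjoint) tag₀-disjoint
    where
    tagged-injective : ∀ {c} {a b : Split} → (c , a) ≡ (c , b) → a ≡ b
    tagged-injective refl = refl
    left! = Unique-triples (Av₁List (2 + j)) (λ m → AvList (3 + j) (n ∸ m)) (suc n) (λ m → Unique-filter-Sym (Av₁ (2 + j)) m) (λ m → Unique-filter-Sym (Av (3 + j)) (n ∸ m))
    right! = Unique-triples (AvList (2 + j)) (λ m → Av₁List (3 + j) (n ∸ m)) (suc n) (λ m → Unique-filter-Sym (Av (2 + j)) m) (λ m → Unique-filter-Sym (Av₁ (3 + j)) (n ∸ m))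
    through! = Unique-splitsH-through j n
    tag-of : ∀ {c} {v : Tagged} (xs : List Split) → v ∈ map (tagged c) xs → proj₁ v ≡ c
    tag-of {c} xs k with MP.∈-map⁻ (tagged c) k
    ... | _ , _ , refl = refl
    tag₁₂-disjoint : ∀ {v} → v ∈ map (tagged 1) (splitsH-right j n) × v ∈ map (tagged 2) (splitsH-through j n) → ⊥
    tag₁₂-disjoint (a , b) = case trans (sym (tag-of _ a)) (tag-of _ b) of λ ()
    tag₀-disjoint : ∀ {v} → v ∈ map (tagged 0) (splitsH-left j n) × v ∈ (map (tagged 1) (splitsH-right j n) ++ map (tagged 2) (splitsH-through j n)) → ⊥
    tag₀-disjoint (a , b) with MP.∈-++⁻ (map (tagged 1) (splitsH-right j n)) b
    ... | inj₁ b1 = case trans (sym (tag-of _ a)) (tag-of _ b1) of λ ()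
    ... | inj₂ b2 = case trans (sym (tag-of _ a)) (tag-of _ b2) of λ ()

  length-splitsH : ∀ j n → length (splitsH j n) ≡ length (splitsH-left j n) + (length (splitsH-right j n) + length (splitsH-through j n))
  length-splitsH j n = trans (LP.length-++ (map (tagged 0) (splitsH-left j n)))
    (cong₂ _+_ (LP.length-map _ (splitsH-left j n)) (trans (LP.length-++ (map (tagged 1) (splitsH-right j n))) (cong₂ _+_ (LP.length-map _ (splitsH-right j n)) (LP.length-map _ (splitsH-through j n)))))

  record ThroughInfo (j n s : ℕ) (σ ρ : List ℕ) : Set where
    field
      ipσ : IsPerm s σ
      ipρ : IsPerm (length ρ) ρ
      tσ : T (Av (2 + j) σ)
      tρ : T (Av⁺ (3 + j) ρ)
      ok : JoinThroughMax (length ρ) s σ ρ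
      eqN : suc (suc (s + length ρ)) ≡ suc n

  nonempty⇒length≥1 : ∀ (ρ : List ℕ) → T (nonempty ρ) → 1 ≤ length ρ
  nonempty⇒length≥1 (_ ∷ _) _ = s≤s z≤n

  length≥1⇒nonempty : ∀ (ρ : List ℕ) → 1 ≤ length ρ → nonempty ρ ≡ true
  length≥1⇒nonempty (_ ∷ _) _ = refl

  throughInfo : ∀ j n s σ ρ → (s , σ , ρ) ∈ splitsH-through j n → ThroughInfo j n s σ ρ
  throughInfo j zero s σ ρ ()
  throughInfo j (suc n′) s σ ρ k with ∈-triples⁻ (AvList (2 + j)) (λ s → Av⁺List (3 + j) (n′ ∸ s)) (suc n′) k
  ... | s< , σ∈ , ρ∈ with ∈-filter-Sym⁻ (Av (2 + j)) s σ∈ | ∈-filter-Sym⁻ (Av⁺ (3 + j)) (n′ ∸ s) ρ∈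
  ... | ipσ , tσ | ipρ , tρ = record { ipσ = ipσ ; ipρ = ipρ′ ; tσ = tσ ; tρ = tρ ; ok = joinThroughMax-ok (length ρ) s σ ρ r1 ipσ ipρ′ ; eqN = eqN }
    where
    lr : length ρ ≡ n′ ∸ s
    lr = proj₁ ipρ
    ipρ′ : IsPerm (length ρ) ρ
    ipρ′ = subst (λ t → IsPerm t ρ) (sym lr) ipρ
    r1 : 1 ≤ length ρ
    r1 = nonempty⇒length≥1 ρ (T-∧ˡ (nonempty ρ) _ tρ)
    eqN : suc (suc (s + length ρ)) ≡ suc (suc n′)
    eqN = cong (λ t → suc (suc t)) (trans (cong (s +_) lr) (NP.m+[n∸m]≡n (NP.≤-pred s<)))

  throughInfo-perm : ∀ j n s σ ρ → ThroughInfo j n s σ ρ → IsPerm (suc n) (joinThroughMax (length ρ) σ ρ (suc n))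
  throughInfo-perm j n s σ ρ inf = subst (λ N → IsPerm N (joinThroughMax (length ρ) σ ρ N)) (ThroughInfo.eqN inf) (JoinThroughMax.perm (ThroughInfo.ok inf))

  throughInfo-count132 : ∀ j n s σ ρ → ThroughInfo j n s σ ρ → count132 (joinThroughMax (length ρ) σ ρ (suc n)) ≡ (count132 σ + count132 ρ) + 1
  throughInfo-count132 j n s σ ρ inf = subst (λ N → count132 (joinThroughMax (length ρ) σ ρ N) ≡ (count132 σ + count132 ρ) + 1) (ThroughInfo.eqN inf) (JoinThroughMax.c132eq (ThroughInfo.ok inf))

  throughInfo-contains : ∀ j n s σ ρ → ThroughInfo j n s σ ρ → contains (3 + j) (joinThroughMax (length ρ) σ ρ (suc n)) ≡ (contains (2 + j) σ ∨ contains (3 + j) ρ)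
  throughInfo-contains j n s σ ρ inf = subst (λ N → contains (3 + j) (joinThroughMax (length ρ) σ ρ N) ≡ (contains (2 + j) σ ∨ contains (3 + j) ρ)) (ThroughInfo.eqN inf) (JoinThroughMax.conteq (ThroughInfo.ok inf) j)

  joinAtMax-Av₁ : ∀ j n m σ ρ → m ≤ n → IsPerm m σ → IsPerm (n ∸ m) ρ → contains (2 + j) σ ≡ false → contains (3 + j) ρ ≡ false →
    count132 σ + count132 ρ ≡ 1 → joinAtMax n m σ ρ ∈ Sym (suc n) × T (Av₁ (3 + j) (joinAtMax n m σ ρ))
  joinAtMax-Av₁ j n m σ ρ m≤n ipσ ipρ e1 e2 e3 = ∈Sym⁺ (suc n) (JoinAtMax.perm ok) ,
    ⇒AvWith 1 (3 + j) (joinAtMax n m σ ρ) (trans (JoinAtMax.conteq ok (suc j)) (cong₂ _∨_ e1 e2)) (trans (JoinAtMax.c132eq ok) e3)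
    where ok = joinAtMax-ok n m σ ρ m≤n ipσ ipρ

  Av⁺⇒ : ∀ k ρ → T (Av⁺ k ρ) → contains k ρ ≡ false × count132 ρ ≡ 0
  Av⁺⇒ k ρ t = AvWith⇒ 0 k ρ (T-∧ʳ (nonempty ρ) _ t)

  record AtMaxInfo (n m : ℕ) (σ ρ : List ℕ) (c : ℕ) : Set where
    field
      m≤n : m ≤ n
      ipσ : IsPerm m σ
      ok : JoinAtMax n m σ ρ
      cσ : count132 σ ≡ c

  atMaxInfo-left : ∀ j n m σ ρ → (m , σ , ρ) ∈ splitsH-left j n → AtMaxInfo n m σ ρ 1
  atMaxInfo-left j n m σ ρ tm with ∈-triples⁻ (Av₁List (2 + j)) (λ m → AvList (3 + j) (n ∸ m)) (suc n) tm
  ... | m< , σ∈ , ρ∈ with ∈-filter-Sym⁻ (Av₁ (2 + j)) m σ∈ | ∈-filter-Sym⁻ (Av (3 + j)) (n ∸ m) ρ∈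
  ... | ipσ , tσ | ipρ , tρ = record { m≤n = NP.≤-pred m< ; ipσ = ipσ ; ok = joinAtMax-ok n m σ ρ (NP.≤-pred m<) ipσ ipρ ; cσ = proj₂ (AvWith⇒ 1 _ σ tσ) }

  atMaxInfo-right : ∀ j n m σ ρ → (m , σ , ρ) ∈ splitsH-right j n → AtMaxInfo n m σ ρ 0
  atMaxInfo-right j n m σ ρ tm with ∈-triples⁻ (AvList (2 + j)) (λ m → Av₁List (3 + j) (n ∸ m)) (suc n) tm
  ... | m< , σ∈ , ρ∈ with ∈-filter-Sym⁻ (Av (2 + j)) m σ∈ | ∈-filter-Sym⁻ (Av₁ (3 + j)) (n ∸ m) ρ∈
  ... | ipσ , tσ | ipρ , tρ = record { m≤n = NP.≤-pred m< ; ipσ = ipσ ; ok = joinAtMax-ok n m σ ρ (NP.≤-pred m<) ipσ ipρ ; cσ = proj₂ (AvWith⇒ 0 _ σ tσ) }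

  atMax-injective : ∀ n m m′ σ σ′ ρ ρ′ c c′ → AtMaxInfo n m σ ρ c → AtMaxInfo n m′ σ′ ρ′ c′ → joinAtMax n m σ ρ ≡ joinAtMax n m′ σ′ ρ′ →
    m ≡ m′ × σ ≡ σ′ × ρ ≡ ρ′ × c ≡ c′
  atMax-injective n m m′ σ σ′ ρ ρ′ c c′ i i′ e with joinAtMax-injective n m m′ σ σ′ ρ ρ′ (AtMaxInfo.ipσ i) (AtMaxInfo.ipσ i′) (AtMaxInfo.ok i) (AtMaxInfo.ok i′) e
  ... | refl , refl , refl = refl , refl , refl , trans (sym (AtMaxInfo.cσ i)) (AtMaxInfo.cσ i′)

  atMax≢through : ∀ j n m σ ρ c s σ′ ρ′ → AtMaxInfo n m σ ρ c → ThroughInfo j n s σ′ ρ′ → joinAtMax n m σ ρ ≢ joinThroughMax (length ρ′) σ′ ρ′ (suc n)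
  atMax≢through j n m σ ρ c s σ′ ρ′ i inf = joinAtMax≢joinThroughMax n m (length ρ′) σ ρ σ′ ρ′ (AtMaxInfo.ok i) (throughInfo-perm j n s σ′ ρ′ inf) (JoinThroughMax.sucr∈ (ThroughInfo.ok inf))

  suc+1 : ∀ a → a + 1 ≡ 1 → a ≡ 0
  suc+1 a e = NP.suc-injective (trans (NP.+-comm 1 a) e)

  fromAtMax : ∀ j n L R → IsPerm (suc n) (L ++ suc n ∷ R) → contains (3 + j) (L ++ suc n ∷ R) ≡ false → count132 (L ++ suc n ∷ R) ≡ 1 →
    All (λ x → All (_≤ x) R) L → ∃[ y ] (y ∈ splitsH j n × joinH n y ≡ L ++ suc n ∷ R)
  fromAtMax j n L R ip avoids one-132 LR with splitAtMax n L R ip LR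
  ... | σ , m≤n , ipσ , ipR , eq with +≡1⁻ (count132 σ) (count132 R) (trans (sym (JoinAtMax.c132eq ok)) (trans (cong count132 (sym eq)) one-132))
    where ok = joinAtMax-ok n (length L) σ R m≤n ipσ ipR
  ... | inj₁ (σ0 , R1) = (1 , length L , σ , R) ,
     MP.∈-++⁺ʳ (map (tagged 0) (splitsH-left j n)) (MP.∈-++⁺ˡ (MP.∈-map⁺ (tagged 1) (∈-triples⁺ (AvList (2 + j)) (λ m → Av₁List (3 + j) (n ∸ m)) (suc n) (s≤s m≤n)
       (∈-filter-Sym⁺ (Av (2 + j)) _ ipσ (⇒AvWith 0 _ σ (proj₁ avoiding) σ0)) (∈-filter-Sym⁺ (Av₁ (3 + j)) _ ipR (⇒AvWith 1 _ R (proj₂ avoiding) R1))))) , sym eq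
    where ok = joinAtMax-ok n (length L) σ R m≤n ipσ ipR
          avoiding = ∨-false⁻ (contains (2 + j) σ) (contains (3 + j) R) (trans (sym (JoinAtMax.conteq ok (suc j))) (trans (cong (contains (3 + j)) (sym eq)) avoids))
  ... | inj₂ (σ1 , R0) = (0 , length L , σ , R) ,
     MP.∈-++⁺ˡ (MP.∈-map⁺ (tagged 0) (∈-triples⁺ (Av₁List (2 + j)) (λ m → AvList (3 + j) (n ∸ m)) (suc n) (s≤s m≤n)
       (∈-filter-Sym⁺ (Av₁ (2 + j)) _ ipσ (⇒AvWith 1 _ σ (proj₁ avoiding) σ1)) (∈-filter-Sym⁺ (Av (3 + j)) _ ipR (⇒AvWith 0 _ R (proj₂ avoiding) R0)))) , sym eq
    where ok = joinAtMax-ok n (length L) σ R m≤n ipσ ipR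
          avoiding = ∨-false⁻ (contains (2 + j) σ) (contains (3 + j) R) (trans (sym (JoinAtMax.conteq ok (suc j))) (trans (cong (contains (3 + j)) (sym eq)) avoids))

  fromThroughMax : ∀ j n L′ a R → IsPerm (suc n) ((L′ ++ a ∷ []) ++ suc n ∷ R) → contains (3 + j) ((L′ ++ a ∷ []) ++ suc n ∷ R) ≡ false →
    count132 ((L′ ++ a ∷ []) ++ suc n ∷ R) ≡ 1 → All (λ x → All (_≤ x) R) L′ → countAbove a R ≡ 1 →
    ∃[ y ] (y ∈ splitsH j n × joinH n y ≡ (L′ ++ a ∷ []) ++ suc n ∷ R)
  fromThroughMax j n L′ a R ip avoids one-132 LR ga with splitThroughMax n L′ a R ip LR ga
  ... | r , σ , ρ , 1≤r , sizes , ipσ , ipρ , eqx = (2 , s , σ , ρ) , mem , sym eqx′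
    where
    s = length L′
    lρ : length ρ ≡ r
    lρ = proj₁ ipρ
    ok : JoinThroughMax (length ρ) s σ ρ
    ok = joinThroughMax-ok (length ρ) s σ ρ (subst (1 ≤_) (sym lρ) 1≤r) ipσ (subst (λ t → IsPerm t ρ) (sym lρ) ipρ)
    eqN : suc (suc (s + length ρ)) ≡ suc n
    eqN = cong suc (trans (cong (λ t → suc (s + t)) lρ) sizes)
    eqx′ : (L′ ++ a ∷ []) ++ suc n ∷ R ≡ joinThroughMax (length ρ) σ ρ (suc n)
    eqx′ = trans eqx (cong (λ t → joinThroughMax t σ ρ (suc n)) (sym lρ))
    c132eq : count132 (joinThroughMax (length ρ) σ ρ (suc n)) ≡ (count132 σ + count132 ρ) + 1
    c132eq = subst (λ N → count132 (joinThroughMax (length ρ) σ ρ N) ≡ (count132 σ + count132 ρ) + 1) eqN (JoinThroughMax.c132eq ok)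
    conteq : contains (3 + j) (joinThroughMax (length ρ) σ ρ (suc n)) ≡ (contains (2 + j) σ ∨ contains (3 + j) ρ)
    conteq = subst (λ N → contains (3 + j) (joinThroughMax (length ρ) σ ρ N) ≡ (contains (2 + j) σ ∨ contains (3 + j) ρ)) eqN (JoinThroughMax.conteq ok j)
    avoiding = ∨-false⁻ (contains (2 + j) σ) (contains (3 + j) ρ) (trans (sym conteq) (trans (cong (contains (3 + j)) (sym eqx′)) avoids))
    no-132′ = +≡0⁻ (count132 σ) (count132 ρ) (suc+1 _ (trans (sym c132eq) (trans (cong count132 (sym eqx′)) one-132)))
    tσ = ⇒AvWith 0 (2 + j) σ (proj₁ avoiding) (proj₁ no-132′)
    tρ : T (Av⁺ (3 + j) ρ)
    tρ rewrite length≥1⇒nonempty ρ (subst (1 ≤_) (sym lρ) 1≤r) = ⇒AvWith 0 (3 + j) ρ (proj₂ avoiding) (proj₂ no-132′)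
    mem′ : (s , σ , ρ) ∈ splitsH-through j (suc (s + r))
    mem′ = ∈-triples⁺ (AvList (2 + j)) (λ s′ → Av⁺List (3 + j) ((s + r) ∸ s′)) (suc (s + r)) (s≤s (NP.m≤m+n s r))
             (∈-filter-Sym⁺ (Av (2 + j)) s ipσ tσ) (∈-filter-Sym⁺ (Av⁺ (3 + j)) ((s + r) ∸ s) (subst (λ t → IsPerm t ρ) (sym (NP.m+n∸m≡n s r)) ipρ) tρ)
    mem : (2 , s , σ , ρ) ∈ splitsH j n
    mem = MP.∈-++⁺ʳ (map (tagged 0) (splitsH-left j n)) (MP.∈-++⁺ʳ (map (tagged 1) (splitsH-right j n)) (MP.∈-map⁺ (tagged 2) (subst (λ t → (s , σ , ρ) ∈ splitsH-through j t) sizes mem′)))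

  joinH-Av₁ : ∀ j n {y} → SplitsHView j n y → joinH n y ∈ Sym (suc n) × T (Av₁ (3 + j) (joinH n y))
  joinH-Av₁ j n (v0 {m , σ , ρ} tm) with ∈-triples⁻ (Av₁List (2 + j)) (λ m → AvList (3 + j) (n ∸ m)) (suc n) tm
  ... | m< , σ∈ , ρ∈ with ∈-filter-Sym⁻ (Av₁ (2 + j)) m σ∈ | ∈-filter-Sym⁻ (Av (3 + j)) (n ∸ m) ρ∈
  ... | ipσ , tσ | ipρ , tρ = joinAtMax-Av₁ j n m σ ρ (NP.≤-pred m<) ipσ ipρ (proj₁ (AvWith⇒ 1 _ σ tσ)) (proj₁ (AvWith⇒ 0 _ ρ tρ))
        (cong₂ _+_ (proj₂ (AvWith⇒ 1 _ σ tσ)) (proj₂ (AvWith⇒ 0 _ ρ tρ)))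
  joinH-Av₁ j n (v1 {m , σ , ρ} tm) with ∈-triples⁻ (AvList (2 + j)) (λ m → Av₁List (3 + j) (n ∸ m)) (suc n) tm
  ... | m< , σ∈ , ρ∈ with ∈-filter-Sym⁻ (Av (2 + j)) m σ∈ | ∈-filter-Sym⁻ (Av₁ (3 + j)) (n ∸ m) ρ∈
  ... | ipσ , tσ | ipρ , tρ = joinAtMax-Av₁ j n m σ ρ (NP.≤-pred m<) ipσ ipρ (proj₁ (AvWith⇒ 0 _ σ tσ)) (proj₁ (AvWith⇒ 1 _ ρ tρ))
        (cong₂ _+_ (proj₂ (AvWith⇒ 0 _ σ tσ)) (proj₂ (AvWith⇒ 1 _ ρ tρ)))
  joinH-Av₁ j n (v2 {s , σ , ρ} tm) = ∈Sym⁺ (suc n) (throughInfo-perm j n s σ ρ inf) ,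
    ⇒AvWith 1 (3 + j) (joinThroughMax (length ρ) σ ρ (suc n))
      (trans (throughInfo-contains j n s σ ρ inf) (cong₂ _∨_ (proj₁ σ-facts) (proj₁ ρ-facts)))
      (trans (throughInfo-count132 j n s σ ρ inf) (cong (_+ 1) (cong₂ _+_ (proj₂ σ-facts) (proj₂ ρ-facts))))
    where
    inf = throughInfo j n s σ ρ tm
    σ-facts = AvWith⇒ 0 (2 + j) σ (ThroughInfo.tσ inf)
    ρ-facts = Av⁺⇒ (3 + j) ρ (ThroughInfo.tρ inf)

  tagged-≡ : ∀ (t : ℕ) {s s′ : ℕ} {σ σ′ ρ ρ′ : List ℕ} → s ≡ s′ → σ ≡ σ′ → ρ ≡ ρ′ → (t , s , σ , ρ) ≡ (t , s′ , σ′ , ρ′)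
  tagged-≡ t refl refl refl = refl

  joinH-injective : ∀ j n {y y′} → SplitsHView j n y → SplitsHView j n y′ → joinH n y ≡ joinH n y′ → y ≡ y′
  joinH-injective j n (v0 {m , σ , ρ} tm) (v0 {m′ , σ′ , ρ′} tm′) eq =
    let m≡ , σ≡ , ρ≡ , _ = atMax-injective n m m′ σ σ′ ρ ρ′ 1 1 (atMaxInfo-left j n m σ ρ tm) (atMaxInfo-left j n m′ σ′ ρ′ tm′) eq
    in tagged-≡ 0 m≡ σ≡ ρ≡
  joinH-injective j n (v1 {m , σ , ρ} tm) (v1 {m′ , σ′ , ρ′} tm′) eq =
    let m≡ , σ≡ , ρ≡ , _ = atMax-injective n m m′ σ σ′ ρ ρ′ 0 0 (atMaxInfo-right j n m σ ρ tm) (atMaxInfo-right j n m′ σ′ ρ′ tm′) eq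
    in tagged-≡ 1 m≡ σ≡ ρ≡
  joinH-injective j n (v0 {m , σ , ρ} tm) (v1 {m′ , σ′ , ρ′} tm′) eq =
    case proj₂ (proj₂ (proj₂ (atMax-injective n m m′ σ σ′ ρ ρ′ 1 0 (atMaxInfo-left j n m σ ρ tm) (atMaxInfo-right j n m′ σ′ ρ′ tm′) eq))) of λ ()
  joinH-injective j n (v1 {m , σ , ρ} tm) (v0 {m′ , σ′ , ρ′} tm′) eq =
    case proj₂ (proj₂ (proj₂ (atMax-injective n m m′ σ σ′ ρ ρ′ 0 1 (atMaxInfo-right j n m σ ρ tm) (atMaxInfo-left j n m′ σ′ ρ′ tm′) eq))) of λ ()
  joinH-injective j n (v0 {m , σ , ρ} tm) (v2 {s , σ′ , ρ′} tm′) eq =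
    ⊥-elim (atMax≢through j n m σ ρ 1 s σ′ ρ′ (atMaxInfo-left j n m σ ρ tm) (throughInfo j n s σ′ ρ′ tm′) eq)
  joinH-injective j n (v1 {m , σ , ρ} tm) (v2 {s , σ′ , ρ′} tm′) eq =
    ⊥-elim (atMax≢through j n m σ ρ 0 s σ′ ρ′ (atMaxInfo-right j n m σ ρ tm) (throughInfo j n s σ′ ρ′ tm′) eq)
  joinH-injective j n (v2 {s , σ′ , ρ′} tm′) (v0 {m , σ , ρ} tm) eq =
    ⊥-elim (atMax≢through j n m σ ρ 1 s σ′ ρ′ (atMaxInfo-left j n m σ ρ tm) (throughInfo j n s σ′ ρ′ tm′) (sym eq))
  joinH-injective j n (v2 {s , σ′ , ρ′} tm′) (v1 {m , σ , ρ} tm) eq =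
    ⊥-elim (atMax≢through j n m σ ρ 0 s σ′ ρ′ (atMaxInfo-right j n m σ ρ tm) (throughInfo j n s σ′ ρ′ tm′) (sym eq))
  joinH-injective j n (v2 {s , σ , ρ} tm) (v2 {s′ , σ′ , ρ′} tm′) eq =
    let s≡ , σ≡ , ρ≡ = joinThroughMax-injective (suc n) (length ρ) (length ρ′) s s′ σ σ′ ρ ρ′
                         (ThroughInfo.ipσ i) (ThroughInfo.ipσ i′) (ThroughInfo.ipρ i) (ThroughInfo.ipρ i′)
                         (throughInfo-perm j n s σ ρ i) (throughInfo-perm j n s′ σ′ ρ′ i′) eq
    in tagged-≡ 2 s≡ σ≡ ρ≡
    where
    i = throughInfo j n s σ ρ tm
    i′ = throughInfo j n s′ σ′ ρ′ tm′

  #Av₁-suc : ∀ j n → #Av₁ (3 + j) (suc n) ≡ length (splitsH j n)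
  #Av₁-suc j n = countᵇ-bijection (Av₁ (3 + j)) (Sym (suc n)) (splitsH j n) (joinH n) (Unique-Sym (suc n)) (Unique-splitsH j n)
    (joinH-Av₁ j n ∘ viewSplitsH j n) from (λ k k′ → joinH-injective j n (viewSplitsH j n k) (viewSplitsH j n k′))
    where
    from : ∀ {x} → x ∈ Sym (suc n) → T (Av₁ (3 + j) x) → ∃[ y ] (y ∈ splitsH j n × joinH n y ≡ x)
    from {x} xm t with IsPerm-split-max n (∈Sym⁻ (suc n) xm)
    ... | L , R , refl with ∈Sym⁻ (suc n) xm
    ... | ip with aroundMax n L R ip | AvWith⇒ 1 (3 + j) (L ++ suc n ∷ R) t
    ... | around | avoids , one-132 with +≡1⁻ (count132 L + count132 R) (count132Across L (suc n ∷ R)) (trans (sym (AroundMax.c132eq around)) one-132)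
    ... | inj₂ (a1 , across≡0) = fromAtMax j n L R ip avoids one-132 (count132Across≡0⇒≤ L (suc n) R (All.map NP.<⇒≤ (AroundMax.LN around)) (AroundMax.RN around) across≡0)
    ... | inj₁ (a0 , across≡1) with count132Across≡1⇒ L (suc n) R (All.map NP.<⇒≤ (AroundMax.LN around)) (AroundMax.RN around) (AroundMax.dj around) across≡1
    ...   | L′ , a′ , refl , al′ , ga = fromThroughMax j n L′ a′ R ip avoids one-132 al′ ga

module GeneratingFunctions where

  open import Defs
  open PowerSeries
  open Booleans
  open Counting
  open Permutations
  open Occurrences
  open Decomposition using (count132From-≤)
  open Recurrences
  open import Data.Bool using (Bool; true; false; _∧_; not)
  open import Data.Integer as ℤ using (ℤ; +_)
  import Data.Integer.Properties as ℤ
  open import Data.List using (List; []; _∷_; map; length; upTo)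
  open import Data.List.Membership.Propositional using (_∈_)
  import Data.List.Properties as List
  open import Data.List.Relation.Unary.All as All using (All; []; _∷_)
  open import Data.Nat as ℕ using (ℕ; zero; suc; _+_; _*_; _∸_; _≤_; _<ᵇ_; s≤s; z≤n)
  open import Data.Nat.ListAction using (sum)
  open import Data.Nat.Properties using (≤-trans)
  open import Data.Product using (_,_; proj₂)
  open import Function using (case_of_)
  open import Relation.Binary.PropositionalEquality

  h≡#Av₁ : ∀ k n → 1 ≤ k → h (p12-3-k k) n ≡ #Av₁ k n
  h≡#Av₁ k n 1≤k = countᵇ-cong (Sym n) λ π →
    cong₂ (λ a c → a ∧ (c ℕ.≡ᵇ 1)) (avoids≡not-contains k π 1≤k) (occ-1-3-2≡count132 π)

  Sym-suc-nonempty : ∀ n {π} → π ∈ Sym (suc n) → nonempty π ≡ true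
  Sym-suc-nonempty n {π} π∈ with ∈Sym⁻ (suc n) {π} π∈
  Sym-suc-nonempty n {_ ∷ _} π∈ | _ = refl

  +-sum : ∀ (F : ℕ → ℕ) L → + sum (map F L) ≡ sumℤ (map (λ m → + F m) L)
  +-sum F [] = refl
  +-sum F (x ∷ L) = cong (ℤ._+_ (+ F x)) (+-sum F L)

  +-convolution : ∀ (f g : ℕ → ℕ) n →
    + sum (map (λ m → f m * g (n ∸ m)) (upTo (suc n))) ≡ ((λ i → + f i) ⊛ (λ i → + g i)) n
  +-convolution f g n = trans (+-sum (λ m → f m * g (n ∸ m)) (upTo (suc n)))
    (cong sumℤ (List.map-cong (λ m → ℤ.pos-* (f m) (g (n ∸ m))) (upTo (suc n))))

  A A⁺ HS : ℕ → Series
  A k n = + #Av k n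
  A⁺ k n = + #Av⁺ k n
  HS k = H (p12-3-k k)

  HS≋#Av₁ : ∀ k → 1 ≤ k → HS k ≋ (λ n → + #Av₁ k n)
  HS≋#Av₁ k 1≤k n = cong +_ (h≡#Av₁ k n 1≤k)

  A-one : A 1 ≋ one
  A-one zero = refl
  A-one (suc n) = cong +_ (countᵇ-none (Av 1) (Sym (suc n)) (λ π∈ → nonempty-contains-1 (Sym-suc-nonempty n π∈)))
    where
    nonempty-contains-1 : ∀ {π} → nonempty π ≡ true → Av 1 π ≡ false
    nonempty-contains-1 {_ ∷ _} _ = refl

  A-rec : ∀ j → A (2 + j) ≋ one ⊕ X (A (1 + j) ⊛ A (2 + j))
  A-rec j zero = refl
  A-rec j (suc n) = trans (cong +_ (#Av-suc j n)) (trans (+-convolution (#Av (1 + j)) (#Av (2 + j)) n) (sym (ℤ.+-identityˡ _)))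

  A⁺-one : ∀ j → A⁺ (3 + j) ⊕ one ≋ A (3 + j)
  A⁺-one j zero = refl
  A⁺-one j (suc n) = trans (ℤ.+-identityʳ _) (cong +_ (countᵇ-cong-All (Sym (suc n))
    (All.tabulate (λ {π} π∈ → cong (_∧ Av (3 + j) π) (Sym-suc-nonempty n π∈)))))

  decreasing-≤ : ∀ x xs → containsRise 0 (x ∷ xs) ≡ false → All (ℕ._≤ x) xs
  decreasing-≤ x [] _ = []
  decreasing-≤ x (y ∷ zs) no-rise with x <ᵇ y in x<ᵇy
  ... | true = case no-rise of λ ()
  ... | false = y≤x ∷ All.map (λ z≤y → ≤-trans z≤y y≤x) (decreasing-≤ y zs no-rise)
    where
    y≤x : y ≤ x
    y≤x = <ᵇ-false⇒≥ x<ᵇy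

  decreasing-count132 : ∀ π → containsRise 0 π ≡ false → count132 π ≡ 0
  decreasing-count132 [] _ = refl
  decreasing-count132 (x ∷ xs) no-rise =
    cong₂ _+_ (count132From-≤ x xs (decreasing-≤ x xs no-rise)) (decreasing-count132 xs (no-rise-tail xs no-rise))
    where
    no-rise-tail : ∀ xs → containsRise 0 (x ∷ xs) ≡ false → containsRise 0 xs ≡ false
    no-rise-tail [] _ = refl
    no-rise-tail (y ∷ zs) no-rise = proj₂ (∨-false⁻ _ _ no-rise)

  H-two : HS 2 ≋ 𝟘
  H-two n = trans (HS≋#Av₁ 2 (s≤s z≤n) n) (cong +_ (countᵇ-none (Av₁ 2) (Sym n) (λ {π} _ → no-132 π)))
    where
    no-132 : ∀ π → Av₁ 2 π ≡ false
    no-132 π with containsRise 0 π in rise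
    ... | true = refl
    ... | false rewrite decreasing-count132 π rise = refl

  length-triples-series : ∀ (f g : ℕ → ℕ) (X Y : ℕ → List (List ℕ)) → (∀ m → length (X m) ≡ f m) → (∀ m → length (Y m) ≡ g m) →
    ∀ n → + length (triples X (λ m → Y (n ∸ m)) (suc n)) ≡ ((λ i → + f i) ⊛ (λ i → + g i)) n
  length-triples-series f g X Y #X #Y n = trans (cong +_ (trans (length-triples X (λ m → Y (n ∸ m)) (suc n))
    (cong sum (List.map-cong (λ m → cong₂ _*_ (#X m) (#Y (n ∸ m))) (upTo (suc n)))))) (+-convolution f g n)

  length-splitsH-through : ∀ j n → + length (splitsH-through j n) ≡ X (A (2 + j) ⊛ A⁺ (3 + j)) n
  length-splitsH-through j zero = refl
  length-splitsH-through j (suc n) = length-triples-series (#Av (2 + j)) (#Av⁺ (3 + j)) (AvList (2 + j)) (Av⁺List (3 + j)) (λ _ → refl) (λ _ → refl) n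

  H-rec : ∀ j → HS (3 + j) ≋ X (HS (2 + j) ⊛ A (3 + j)) ⊕ X (A (2 + j) ⊛ HS (3 + j)) ⊕ X (X (A (2 + j) ⊛ A⁺ (3 + j)))
  H-rec j zero = HS≋#Av₁ (3 + j) (s≤s z≤n) 0
  H-rec j (suc n) = begin
    HS (3 + j) (suc n)
      ≡⟨ HS≋#Av₁ (3 + j) (s≤s z≤n) (suc n) ⟩
    + #Av₁ (3 + j) (suc n)
      ≡⟨ cong +_ (trans (#Av₁-suc j n) (length-splitsH j n)) ⟩
    + length (splitsH-left j n) ℤ.+ (+ length (splitsH-right j n) ℤ.+ + length (splitsH-through j n))
      ≡⟨ ℤ.+-assoc (+ length (splitsH-left j n)) (+ length (splitsH-right j n)) (+ length (splitsH-through j n)) ⟨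
    + length (splitsH-left j n) ℤ.+ + length (splitsH-right j n) ℤ.+ + length (splitsH-through j n)
      ≡⟨ cong₂ ℤ._+_ (cong₂ ℤ._+_ left right) (length-splitsH-through j n) ⟩
    (HS (2 + j) ⊛ A (3 + j)) n ℤ.+ (A (2 + j) ⊛ HS (3 + j)) n ℤ.+ X (A (2 + j) ⊛ A⁺ (3 + j)) n
      ∎
    where
    open ≡-Reasoning
    #HS : ∀ k → 1 ≤ k → (λ n → + #Av₁ k n) ≋ HS k
    #HS k 1≤k n = sym (HS≋#Av₁ k 1≤k n)
    left : + length (splitsH-left j n) ≡ (HS (2 + j) ⊛ A (3 + j)) n
    left = trans (length-triples-series (#Av₁ (2 + j)) (#Av (3 + j)) (Av₁List (2 + j)) (AvList (3 + j)) (λ _ → refl) (λ _ → refl) n)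
                 (⊛-cong {g = A (3 + j)} {g′ = A (3 + j)} (#HS (2 + j) (s≤s z≤n)) (λ _ → refl) n)
    right : + length (splitsH-right j n) ≡ (A (2 + j) ⊛ HS (3 + j)) n
    right = trans (length-triples-series (#Av (2 + j)) (#Av₁ (3 + j)) (AvList (2 + j)) (Av₁List (3 + j)) (λ _ → refl) (λ _ → refl) n)
                  (⊛-cong {f = A (2 + j)} {f′ = A (2 + j)} (λ _ → refl) (#HS (3 + j) (s≤s z≤n)) n)

open import Data.Integer as ℤ using (ℤ; 0ℤ)
import Data.Integer.Properties as ℤ
open import Data.List using (applyUpTo)
open import Data.List.Properties using (map-applyUpTo)
open import Data.Nat using (ℕ; zero; suc; _+_; _∸_; _<_; _≤_; s≤s; z≤n)
open import Data.Nat.Properties using (+-∸-assoc; m+n∸n≡m; +-assoc; +-comm; ≤-trans; m≤m+n; m≤n+m)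
open import Function using (_∘_)
open import Relation.Binary.PropositionalEquality
open PowerSeries
open GeneratingFunctions
open CommutativeRing ⊛-commutativeRing using (+-cong; *-congˡ; zeroʳ; +-abelianGroup) renaming (trans to ≋-trans)
open import Algebra.Properties.AbelianGroup +-abelianGroup using (//-rightDividesˡ)
open RecurrenceSteps ⊛-commutativeRing using (ratio-step; weighted-step)
import Relation.Binary.Reasoning.Setoid ≋-setoid as ≋-Reasoning

shift-suc : ∀ a f → shift (suc a) f ≋ X (shift a f)
shift-suc a f zero = refl
shift-suc zero f (suc n) = refl
shift-suc (suc a) f (suc n) = refl

sumℤ-snoc : ∀ (G : ℕ → ℤ) j → sumℤ (applyUpTo G (suc j)) ≡ sumℤ (applyUpTo G j) ℤ.+ G j
sumℤ-snoc G zero = ℤ.+-comm (G 0) 0ℤ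
sumℤ-snoc G (suc j) = trans (cong (ℤ._+_ (G 0)) (sumℤ-snoc (G ∘ suc) j)) (sym (ℤ.+-assoc (G 0) _ _))

sumℤ-cong : ∀ {G G′ : ℕ → ℤ} j → (∀ {i} → i < j → G i ≡ G′ i) →
            sumℤ (applyUpTo G j) ≡ sumℤ (applyUpTo G′ j)
sumℤ-cong zero G≡G′ = refl
sumℤ-cong (suc j) G≡G′ = cong₂ ℤ._+_ (G≡G′ (s≤s z≤n)) (sumℤ-cong j (λ i<j → G≡G′ (s≤s i<j)))

sumℤ-zeros : ∀ j → sumℤ (applyUpTo (λ _ → 0ℤ) j) ≡ 0ℤ
sumℤ-zeros zero = refl
sumℤ-zeros (suc j) = trans (ℤ.+-identityˡ _) (sumℤ-zeros j)

rhsTerm : ℕ → ℕ → Series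
rhsTerm k i = shift (k + 1 ∸ suc i) (P (suc i) ⊛ P (suc i))

rhsNum-applyUpTo : ∀ k n → rhsNum k n ≡ sumℤ (applyUpTo (λ i → rhsTerm k i n) (k ∸ 2))
rhsNum-applyUpTo k n = cong sumℤ (map-applyUpTo suc _ (k ∸ 2))

rhsNum-X : ∀ j → rhsNum (3 + j) ≋ X (rhsNum (2 + j)) ⊕ X (X (X (P (1 + j) ⊛ P (1 + j))))
rhsNum-X j n = begin
  rhsNum (3 + j) n
    ≡⟨ rhsNum-applyUpTo (3 + j) n ⟩
  sumℤ (applyUpTo (λ i → rhsTerm (3 + j) i n) (suc j))
    ≡⟨ sumℤ-snoc (λ i → rhsTerm (3 + j) i n) j ⟩
  sumℤ (applyUpTo (λ i → rhsTerm (3 + j) i n) j) ℤ.+ rhsTerm (3 + j) j n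
    ≡⟨ cong₂ ℤ._+_ (sumℤ-cong j (λ i<j → earlier i<j n)) (last n) ⟩
  sumℤ (applyUpTo (λ i → X (rhsTerm (2 + j) i) n) j) ℤ.+ X (X (X Q)) n
    ≡⟨ cong (ℤ._+ X (X (X Q)) n) (sum-X n) ⟩
  X (rhsNum (2 + j)) n ℤ.+ X (X (X Q)) n
    ∎
  where
  open ≡-Reasoning
  Q = P (1 + j) ⊛ P (1 + j)
  earlier : ∀ {i} → i < j → rhsTerm (3 + j) i ≋ X (rhsTerm (2 + j) i)
  earlier {i} i<j m =
    trans (cong (λ a → shift a (P (suc i) ⊛ P (suc i)) m)
                (+-∸-assoc 1 (≤-trans i<j (≤-trans (m≤m+n j 1) (m≤n+m _ 2)))))
          (shift-suc (2 + j + 1 ∸ suc i) (P (suc i) ⊛ P (suc i)) m)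
  last : rhsTerm (3 + j) j ≋ X (X (X Q))
  last m = begin
    shift (3 + j + 1 ∸ suc j) Q m   ≡⟨ cong (λ a → shift (a ∸ suc j) Q m) (trans (+-assoc 3 j 1) (cong (3 +_) (+-comm j 1))) ⟩
    shift (3 + suc j ∸ suc j) Q m   ≡⟨ cong (λ a → shift a Q m) (m+n∸n≡m 3 (suc j)) ⟩
    shift 3 Q m                     ≡⟨ shift-suc 2 Q m ⟩
    X (shift 2 Q) m                 ≡⟨ X-cong (λ m′ → trans (shift-suc 1 Q m′) (X-cong (shift-suc 0 Q) m′)) m ⟩
    X (X (X Q)) m                   ∎
  sum-X : ∀ n → sumℤ (applyUpTo (λ i → X (rhsTerm (2 + j) i) n) j) ≡ X (rhsNum (2 + j)) n
  sum-X zero = sumℤ-zeros j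
  sum-X (suc n) = sym (rhsNum-applyUpTo (2 + j) n)

rhsNum-suc : ∀ j → rhsNum (3 + j) ≋ x ⊛ rhsNum (2 + j) ⊕ x ⊛ (x ⊛ (x ⊛ (P (1 + j) ⊛ P (1 + j))))
rhsNum-suc j = begin
  rhsNum (3 + j)                                    ≈⟨ rhsNum-X j ⟩
  X (rhsNum (2 + j)) ⊕ X (X (X Q))                  ≈⟨ +-cong (X≋x⊛ (rhsNum (2 + j))) X³≋x³ ⟩
  x ⊛ rhsNum (2 + j) ⊕ x ⊛ (x ⊛ (x ⊛ Q))           ∎
  where
  open ≋-Reasoning
  Q = P (1 + j) ⊛ P (1 + j)
  X³≋x³ : X (X (X Q)) ≋ x ⊛ (x ⊛ (x ⊛ Q))
  X³≋x³ = begin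
    X (X (X Q))           ≈⟨ X≋x⊛ (X (X Q)) ⟩
    x ⊛ X (X Q)           ≈⟨ *-congˡ {x} (X≋x⊛ (X Q)) ⟩
    x ⊛ (x ⊛ X Q)         ≈⟨ *-congˡ {x} (*-congˡ {x} (X≋x⊛ Q)) ⟩
    x ⊛ (x ⊛ (x ⊛ Q))     ∎

P-rec : ∀ j → P (2 + j) ⊕ x ⊛ P j ≋ P (1 + j)
P-rec j = begin
  P (2 + j) ⊕ x ⊛ P j   ≈⟨ +-cong {P (2 + j)} (λ _ → refl) (X≋x⊛ (P j)) ⟨
  P (2 + j) ⊕ X (P j)   ≈⟨ //-rightDividesˡ (X (P j)) (P (1 + j)) ⟩
  P (1 + j)             ∎
  where open ≋-Reasoning

P⊛A : ∀ j → P (1 + j) ⊛ A (1 + j) ≋ P j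
P⊛A zero = begin
  one ⊛ A 1   ≈⟨ ⊛-identityˡ (A 1) ⟩
  A 1         ≈⟨ A-one ⟩
  one         ∎
  where open ≋-Reasoning
P⊛A (suc j) = ratio-step {x = x} {P j} {P (1 + j)} {P (2 + j)} {A (1 + j)} (P-rec j) (P⊛A j) (begin
  A (2 + j)                           ≈⟨ A-rec j ⟩
  one ⊕ X (A (1 + j) ⊛ A (2 + j))     ≈⟨ +-cong {one} (λ _ → refl) (X≋x⊛ (A (1 + j) ⊛ A (2 + j))) ⟩
  one ⊕ x ⊛ (A (1 + j) ⊛ A (2 + j))   ∎)
  where open ≋-Reasoning

H-rec′ : ∀ j → HS (3 + j) ≋ x ⊛ (HS (2 + j) ⊛ A (3 + j)) ⊕ x ⊛ (A (2 + j) ⊛ HS (3 + j))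
                           ⊕ x ⊛ (x ⊛ (A (2 + j) ⊛ A⁺ (3 + j)))
H-rec′ j = begin
  HS (3 + j)   ≈⟨ H-rec j ⟩
  X (HS (2 + j) ⊛ A (3 + j)) ⊕ X (A (2 + j) ⊛ HS (3 + j)) ⊕ X (X (A (2 + j) ⊛ A⁺ (3 + j)))
    ≈⟨ +-cong (+-cong (X≋x⊛ (HS (2 + j) ⊛ A (3 + j))) (X≋x⊛ (A (2 + j) ⊛ HS (3 + j))))
              (≋-trans (X≋x⊛ (X AA⁺)) (*-congˡ {x} (X≋x⊛ AA⁺))) ⟩
  x ⊛ (HS (2 + j) ⊛ A (3 + j)) ⊕ x ⊛ (A (2 + j) ⊛ HS (3 + j)) ⊕ x ⊛ (x ⊛ (A (2 + j) ⊛ A⁺ (3 + j))) ∎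
  where
  open ≋-Reasoning
  AA⁺ = A (2 + j) ⊛ A⁺ (3 + j)

P²H≋rhsNum : ∀ j → P (2 + j) ⊛ (P (2 + j) ⊛ HS (2 + j)) ≋ rhsNum (2 + j)
P²H≋rhsNum zero = begin
  P 2 ⊛ (P 2 ⊛ HS 2)   ≈⟨ *-congˡ {P 2} (*-congˡ {P 2} H-two) ⟩
  P 2 ⊛ (P 2 ⊛ 𝟘)      ≈⟨ *-congˡ {P 2} (zeroʳ (P 2)) ⟩
  P 2 ⊛ 𝟘              ≈⟨ zeroʳ (P 2) ⟩
  𝟘                    ∎
  where open ≋-Reasoning
P²H≋rhsNum (suc j) = begin
  P (3 + j) ⊛ (P (3 + j) ⊛ HS (3 + j))
    ≈⟨ weighted-step {x = x} {P (1 + j)} {P (2 + j)} {P (3 + j)} {A (2 + j)} (P-rec (1 + j)) (P⊛A (1 + j))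
                    {A (3 + j)} {A⁺ (3 + j)} {HS (2 + j)} {HS (3 + j)} (P⊛A (2 + j)) (A⁺-one j) (H-rec′ j) ⟩
  x ⊛ (P (2 + j) ⊛ (P (2 + j) ⊛ HS (2 + j))) ⊕ x ⊛ (x ⊛ (x ⊛ (P (1 + j) ⊛ P (1 + j))))
    ≈⟨ +-cong (*-congˡ {x} (P²H≋rhsNum j)) (λ _ → refl) ⟩
  x ⊛ rhsNum (2 + j) ⊕ x ⊛ (x ⊛ (x ⊛ (P (1 + j) ⊛ P (1 + j))))
    ≈⟨ rhsNum-suc j ⟨
  rhsNum (3 + j)
    ∎
  where open ≋-Reasoning

theorem4p1 : (k : ℕ) → 2 ≤ k → (n : ℕ) →
    (P k ⊛ (P k ⊛ H (p12-3-k k))) n ≡ rhsNum k n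
theorem4p1 (suc (suc j)) (s≤s (s≤s z≤n)) = P²H≋rhsNum j
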